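{- Let $H$ and $K$ be finite simplicial complexes and $m\ge 1$. If $H<K$ and $o^m_{\mathbb{Z}}(H_\times)\neq 0$, then $o^m_{\mathbb{Z}}(K_\times)\neq 0$.
   Context: Minors: a set $T$ is a missing face of $K$ if $T\notin K$ but all proper subsets are in $K$. An admissible contraction identifies two distinct vertices $u,v$ of $K$ such that no missing face of $K$ of dimension $\le\dim K$ contains both, giving $K'=\{T: u\notin T\in K\}\cup\{(T\setminus\{u\})\cup\{v\}: u\in T\in K\}$; a deletion passes to a subcomplex; $H<K$ means $H$ is obtained from $K$ by a finite sequence of these. Van Kampen obstruction over $\mathbb{Z}$: $K_\times=\bigcup\{S\times T: S,T\in K,\ S\cap T=\emptyset\}$ with cellular chain complex $C_\bullet(K_\times)=\bigoplus\mathbb{Z}(S\times T)$, boundary $\partial(S\times T)=\partial S\times T+(-1)^{\dim S}S\times\partial T$, and $\mathbb{Z}_2$-action $\tau(S\times T)=(-1)^{\dim S\dim T}T\times S$. Let $C^\bullet=\mathrm{Hom}(C_\bullet,\mathbb{Z})$, $C^\bullet_s$ and $C^\bullet_a$ the subcomplexes of symmetric ($\tau c=c$) and antisymmetric ($\tau c=-c$) cochains with cohomologies $H_s,H_a$, and $H^m_{eq}=H^m_s$ for $m$ even, $H^m_a$ for $m$ odd. $o^m_{\mathbb{Z}}(K_\times)=i^*(z)\in H^m_{eq}(K_\times)$, where $i:K_\times\to S^\infty$ is the (unique up to equivariant homotopy) $\mathbb{Z}_2$-map and $z$ generates $H^m_{eq}(S^\infty)$; it is defined up to sign. Explicitly,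 fixing a total order $<$ on the vertices, it is represented by the cochain with $o^{2m}((1+\tau)(S\times T))=1$ if $s_0<t_0<\dots<s_m<t_m$ and $0$ otherwise, and $o^{2m+1}((1-\tau)(S\times T))=1$ if $t_0<s_0<t_1<\dots<t_m<s_m<t_{m+1}$ and $0$ otherwise, where $S=\{s_i\}$, $T=\{t_i\}$. -}

module Defs where

open import Data.Bool using (Bool; true; false; if_then_else_)
open import Data.Nat using (ℕ; zero; suc; _≤_; _∸_) renaming (_+_ to _+ℕ_; _*_ to _*ℕ_)
open import Data.Integer using (ℤ; _+_; _-_; _*_; -_; 0ℤ; 1ℤ)
open import Data.Fin using (Fin)
import Data.Fin as F
open import Data.Fin.Subset renaming (_-_ to _∖ₛ_) using (Subset; _∈_; _∉_; _⊆_; _⊂_; _∪_; ⁅_⁆; ∣_∣; Nonempty)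
open import Data.Vec using ([]; _∷_)
open import Data.List using (List; []; _∷_; _++_; map)
open import Data.Product using (Σ; _×_)
open import Data.Sum using (_⊎_)
open import Relation.Nullary using (¬_)
open import Relation.Binary.PropositionalEquality using (_≡_; _≢_)

-- Finite simplicial complexes on the vertex labels Fin n.
-- A complex is the predicate "S is a (nonempty) face".

SC : ℕ → Set₁
SC n = Subset n → Set

IsComplex : ∀ {n} → SC n → Set
IsComplex K =
  (∀ S → K S → Nonempty S) ×
  (∀ S T → K S → T ⊆ S → Nonempty T → K T)

MissingFace : ∀ {n} → SC n → Subset n → Set
MissingFace K T = ¬ K T × (∀ S → S ⊂ T → Nonempty S → K S)

-- admissible contraction of u to v:
-- u ≠ v vertices, and no missing face of dimension ≤ dim K contains both
-- (dim T ≤ dim K  ⇔  ∣T∣ ≤ ∣F∣ for some face F of K)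
Admissible : ∀ {n} → SC n → Fin n → Fin n → Set
Admissible K u v =
  u ≢ v × K ⁅ u ⁆ × K ⁅ v ⁆ ×
  ¬ (Σ (Subset _) λ T → MissingFace K T × u ∈ T × v ∈ T ×
       Σ (Subset _) λ F → K F × ∣ T ∣ ≤ ∣ F ∣)

Contract : ∀ {n} → Fin n → Fin n → SC n → SC n
Contract u v K T =
  (u ∉ T × K T) ⊎
  Σ (Subset _) λ T₀ → u ∈ T₀ × K T₀ × T ≡ ((T₀ ∖ₛ u) ∪ ⁅ v ⁆)

data _≼_ {n} : SC n → SC n → Set₁ where
  done     : ∀ {K} → K ≼ K
  contract : ∀ {H K} u v → Admissible K u v → H ≼ Contract u v K → H ≼ K
  delete   : ∀ {H K} L → IsComplex L → (∀ S → L S → K S) → H ≼ L → H ≼ K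

-- Cellular cochains of the deleted product K_×.
-- A cell S × T is a pair of disjoint faces; dim = ∣S∣ + ∣T∣ - 2.

Cell : ∀ {n} → SC n → ℕ → Subset n → Subset n → Set
Cell K d S T = K S × K T × (∀ x → x ∈ S → x ∉ T) × (∣ S ∣ +ℕ ∣ T ∣ ≡ suc (suc d))

-- a cochain: integer values on pairs (only values on cells matter)
Cochain : ℕ → Set
Cochain n = Subset n → Subset n → ℤ

neg1^ : ℕ → ℤ
neg1^ zero = 1ℤ
neg1^ (suc k) = - neg1^ k

elems : ∀ {n} → Subset n → List (Fin n)
elems [] = []
elems (true ∷ p) = F.zero ∷ map F.suc (elems p)
elems (false ∷ p) = map F.suc (elems p)

altSum : ∀ {A : Set} → List A → (A → ℤ) → ℤ
altSum [] g = 0ℤ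
altSum (x ∷ xs) g = g x - altSum xs g

-- f(∂S) for the simplicial boundary ∂S = Σ_i (-1)^i (S ∖ s_i)
-- (∂ of a vertex is 0)
faceSum : ∀ {n} → (Subset n → ℤ) → Subset n → ℤ
faceSum {n} f S = go ∣ S ∣
  where
  go : ℕ → ℤ
  go zero = 0ℤ
  go (suc zero) = 0ℤ
  go (suc (suc _)) = altSum (elems S) (λ s → f (S ∖ₛ s))

δ : ∀ {n} → Cochain n → Cochain n
δ e S T = faceSum (λ S' → e S' T) S + neg1^ (∣ S ∣ ∸ 1) * faceSum (λ T' → e S T') T

-- sign (-1)^{dim S · dim T} in τ(S × T) = (-1)^{dim S dim T} T × S
τsign : ∀ {n} → Subset n → Subset n → ℤ
τsign S T = neg1^ ((∣ S ∣ ∸ 1) *ℕ (∣ T ∣ ∸ 1))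

-- Equivariant cochains for H^m_eq: symmetric (τc = c) if m even,
-- antisymmetric (τc = -c) if m odd; condition imposed on d-cells.
-- (τc)(S×T) = τsign S T · c(T×S).
Equivariant : ∀ {n} → ℕ → SC n → ℕ → Cochain n → Set
Equivariant m K d c = ∀ S T → Cell K d S T → c S T ≡ neg1^ m * (τsign S T * c T S)

-- The explicit van Kampen obstruction cochain (natural order on Fin n).

data Tag : Set where
  L R : Tag   -- L : vertex of S,  R : vertex of T

word : ∀ {n} → Subset n → Subset n → List Tag
word [] [] = []
word (b ∷ S) (c ∷ T) =
  (if b then L ∷ [] else []) ++ ((if c then R ∷ [] else []) ++ word S T)

-- m = 2k   : s₀ < t₀ < … < s_k < t_k          ( (L R)^{k+1} )
-- m = 2k+1 : t₀ < s₀ < t₁ < … < s_k < t_{k+1}  ( R (L R)^{k+1} )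
pattern′ : ℕ → List Tag
pattern′ zero = L ∷ R ∷ []
pattern′ (suc zero) = R ∷ L ∷ R ∷ []
pattern′ (suc (suc m)) = pattern′ m ++ (L ∷ R ∷ [])

tagEq : Tag → Tag → Bool
tagEq L L = true
tagEq R R = true
tagEq _ _ = false

listEq : List Tag → List Tag → Bool
listEq [] [] = true
listEq (x ∷ xs) (y ∷ ys) = if tagEq x y then listEq xs ys else false
listEq _ _ = false

-- indicator of the orbit representative S × T
base : ∀ {n} → ℕ → Subset n → Subset n → ℤ
base m S T = if listEq (word S T) (pattern′ m) then 1ℤ else 0ℤ

-- o^m : value 1 on the orbit representatives S × T with the interleaving
-- pattern, extended (anti)symmetrically: o = base + (±τ) base
obs : ∀ {n} → ℕ → Cochain n
obs m S T = base m S T + neg1^ m * (τsign S T * base m T S)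

-- o^m_ℤ(K_×) ≠ 0 in H^m_eq(K_×): the cocycle o^m is not the coboundary
-- of any equivariant (m-1)-cochain of K_×
VKNonzero : ∀ {n} → ℕ → SC n → Set
VKNonzero m K =
  ¬ (Σ (Cochain _) λ e → Equivariant m K (m ∸ 1) e ×
       (∀ S T → Cell K m S T → δ e S T ≡ obs m S T))

{-# OPTIONS --safe #-}

-- The class o^m(K) vanishes when some equivariant (m-1)-cochain e of K_× has δe = o^m on the
-- m-cells, and each elementary step of H < K carries such an e for K to one for H.  For a
-- deletion we restrict e.  For a contraction of u onto v we first relabel the vertices by
-- adjacent transpositions until u = v + 1: swapping two adjacent vertices changes the explicit
-- cocycle o^m only by the coboundary of an explicit equivariant cochain, so vanishing does not
-- depend on the vertex order.  When u = v + 1 we add to e the coboundary of a cochain supported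
-- on the cells S × T with v ∈ S ∌ u; afterwards e takes the same value on S × T and on
-- (S - v + u) × T, so it descends to the contracted complex.  This uses that o^m vanishes on
-- S × T when S contains both u and v (they are adjacent in the merged order of S ∪ T), and
-- admissibility, which makes S + u a face whenever S and S - v + u are.  As the conclusion is a
-- negation, faces may be assumed decidable.

module Submission where

open import Data.Bool using (Bool; true; false; if_then_else_; _∧_; not)
import Data.Bool as Bool
import Data.Bool.Properties as BP
open import Data.Empty using (⊥-elim)
open import Data.Fin using (Fin; zero; suc; inject₁; toℕ; lower₁)
import Data.Fin.Properties as FP
open import Data.Fin.Subset using (Subset; _∈_; _∉_; _⊆_; _⊂_; _∪_; ⁅_⁆; ∣_∣; Nonempty) renaming (_-_ to _∖ₛ_)
import Data.Fin.Subset.Properties as SP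
open import Data.Integer using (ℤ; _+_; _-_; _*_; -_; 0ℤ; 1ℤ)
import Data.Integer.Properties as ℤP
open import Data.Integer.Tactic.RingSolver using (solve-∀)
open import Data.List using (List; []; _∷_; _++_; map; length)
import Data.List.Properties as LP
open import Data.Nat as ℕ using (ℕ; zero; suc; _∸_; _≤_) renaming (_+_ to _+ℕ_; _*_ to _*ℕ_)
import Data.Nat.Properties as ℕP
import Data.Nat.Tactic.RingSolver as ℕSolver
open import Data.Product using (Σ; _×_; _,_; proj₁; proj₂)
open import Data.Sum using (_⊎_; inj₁; inj₂)
open import Data.Vec using (Vec; []; _∷_; here; there)
open import Data.Vec.Relation.Binary.Pointwise.Inductive using (Pointwise; []; _∷_)
open import Defs
open import Function using (case_of_)
open import Relation.Binary using (tri<; tri≈; tri>)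
open import Relation.Binary.PropositionalEquality
open import Relation.Nullary using (¬_; Dec; yes; no)
open import Relation.Nullary.Decidable using (_×-dec_; ¬?)

neg1^-+ : ∀ a b → neg1^ (a +ℕ b) ≡ neg1^ a * neg1^ b
neg1^-+ zero b = sym (ℤP.*-identityˡ _)
neg1^-+ (suc a) b = trans (cong -_ (neg1^-+ a b)) (ℤP.neg-distribˡ-* (neg1^ a) (neg1^ b))

neg-square : ∀ x → (- x) * (- x) ≡ x * x
neg-square = solve-∀

neg1^-square : ∀ a → neg1^ a * neg1^ a ≡ 1ℤ
neg1^-square zero = refl
neg1^-square (suc a) = trans (neg-square (neg1^ a)) (neg1^-square a)

neg1^-double : ∀ a → neg1^ (a +ℕ a) ≡ 1ℤ
neg1^-double a = trans (neg1^-+ a a) (neg1^-square a)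

τsign-sym : ∀ {n} (X Y : Subset n) → τsign X Y ≡ τsign Y X
τsign-sym X Y = cong neg1^ (ℕP.*-comm (∣ X ∣ ∸ 1) (∣ Y ∣ ∸ 1))

τsign-square : ∀ {n} (X Y : Subset n) → τsign X Y * τsign Y X ≡ 1ℤ
τsign-square X Y = trans (cong (τsign X Y *_) (sym (τsign-sym X Y))) (neg1^-square ((∣ X ∣ ∸ 1) *ℕ (∣ Y ∣ ∸ 1)))

dimSign : ∀ {n} → Subset n → ℤ
dimSign S = neg1^ (∣ S ∣ ∸ 1)

-- Boundary sums over the faces of a subset

-- ∂ f S = Σᵢ (-1)ⁱ f (S - sᵢ) for the elements s₀ < s₁ < ... of S.
∂ : ∀ {n} → (Subset n → ℤ) → Subset n → ℤ
∂ f [] = 0ℤ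
∂ f (true ∷ S) = f (false ∷ S) - ∂ (λ X → f (true ∷ X)) S
∂ f (false ∷ S) = ∂ (λ X → f (false ∷ X)) S

remove : ∀ {n} → Subset n → Fin n → Subset n
remove (b ∷ S) zero = false ∷ S
remove (b ∷ S) (suc i) = b ∷ remove S i

∂-ext : ∀ {n} (f g : Subset n → ℤ) S → (∀ X → f X ≡ g X) → ∂ f S ≡ ∂ g S
∂-ext f g [] h = refl
∂-ext f g (true ∷ S) h = cong₂ _-_ (h _) (∂-ext _ _ S (λ X → h (true ∷ X)))
∂-ext f g (false ∷ S) h = ∂-ext _ _ S (λ X → h (false ∷ X))

∂-cong : ∀ {n} (f g : Subset n → ℤ) S → (∀ i → i ∈ S → f (remove S i) ≡ g (remove S i)) → ∂ f S ≡ ∂ g S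
∂-cong f g [] h = refl
∂-cong f g (true ∷ S) h = cong₂ _-_ (h zero here) (∂-cong _ _ S (λ i i∈ → h (suc i) (there i∈)))
∂-cong f g (false ∷ S) h = ∂-cong _ _ S (λ i i∈ → h (suc i) (there i∈))

∂-0 : ∀ {n} (S : Subset n) → ∂ (λ _ → 0ℤ) S ≡ 0ℤ
∂-0 [] = refl
∂-0 (true ∷ S) = cong (λ z → 0ℤ - z) (∂-0 S)
∂-0 (false ∷ S) = ∂-0 S

∂-+ : ∀ {n} (f g : Subset n → ℤ) S → ∂ (λ X → f X + g X) S ≡ ∂ f S + ∂ g S
∂-+ f g [] = refl
∂-+ f g (true ∷ S) = trans (cong (λ z → f (false ∷ S) + g (false ∷ S) - z) (∂-+ _ _ S))
  (interchange (f (false ∷ S)) (g (false ∷ S)) (∂ (λ X → f (true ∷ X)) S) (∂ (λ X → g (true ∷ X)) S))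
  where
  interchange : ∀ a b c d → a + b - (c + d) ≡ a - c + (b - d)
  interchange = solve-∀
∂-+ f g (false ∷ S) = ∂-+ _ _ S

∂-* : ∀ {n} (c : ℤ) (f : Subset n → ℤ) S → ∂ (λ X → c * f X) S ≡ c * ∂ f S
∂-* c f [] = sym (ℤP.*-zeroʳ c)
∂-* c f (true ∷ S) = trans (cong (λ z → c * f (false ∷ S) - z) (∂-* c _ S))
    (distrib c (f (false ∷ S)) (∂ (λ X → f (true ∷ X)) S))
  where
  distrib : ∀ c a b → c * a - c * b ≡ c * (a - b)
  distrib = solve-∀
∂-* c f (false ∷ S) = ∂-* c _ S

∂-neg : ∀ {n} (f : Subset n → ℤ) S → ∂ (λ X → - f X) S ≡ - ∂ f S
∂-neg f S = trans (∂-ext _ _ S (λ X → sym (ℤP.-1*i≡-i (f X)))) (trans (∂-* (- 1ℤ) f S) (ℤP.-1*i≡-i _))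

∂-sub : ∀ {n} (f g : Subset n → ℤ) S → ∂ (λ X → f X - g X) S ≡ ∂ f S - ∂ g S
∂-sub f g S = trans (∂-+ f (λ X → - g X) S) (cong (∂ f S +_) (∂-neg g S))

∂∂≡0 : ∀ {n} (f : Subset n → ℤ) S → ∂ (λ X → ∂ f X) S ≡ 0ℤ
∂∂≡0 f [] = refl
∂∂≡0 f (true ∷ S) =
  trans (cong (λ z → ∂ (λ X → f (false ∷ X)) S - z)
    (trans (∂-sub (λ X → f (false ∷ X)) (λ X → ∂ (λ Y → f (true ∷ Y)) X) S)
           (cong (λ z → ∂ (λ X → f (false ∷ X)) S - z) (∂∂≡0 _ S))))
  (cancel (∂ (λ X → f (false ∷ X)) S))
  where
  cancel : ∀ a → a - (a - 0ℤ) ≡ 0ℤ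
  cancel = solve-∀
∂∂≡0 f (false ∷ S) = ∂∂≡0 _ S

∂-comm : ∀ {n m} (k : Subset n → Subset m → ℤ) S T →
  ∂ (λ X → ∂ (λ Y → k X Y) T) S ≡ ∂ (λ Y → ∂ (λ X → k X Y) S) T
∂-comm k [] T = sym (∂-0 T)
∂-comm k (true ∷ S) T =
  trans (cong (λ z → ∂ (λ Y → k (false ∷ S) Y) T - z) (∂-comm (λ X Y → k (true ∷ X) Y) S T))
        (sym (∂-sub _ _ T))
∂-comm k (false ∷ S) T = ∂-comm _ S T

∂-vanishing : ∀ {n} (f : Subset n → ℤ) S → (∀ X → f X ≡ 0ℤ) → ∂ f S ≡ 0ℤ
∂-vanishing f S h = trans (∂-ext f (λ _ → 0ℤ) S h) (∂-0 S)

∂-vanishingOnFaces : ∀ {n} {f : Subset n → ℤ} S → (∀ i → i ∈ S → f (remove S i) ≡ 0ℤ) → ∂ f S ≡ 0ℤ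
∂-vanishingOnFaces S h = trans (∂-cong _ (λ _ → 0ℤ) S h) (∂-0 S)

card-remove : ∀ {n} (S : Subset n) i → i ∈ S → suc ∣ remove S i ∣ ≡ ∣ S ∣
card-remove (true ∷ S) zero here = refl
card-remove (true ∷ S) (suc i) (there p) = cong suc (card-remove S i p)
card-remove (false ∷ S) (suc i) (there p) = card-remove S i p

∖ₛ≡remove : ∀ {n} (S : Subset n) i → S ∖ₛ i ≡ remove S i
∖ₛ≡remove (b ∷ S) zero = cong (false ∷_) (SP.p─⊥≡p S)
∖ₛ≡remove (b ∷ S) (suc i) = cong (b ∷_) (∖ₛ≡remove S i)

remove-⊆ : ∀ {n} (S : Subset n) i → remove S i ⊆ S
remove-⊆ S i m = SP.p─q⊆p S ⁅ i ⁆ (subst (_ ∈_) (sym (∖ₛ≡remove S i)) m)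

-- The coboundary on cochains vanishing on the empty set

nonemptyᵇ : ∀ {n} → Subset n → Bool
nonemptyᵇ [] = false
nonemptyᵇ (true ∷ S) = true
nonemptyᵇ (false ∷ S) = nonemptyᵇ S

nonemptyᵇ-card0 : ∀ {n} (S : Subset n) → ∣ S ∣ ≡ 0 → nonemptyᵇ S ≡ false
nonemptyᵇ-card0 [] eq = refl
nonemptyᵇ-card0 (true ∷ S) ()
nonemptyᵇ-card0 (false ∷ S) eq = nonemptyᵇ-card0 S eq

nonemptyᵇ-cardsuc : ∀ {n k} (S : Subset n) → ∣ S ∣ ≡ suc k → nonemptyᵇ S ≡ true
nonemptyᵇ-cardsuc (true ∷ S) eq = refl
nonemptyᵇ-cardsuc (false ∷ S) eq = nonemptyᵇ-cardsuc S eq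

nonemptyᵇ-Nonempty : ∀ {n} (S : Subset n) → Nonempty S → nonemptyᵇ S ≡ true
nonemptyᵇ-Nonempty (true ∷ S) _ = refl
nonemptyᵇ-Nonempty (false ∷ S) (suc i , there p) = nonemptyᵇ-Nonempty S (i , p)

Nonempty-nonemptyᵇ : ∀ {n} (X : Subset n) → nonemptyᵇ X ≡ true → Nonempty X
Nonempty-nonemptyᵇ (true ∷ X) h = zero , here
Nonempty-nonemptyᵇ (false ∷ X) h with Nonempty-nonemptyᵇ X h
... | i , m = suc i , there m

nonemptyᵇ-false-∉ : ∀ {n} (S : Subset n) i → nonemptyᵇ S ≡ false → i ∉ S
nonemptyᵇ-false-∉ (true ∷ S) i () p
nonemptyᵇ-false-∉ (false ∷ S) (suc i) eq (there p) = nonemptyᵇ-false-∉ S i eq p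

∂-empty : ∀ {n} (f : Subset n → ℤ) S → nonemptyᵇ S ≡ false → ∂ f S ≡ 0ℤ
∂-empty f S eq = ∂-vanishingOnFaces S (λ i i∈ → ⊥-elim (nonemptyᵇ-false-∉ S i eq i∈))

∂-small : ∀ {n} (f : Subset n → ℤ) S → (∀ X → nonemptyᵇ X ≡ false → f X ≡ 0ℤ) → ∣ S ∣ ≤ 1 → ∂ f S ≡ 0ℤ
∂-small f S hf le = ∂-vanishingOnFaces S (λ i i∈ → hf (remove S i) (nonemptyᵇ-card0 (remove S i)
  (ℕP.n≤0⇒n≡0 (ℕP.≤-pred (subst (_≤ 1) (sym (card-remove S i i∈)) le)))))

VanishesOnEmpty : ∀ {n} → Cochain n → Set
VanishesOnEmpty e = (∀ X Y → nonemptyᵇ X ≡ false → e X Y ≡ 0ℤ) × (∀ X Y → nonemptyᵇ Y ≡ false → e X Y ≡ 0ℤ)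

vanishes-+ : ∀ {n} (f g : Cochain n) → VanishesOnEmpty f → VanishesOnEmpty g → VanishesOnEmpty (λ X Y → f X Y + g X Y)
vanishes-+ f g (f1 , f2) (g1 , g2) = (λ X Y h → cong₂ _+_ (f1 X Y h) (g1 X Y h)) ,
    (λ X Y h → cong₂ _+_ (f2 X Y h) (g2 X Y h))

mask : ∀ {n} → Cochain n → Cochain n
mask e S T = if nonemptyᵇ S then (if nonemptyᵇ T then e S T else 0ℤ) else 0ℤ

mask-vanishes : ∀ {n} (e : Cochain n) → VanishesOnEmpty (mask e)
mask-vanishes e = vanishesˡ , vanishesʳ
  where
  vanishesˡ : ∀ X Y → nonemptyᵇ X ≡ false → mask e X Y ≡ 0ℤ
  vanishesˡ X Y eq rewrite eq = refl
  vanishesʳ : ∀ X Y → nonemptyᵇ Y ≡ false → mask e X Y ≡ 0ℤ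
  vanishesʳ X Y eq with nonemptyᵇ X
  ... | false = refl
  ... | true rewrite eq = refl

mask-id : ∀ {n} (e : Cochain n) → VanishesOnEmpty e → ∀ X Y → mask e X Y ≡ e X Y
mask-id e (m1 , m2) X Y with nonemptyᵇ X in eqX
... | false = sym (m1 X Y eqX)
... | true with nonemptyᵇ Y in eqY
... | false = sym (m2 X Y eqY)
... | true = refl

mask-nonempty : ∀ {n} (e : Cochain n) S T → Nonempty S → Nonempty T → mask e S T ≡ e S T
mask-nonempty e S T neS neT rewrite nonemptyᵇ-Nonempty S neS | nonemptyᵇ-Nonempty T neT = refl

δ′ : ∀ {n} → Cochain n → Cochain n
δ′ e S T = ∂ (λ X → e X T) S + dimSign S * ∂ (λ Y → e S Y) T

δ′-ext : ∀ {n} (f g : Cochain n) S T → (∀ X Y → f X Y ≡ g X Y) → δ′ f S T ≡ δ′ g S T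
δ′-ext f g S T h = cong₂ (λ a b → a + dimSign S * b) (∂-ext _ _ S (λ X → h X T)) (∂-ext _ _ T (λ Y → h S Y))

δ′-cong : ∀ {n} (f g : Cochain n) S T →
  (∀ i → i ∈ S → f (remove S i) T ≡ g (remove S i) T) → (∀ i → i ∈ T → f S (remove T i) ≡ g S (remove T i)) →
  δ′ f S T ≡ δ′ g S T
δ′-cong f g S T hS hT = cong₂ (λ x y → x + dimSign S * y) (∂-cong _ _ S hS) (∂-cong _ _ T hT)

δ′-+ : ∀ {n} (f g : Cochain n) S T → δ′ (λ X Y → f X Y + g X Y) S T ≡ δ′ f S T + δ′ g S T
δ′-+ f g S T = trans (cong₂ (λ x y → x + dimSign S * y) (∂-+ (λ X → f X T) (λ X → g X T) S) (∂-+ (f S) (g S) T))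
  (interchange (∂ (λ X → f X T) S) (∂ (λ X → g X T) S) (∂ (f S) T) (∂ (g S) T) (dimSign S))
  where
  interchange : ∀ a b c d s → a + b + s * (c + d) ≡ a + s * c + (b + s * d)
  interchange = solve-∀

δ′-zero : ∀ {n} (f : Cochain n) S T → ∂ (λ X → f X T) S ≡ 0ℤ → ∂ (f S) T ≡ 0ℤ → δ′ f S T ≡ 0ℤ
δ′-zero f S T h1 h2 = trans (cong₂ (λ x y → x + dimSign S * y) h1 h2)
    (trans (ℤP.+-identityˡ _) (ℤP.*-zeroʳ (dimSign S)))

δ′-vanishes : ∀ {n} (e : Cochain n) → VanishesOnEmpty e → VanishesOnEmpty (δ′ e)
δ′-vanishes e (m1 , m2) =
  (λ X Y eq → δ′-zero e X Y (∂-empty _ X eq) (∂-vanishing _ Y (λ Y' → m1 X Y' eq))) ,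
  (λ X Y eq → δ′-zero e X Y (∂-vanishing _ X (λ X' → m2 X' Y eq)) (∂-empty _ Y eq))

altSum-ext : ∀ {A : Set} (xs : List A) (f g : A → ℤ) → (∀ x → f x ≡ g x) → altSum xs f ≡ altSum xs g
altSum-ext [] f g h = refl
altSum-ext (x ∷ xs) f g h = cong₂ _-_ (h x) (altSum-ext xs f g h)

altSum-map-suc : ∀ {n} (xs : List (Fin n)) (g : Fin (suc n) → ℤ) → altSum (map suc xs) g ≡ altSum xs (λ s → g (suc s))
altSum-map-suc [] g = refl
altSum-map-suc (x ∷ xs) g = cong (λ z → g (suc x) - z) (altSum-map-suc xs g)

altSum-remove : ∀ {n} (f : Subset n → ℤ) S → altSum (elems S) (λ s → f (remove S s)) ≡ ∂ f S
altSum-remove f [] = refl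
altSum-remove f (true ∷ S) = cong (λ z → f (false ∷ S) - z)
  (trans (altSum-map-suc (elems S) (λ s → f (remove (true ∷ S) s))) (altSum-remove (λ X → f (true ∷ X)) S))
altSum-remove f (false ∷ S) =
  trans (altSum-map-suc (elems S) (λ s → f (remove (false ∷ S) s))) (altSum-remove (λ X → f (false ∷ X)) S)

maskSet : ∀ {n} → (Subset n → ℤ) → Subset n → ℤ
maskSet f X = if nonemptyᵇ X then f X else 0ℤ

faceSum≡∂ : ∀ {n} (f : Subset n → ℤ) S → faceSum f S ≡ ∂ (maskSet f) S
faceSum≡∂ f S with ∣ S ∣ in eq
... | zero = sym (∂-small (maskSet f) S (λ X e → cong (if_then f X else 0ℤ) e) (ℕP.≤-trans (ℕP.≤-reflexive eq) ℕ.z≤n))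
... | suc zero = sym (∂-small (maskSet f) S (λ X e → cong (if_then f X else 0ℤ) e) (ℕP.≤-reflexive eq))
... | suc (suc k) = trans (altSum-ext (elems S) _ _ (λ s → cong f (∖ₛ≡remove S s)))
      (trans (altSum-remove f S) (∂-cong f (maskSet f) S
        (λ i i∈ → cong (if_then f (remove S i) else 0ℤ)
           (sym (nonemptyᵇ-cardsuc (remove S i) (ℕP.suc-injective (trans (card-remove S i i∈) eq)))))))

δ≡δ′-mask : ∀ {n} (e : Cochain n) S T → Nonempty S → Nonempty T → δ e S T ≡ δ′ (mask e) S T
δ≡δ′-mask e S T neS neT = cong₂ (λ a b → a + dimSign S * b)
  (trans (faceSum≡∂ (λ S' → e S' T) S) (∂-ext _ _ S maskˡ))
  (trans (faceSum≡∂ (λ T' → e S T') T) (∂-ext _ _ T maskʳ))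
  where
  maskˡ : ∀ X → maskSet (λ S' → e S' T) X ≡ mask e X T
  maskˡ X with nonemptyᵇ X
  ... | false = refl
  ... | true rewrite nonemptyᵇ-Nonempty T neT = refl
  maskʳ : ∀ Y → maskSet (λ T' → e S T') Y ≡ mask e S Y
  maskʳ Y rewrite nonemptyᵇ-Nonempty S neS = refl

∂-dimSign : ∀ {n} (g : Subset n → ℤ) S → (∀ X → nonemptyᵇ X ≡ false → g X ≡ 0ℤ) →
  ∂ (λ X → dimSign X * g X) S ≡ - (dimSign S * ∂ g S)
∂-dimSign g S hg = trans (∂-cong _ (λ X → (- dimSign S) * g X) S faceSign)
  (trans (∂-* (- dimSign S) g S) (sym (ℤP.neg-distribˡ-* (dimSign S) (∂ g S))))
  where
  faceSign : ∀ i → i ∈ S → dimSign (remove S i) * g (remove S i) ≡ (- dimSign S) * g (remove S i)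
  faceSign i i∈ = bySize ∣ remove S i ∣ refl
    where
    bySize : ∀ r → ∣ remove S i ∣ ≡ r → dimSign (remove S i) * g (remove S i) ≡ (- dimSign S) * g (remove S i)
    bySize zero e = trans (cong (dimSign (remove S i) *_) g0)
      (trans (ℤP.*-zeroʳ (dimSign (remove S i))) (sym (trans (cong ((- dimSign S) *_) g0) (ℤP.*-zeroʳ (- dimSign S)))))
      where
      g0 : g (remove S i) ≡ 0ℤ
      g0 = hg (remove S i) (nonemptyᵇ-card0 (remove S i) e)
    bySize (suc r) e = cong (_* g (remove S i)) (begin
      neg1^ (∣ remove S i ∣ ∸ 1)   ≡⟨ cong (λ z → neg1^ (z ∸ 1)) e ⟩
      neg1^ r                      ≡⟨ sym (ℤP.neg-involutive _) ⟩
      - neg1^ (suc r)              ≡⟨ cong (λ z → - neg1^ (z ∸ 1)) (trans (cong suc (sym e)) (card-remove S i i∈)) ⟩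
      - dimSign S                  ∎)
      where open ≡-Reasoning

δ′δ′≡0 : ∀ {n} (k : Cochain n) → VanishesOnEmpty k → ∀ S T → δ′ (δ′ k) S T ≡ 0ℤ
δ′δ′≡0 k (m1 , _) S T = begin
  ∂ (λ X → δ′ k X T) S + σ * ∂ (λ Y → δ′ k S Y) T
    ≡⟨ cong₂ (λ a b → a + σ * b) (∂-+ (λ X → ∂ (λ X′ → k X′ T) X) _ S) (∂-+ (λ Y → ∂ (λ X → k X Y) S) _ T) ⟩
  (∂ (λ X → ∂ (λ X′ → k X′ T) X) S + ∂ (λ X → dimSign X * ∂ (k X) T) S)
    + σ * (∂ (λ Y → ∂ (λ X → k X Y) S) T + ∂ (λ Y → σ * ∂ (k S) Y) T)
    ≡⟨ cong₂ (λ a b → a + σ * b)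
         (cong₂ _+_ (∂∂≡0 _ S) (∂-dimSign (λ X → ∂ (k X) T) S (λ X eq → ∂-vanishing _ T (λ Y → m1 X Y eq))))
         (cong₂ _+_ (sym (∂-comm k S T)) (trans (∂-* σ _ T) (cong (σ *_) (∂∂≡0 _ T)))) ⟩
  (0ℤ + - (σ * P)) + σ * (P + σ * 0ℤ)
    ≡⟨ cancel σ P ⟩
  0ℤ ∎
  where
  open ≡-Reasoning
  σ = dimSign S
  P = ∂ (λ X → ∂ (k X) T) S
  cancel : ∀ s z → (0ℤ + - (s * z)) + s * (z + s * 0ℤ) ≡ 0ℤ
  cancel = solve-∀

τsign-faceʳ : ∀ s t → t ≤ 1 ⊎ s ≡ 0 ⊎ neg1^ ((s ∸ 1) *ℕ (t ∸ 1)) * neg1^ ((t ∸ 1 ∸ 1) *ℕ (s ∸ 1)) ≡ neg1^ (s ∸ 1)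
τsign-faceʳ s zero = inj₁ ℕ.z≤n
τsign-faceʳ s (suc zero) = inj₁ (ℕ.s≤s ℕ.z≤n)
τsign-faceʳ zero (suc (suc t)) = inj₂ (inj₁ refl)
τsign-faceʳ (suc s) (suc (suc t)) = inj₂ (inj₂ (begin
  neg1^ (s *ℕ suc t) * neg1^ (t *ℕ s)        ≡⟨ sym (neg1^-+ (s *ℕ suc t) (t *ℕ s)) ⟩
  neg1^ (s *ℕ suc t +ℕ t *ℕ s)               ≡⟨ cong neg1^ (exponent s t) ⟩
  neg1^ (s +ℕ (s *ℕ t +ℕ s *ℕ t))            ≡⟨ neg1^-+ s _ ⟩
  neg1^ s * neg1^ (s *ℕ t +ℕ s *ℕ t)         ≡⟨ cong (neg1^ s *_) (neg1^-double (s *ℕ t)) ⟩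
  neg1^ s * 1ℤ                               ≡⟨ ℤP.*-identityʳ _ ⟩
  neg1^ s                                    ∎))
  where
  open ≡-Reasoning
  exponent : ∀ s t → s *ℕ suc t +ℕ t *ℕ s ≡ s +ℕ (s *ℕ t +ℕ s *ℕ t)
  exponent = ℕSolver.solve-∀

τsign-faceˡ : ∀ s t → s ≤ 1 ⊎ t ≡ 0 ⊎ neg1^ ((s ∸ 1) *ℕ (t ∸ 1)) * neg1^ (t ∸ 1) * neg1^ ((t ∸ 1) *ℕ (s ∸ 1 ∸ 1)) ≡ 1ℤ
τsign-faceˡ zero t = inj₁ ℕ.z≤n
τsign-faceˡ (suc zero) t = inj₁ (ℕ.s≤s ℕ.z≤n)
τsign-faceˡ (suc (suc s)) zero = inj₂ (inj₁ refl)
τsign-faceˡ (suc (suc s)) (suc t) = inj₂ (inj₂ (begin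
  neg1^ (suc s *ℕ t) * neg1^ t * neg1^ (t *ℕ s)   ≡⟨ cong (_* neg1^ (t *ℕ s)) (sym (neg1^-+ (suc s *ℕ t) t)) ⟩
  neg1^ (suc s *ℕ t +ℕ t) * neg1^ (t *ℕ s)        ≡⟨ sym (neg1^-+ (suc s *ℕ t +ℕ t) (t *ℕ s)) ⟩
  neg1^ (suc s *ℕ t +ℕ t +ℕ t *ℕ s)               ≡⟨ cong neg1^ (exponent s t) ⟩
  neg1^ ((t +ℕ s *ℕ t) +ℕ (t +ℕ s *ℕ t))          ≡⟨ neg1^-double (t +ℕ s *ℕ t) ⟩
  1ℤ                                              ∎))
  where
  open ≡-Reasoning
  exponent : ∀ s t → suc s *ℕ t +ℕ t +ℕ t *ℕ s ≡ (t +ℕ s *ℕ t) +ℕ (t +ℕ s *ℕ t)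
  exponent = ℕSolver.solve-∀

*-congʳ-unless0 : ∀ {x y} B → B ≡ 0ℤ ⊎ x ≡ y → x * B ≡ y * B
*-congʳ-unless0 {x} {y} B (inj₁ refl) = trans (ℤP.*-zeroʳ x) (sym (ℤP.*-zeroʳ y))
*-congʳ-unless0 B (inj₂ refl) = refl

card-remove′ : ∀ {n} (S : Subset n) i → i ∈ S → ∣ remove S i ∣ ≡ ∣ S ∣ ∸ 1
card-remove′ S i i∈ = cong (_∸ 1) (card-remove S i i∈)

δ′-equivariant : ∀ {n} (ε : ℤ) (k : Cochain n) S T → ε * ε ≡ 1ℤ → VanishesOnEmpty k →
  (∀ i → i ∈ S → k T (remove S i) ≡ ε * (τsign T (remove S i) * k (remove S i) T)) →
  (∀ i → i ∈ T → k (remove T i) S ≡ ε * (τsign (remove T i) S * k S (remove T i))) →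
  δ′ k S T ≡ ε * (τsign S T * δ′ k T S)
δ′-equivariant ε k S T εε (m1 , m2) hS hT = begin
  A + dimSign S * B                                     ≡⟨ cong₂ _+_ (sym signA) (sym signB) ⟩
  τ * dimSign T * c2 * A + τ * c1 * B                   ≡⟨ sym (ℤP.*-identityˡ _) ⟩
  1ℤ * (τ * dimSign T * c2 * A + τ * c1 * B)            ≡⟨ cong (_* (τ * dimSign T * c2 * A + τ * c1 * B)) (sym εε) ⟩
  ε * ε * (τ * dimSign T * c2 * A + τ * c1 * B)         ≡⟨ regroup ε τ c1 c2 (dimSign T) A B ⟩
  ε * (τ * (ε * (c1 * B) + dimSign T * (ε * (c2 * A))))
      ≡⟨ cong (λ z → ε * (τ * z)) (sym (cong₂ (λ a b → a + dimSign T * b) stepT stepS)) ⟩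
  ε * (τ * δ′ k T S)                                    ∎
  where
  open ≡-Reasoning
  s = ∣ S ∣
  t = ∣ T ∣
  τ = τsign S T
  c1 = neg1^ ((t ∸ 1 ∸ 1) *ℕ (s ∸ 1))
  c2 = neg1^ ((t ∸ 1) *ℕ (s ∸ 1 ∸ 1))
  A = ∂ (λ X → k X T) S
  B = ∂ (λ Y → k S Y) T
  stepT : ∂ (λ X → k X S) T ≡ ε * (c1 * B)
  stepT = trans (∂-cong _ (λ X → ε * (c1 * k S X)) T
             (λ i i∈ → trans (hT i i∈)
                 (cong (λ z → ε * (neg1^ ((z ∸ 1) *ℕ (s ∸ 1)) * k S (remove T i))) (card-remove′ T i i∈))))
          (trans (∂-* ε _ T) (cong (ε *_) (∂-* c1 _ T)))
  stepS : ∂ (λ Y → k T Y) S ≡ ε * (c2 * A)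
  stepS = trans (∂-cong _ (λ Y → ε * (c2 * k Y T)) S
             (λ i i∈ → trans (hS i i∈)
                 (cong (λ z → ε * (neg1^ ((t ∸ 1) *ℕ (z ∸ 1)) * k (remove S i) T)) (card-remove′ S i i∈))))
          (trans (∂-* ε _ S) (cong (ε *_) (∂-* c2 _ S)))
  signB : τ * c1 * B ≡ dimSign S * B
  signB = *-congʳ-unless0 B (case (τsign-faceʳ s t))
    where
    case : t ≤ 1 ⊎ s ≡ 0 ⊎ τ * c1 ≡ dimSign S → B ≡ 0ℤ ⊎ τ * c1 ≡ dimSign S
    case (inj₁ t≤1) = inj₁ (∂-small _ T (λ X eq → m2 S X eq) t≤1)
    case (inj₂ (inj₁ s≡0)) = inj₁ (∂-vanishing _ T (λ Y → m1 S Y (nonemptyᵇ-card0 S s≡0)))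
    case (inj₂ (inj₂ p)) = inj₂ p
  signA : τ * dimSign T * c2 * A ≡ A
  signA = trans (*-congʳ-unless0 A (case (τsign-faceˡ s t))) (ℤP.*-identityˡ A)
    where
    case : s ≤ 1 ⊎ t ≡ 0 ⊎ τ * dimSign T * c2 ≡ 1ℤ → A ≡ 0ℤ ⊎ τ * dimSign T * c2 ≡ 1ℤ
    case (inj₁ s≤1) = inj₁ (∂-small _ S (λ X eq → m1 X T eq) s≤1)
    case (inj₂ (inj₁ t≡0)) = inj₁ (∂-vanishing _ S (λ X → m2 X T (nonemptyᵇ-card0 T t≡0)))
    case (inj₂ (inj₂ p)) = inj₂ p
  regroup : ∀ ε τ c1 c2 σ A B →
    ε * ε * (τ * σ * c2 * A + τ * c1 * B) ≡ ε * (τ * (ε * (c1 * B) + σ * (ε * (c2 * A))))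
  regroup = solve-∀

Cell-swap : ∀ {n} {K : SC n} {d S T} → Cell K d S T → Cell K d T S
Cell-swap {S = S} {T} (KS , KT , dj , c) = KT , KS , (λ x xT xS → dj x xS xT) , trans (ℕP.+-comm ∣ T ∣ ∣ S ∣) c

Cell-mono : ∀ {n} {K L : SC n} {d S T} → (∀ X → L X → K X) → Cell L d S T → Cell K d S T
Cell-mono sub (LS , LT , dj , c) = sub _ LS , sub _ LT , dj , c

Cell-faceˡ : ∀ {n} {K : SC n} {m S T} → IsComplex K → 1 ≤ m → Cell K m S T →
  ∀ i → i ∈ S → nonemptyᵇ (remove S i) ≡ true → Cell K (m ∸ 1) (remove S i) T
Cell-faceˡ {m = suc m} {S} {T} cx _ (KS , KT , dj , c) i i∈ h =
  proj₂ cx S (remove S i) KS (remove-⊆ S i) (Nonempty-nonemptyᵇ _ h) , KT , (λ x m' → dj x (remove-⊆ S i m')) ,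
  ℕP.suc-injective (trans (cong (_+ℕ ∣ T ∣) (card-remove S i i∈)) c)

Cell-faceʳ : ∀ {n} {K : SC n} {m S T} → IsComplex K → 1 ≤ m → Cell K m S T →
  ∀ i → i ∈ T → nonemptyᵇ (remove T i) ≡ true → Cell K (m ∸ 1) S (remove T i)
Cell-faceʳ cx le c i i∈ h = Cell-swap (Cell-faceˡ cx le (Cell-swap c) i i∈ h)

zero-equivariant : ∀ {x y} ε τ → x ≡ 0ℤ → y ≡ 0ℤ → x ≡ ε * (τ * y)
zero-equivariant ε τ refl refl = sym (trans (cong (ε *_) (ℤP.*-zeroʳ τ)) (ℤP.*-zeroʳ ε))

δ′-equivariant-cell : ∀ {n} {K : SC n} {m e S T} → IsComplex K → 1 ≤ m → Equivariant m K (m ∸ 1) e →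
  VanishesOnEmpty e → Cell K m S T → δ′ e S T ≡ neg1^ m * (τsign S T * δ′ e T S)
δ′-equivariant-cell {m = m} {e} {S} {T} cx le eq (m1 , m2) c =
  δ′-equivariant (neg1^ m) e S T (neg1^-square m) (m1 , m2) faceˡ faceʳ
  where
  faceˡ : ∀ i → i ∈ S → e T (remove S i) ≡ neg1^ m * (τsign T (remove S i) * e (remove S i) T)
  faceˡ i i∈ with nonemptyᵇ (remove S i) in h
  ... | true = eq T (remove S i) (Cell-swap (Cell-faceˡ cx le c i i∈ h))
  ... | false = zero-equivariant (neg1^ m) (τsign T (remove S i)) (m2 T _ h) (m1 _ T h)
  faceʳ : ∀ i → i ∈ T → e (remove T i) S ≡ neg1^ m * (τsign (remove T i) S * e S (remove T i))
  faceʳ i i∈ with nonemptyᵇ (remove T i) in h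
  ... | true = eq (remove T i) S (Cell-swap (Cell-faceʳ cx le c i i∈ h))
  ... | false = zero-equivariant (neg1^ m) (τsign (remove T i) S) (m1 _ S h) (m2 S _ h)

Cobounds : ∀ {n} → ℕ → SC n → Cochain n → Set
Cobounds m K e = ∀ S T → Cell K m S T → δ′ e S T ≡ obs m S T

Primitive : ∀ {n} → ℕ → SC n → Cochain n → Set
Primitive m K e = VanishesOnEmpty e × Equivariant m K (m ∸ 1) e × Cobounds m K e

HasPrimitive : ∀ {n} → ℕ → SC n → Set
HasPrimitive {n} m K = Σ (Cochain n) (Primitive m K)

Primitive-mono : ∀ {n} {m} {K L : SC n} {e} → (∀ X → L X → K X) → Primitive m K e → Primitive m L e
Primitive-mono sub (me , eqe , cobe) = me , (λ S T c → eqe S T (Cell-mono sub c)) ,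
    (λ S T c → cobe S T (Cell-mono sub c))

-- VKNonzero m K is ¬ Vanishes m K.
Vanishes : ∀ {n} → ℕ → SC n → Set
Vanishes m K = Σ (Cochain _) λ e → Equivariant m K (m ∸ 1) e × (∀ S T → Cell K m S T → δ e S T ≡ obs m S T)

Vanishes-mono : ∀ {n} {m} {K L : SC n} → (∀ X → L X → K X) → Vanishes m K → Vanishes m L
Vanishes-mono sub (e , eq , cob) = e , (λ S T c → eq S T (Cell-mono sub c)) , (λ S T c → cob S T (Cell-mono sub c))

toPrimitive : ∀ {n} {m} {K : SC n} → IsComplex K → Vanishes m K → HasPrimitive m K
toPrimitive {m = m} {K} (ne , _) (e , eq , cob) = mask e , mask-vanishes e , eq′ , cob′
  where
  eq′ : Equivariant m K (m ∸ 1) (mask e)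
  eq′ S T c@(KS , KT , _ , _) = trans (mask-nonempty e S T (ne S KS) (ne T KT))
    (trans (eq S T c) (cong (λ z → neg1^ m * (τsign S T * z)) (sym (mask-nonempty e T S (ne T KT) (ne S KS)))))
  cob′ : Cobounds m K (mask e)
  cob′ S T c@(KS , KT , _ , _) = trans (sym (δ≡δ′-mask e S T (ne S KS) (ne T KT))) (cob S T c)

fromPrimitive : ∀ {n} {m} {K : SC n} → IsComplex K → HasPrimitive m K → Vanishes m K
fromPrimitive (ne , _) (e , me , eqe , cobe) = e , eqe , λ S T c@(KS , KT , _ , _) →
  trans (δ≡δ′-mask e S T (ne S KS) (ne T KT)) (trans (δ′-ext _ _ S T (mask-id e me)) (cobe S T c))

-- For a : Fin n, v = inject₁ a and u = suc a are adjacent vertices of Fin (suc n), and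
-- pairAt a X = (v ∈ X , u ∈ X).

suc≢inject₁ : ∀ {n} (a : Fin n) → suc a ≢ inject₁ a
suc≢inject₁ zero ()
suc≢inject₁ (suc a) e = suc≢inject₁ a (FP.suc-injective e)

pattern TT = true , true
pattern TF = true , false
pattern FT = false , true
pattern FF = false , false

pairAt : ∀ {n} {A : Set} → Fin n → Vec A (suc n) → A × A
pairAt zero (x ∷ y ∷ S) = x , y
pairAt (suc a) (x ∷ S) = pairAt a S

setPairAt : ∀ {n} {A : Set} → Fin n → A → A → Vec A (suc n) → Vec A (suc n)
setPairAt zero p q (x ∷ y ∷ S) = p ∷ q ∷ S
setPairAt (suc a) p q (x ∷ S) = x ∷ setPairAt a p q S

moveUp : ∀ {n} → Fin n → Subset (suc n) → Subset (suc n)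
moveUp zero (true ∷ false ∷ S) = false ∷ true ∷ S
moveUp zero (true ∷ true ∷ S) = true ∷ true ∷ S
moveUp zero (false ∷ y ∷ S) = false ∷ y ∷ S
moveUp (suc a) (x ∷ S) = x ∷ moveUp a S

signBefore : ∀ {n} → Fin n → Subset (suc n) → ℤ
signBefore zero _ = 1ℤ
signBefore (suc a) (true ∷ S) = - signBefore a S
signBefore (suc a) (false ∷ S) = signBefore a S

isTF : Bool × Bool → Bool
isTF TF = true
isTF TT = false
isTF (false , _) = false

isTF-FF : ∀ {p} → p ≡ FF → isTF p ≡ false
isTF-FF refl = refl

signBefore-square : ∀ {n} (a : Fin n) X → signBefore a X * signBefore a X ≡ 1ℤ
signBefore-square zero X = refl
signBefore-square (suc a) (true ∷ X) = trans (neg-square (signBefore a X)) (signBefore-square a X)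
signBefore-square (suc a) (false ∷ X) = signBefore-square a X

∈⇒pairAt₁ : ∀ {n} (a : Fin n) X → inject₁ a ∈ X → proj₁ (pairAt a X) ≡ true
∈⇒pairAt₁ zero (x ∷ y ∷ X) here = refl
∈⇒pairAt₁ (suc a) (x ∷ X) (there p) = ∈⇒pairAt₁ a X p

pairAt₁⇒∈ : ∀ {n} (a : Fin n) X → proj₁ (pairAt a X) ≡ true → inject₁ a ∈ X
pairAt₁⇒∈ zero (true ∷ y ∷ X) refl = here
pairAt₁⇒∈ (suc a) (x ∷ X) h = there (pairAt₁⇒∈ a X h)

∈⇒pairAt₂ : ∀ {n} (a : Fin n) X → suc a ∈ X → proj₂ (pairAt a X) ≡ true
∈⇒pairAt₂ zero (x ∷ y ∷ X) (there here) = refl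
∈⇒pairAt₂ (suc a) (x ∷ X) (there p) = ∈⇒pairAt₂ a X p

pairAt₂⇒∈ : ∀ {n} (a : Fin n) X → proj₂ (pairAt a X) ≡ true → suc a ∈ X
pairAt₂⇒∈ zero (x ∷ true ∷ X) refl = there here
pairAt₂⇒∈ (suc a) (x ∷ X) h = there (pairAt₂⇒∈ a X h)

∉⇒pairAt₁ : ∀ {n} (a : Fin n) X → inject₁ a ∉ X → proj₁ (pairAt a X) ≡ false
∉⇒pairAt₁ a X h with proj₁ (pairAt a X) in eq
... | true = ⊥-elim (h (pairAt₁⇒∈ a X eq))
... | false = refl

∉⇒pairAt₂ : ∀ {n} (a : Fin n) X → suc a ∉ X → proj₂ (pairAt a X) ≡ false
∉⇒pairAt₂ a X h with proj₂ (pairAt a X) in eq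
... | true = ⊥-elim (h (pairAt₂⇒∈ a X eq))
... | false = refl

×-η : ∀ {A B : Set} (p : A × B) {x y} → proj₁ p ≡ x → proj₂ p ≡ y → p ≡ (x , y)
×-η (x , y) refl refl = refl

pairAt-empty : ∀ {n} (a : Fin n) X → nonemptyᵇ X ≡ false → pairAt a X ≡ FF
pairAt-empty zero (false ∷ false ∷ X) h = refl
pairAt-empty zero (true ∷ y ∷ X) ()
pairAt-empty zero (false ∷ true ∷ X) ()
pairAt-empty (suc a) (false ∷ X) h = pairAt-empty a X h
pairAt-empty (suc a) (true ∷ X) ()

pairAt-setPairAt : ∀ {n} {A : Set} (a : Fin n) (p q : A) X → pairAt a (setPairAt a p q X) ≡ (p , q)
pairAt-setPairAt zero p q (x ∷ y ∷ X) = refl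
pairAt-setPairAt (suc a) p q (x ∷ X) = pairAt-setPairAt a p q X

setPairAt-other⁻ : ∀ {n} (a : Fin n) (p q : Bool) X i → i ≢ inject₁ a → i ≢ suc a → i ∈ setPairAt a p q X → i ∈ X
setPairAt-other⁻ zero p q (x ∷ y ∷ X) zero h1 h2 _ = ⊥-elim (h1 refl)
setPairAt-other⁻ zero p q (x ∷ y ∷ X) (suc zero) h1 h2 _ = ⊥-elim (h2 refl)
setPairAt-other⁻ zero p q (x ∷ y ∷ X) (suc (suc i)) h1 h2 (there (there m)) = there (there m)
setPairAt-other⁻ (suc a) p q (x ∷ X) zero h1 h2 here = here
setPairAt-other⁻ (suc a) p q (x ∷ X) (suc i) h1 h2 (there m) =
  there (setPairAt-other⁻ a p q X i (λ e → h1 (cong suc e)) (λ e → h2 (cong suc e)) m)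

setPairAt-other⁺ : ∀ {n} (a : Fin n) (p q : Bool) X i → i ≢ inject₁ a → i ≢ suc a → i ∈ X → i ∈ setPairAt a p q X
setPairAt-other⁺ zero p q (x ∷ y ∷ X) zero h1 h2 _ = ⊥-elim (h1 refl)
setPairAt-other⁺ zero p q (x ∷ y ∷ X) (suc zero) h1 h2 _ = ⊥-elim (h2 refl)
setPairAt-other⁺ zero p q (x ∷ y ∷ X) (suc (suc i)) h1 h2 (there (there m)) = there (there m)
setPairAt-other⁺ (suc a) p q (x ∷ X) zero h1 h2 here = here
setPairAt-other⁺ (suc a) p q (x ∷ X) (suc i) h1 h2 (there m) =
  there (setPairAt-other⁺ a p q X i (λ e → h1 (cong suc e)) (λ e → h2 (cong suc e)) m)

setPairAt-remove : ∀ {n} (a : Fin n) (p q : Bool) X i → i ≢ inject₁ a → i ≢ suc a →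
  setPairAt a p q (remove X i) ≡ remove (setPairAt a p q X) i
setPairAt-remove zero p q (x ∷ y ∷ X) zero h1 h2 = ⊥-elim (h1 refl)
setPairAt-remove zero p q (x ∷ y ∷ X) (suc zero) h1 h2 = ⊥-elim (h2 refl)
setPairAt-remove zero p q (x ∷ y ∷ X) (suc (suc i)) h1 h2 = refl
setPairAt-remove (suc a) p q (x ∷ X) zero h1 h2 = refl
setPairAt-remove (suc a) p q (x ∷ X) (suc i) h1 h2 =
  cong (x ∷_) (setPairAt-remove a p q X i (λ e → h1 (cong suc e)) (λ e → h2 (cong suc e)))

pairAt-remove-v : ∀ {n} (a : Fin n) X → proj₁ (pairAt a (remove X (inject₁ a))) ≡ false
pairAt-remove-v zero (x ∷ y ∷ X) = refl
pairAt-remove-v (suc a) (x ∷ X) = pairAt-remove-v a X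

pairAt-contracted : ∀ {n} (a : Fin n) T → pairAt a ((T ∖ₛ suc a) ∪ ⁅ inject₁ a ⁆) ≡ TF
pairAt-contracted zero (true ∷ true ∷ T) = refl
pairAt-contracted zero (true ∷ false ∷ T) = refl
pairAt-contracted zero (false ∷ true ∷ T) = refl
pairAt-contracted zero (false ∷ false ∷ T) = refl
pairAt-contracted (suc a) (x ∷ T) = pairAt-contracted a T

setPairAt-contracted : ∀ {n} (a : Fin n) T → pairAt a T ≡ FT →
    setPairAt a false true (remove T (suc a) ∪ ⁅ inject₁ a ⁆) ≡ T
setPairAt-contracted zero (false ∷ true ∷ T) refl = cong (λ z → false ∷ true ∷ z) (SP.∪-identityʳ T)
setPairAt-contracted (suc a) (x ∷ T) h = cong₂ _∷_ (BP.∨-identityʳ x) (setPairAt-contracted a T h)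

disjoint-setPairAt : ∀ {n} (a : Fin n) (p q : Bool) X S T → pairAt a T ≡ FF → X ⊆ S → (∀ x → x ∈ S → x ∉ T) →
  ∀ x → x ∈ setPairAt a p q X → x ∉ T
disjoint-setPairAt a p q X S T gT sub dj x m xT with x FP.≟ suc a | x FP.≟ inject₁ a
... | yes refl | _ with trans (sym (∈⇒pairAt₂ a T xT)) (cong proj₂ gT)
... | ()
disjoint-setPairAt a p q X S T gT sub dj x m xT | no _ | yes refl with trans (sym (∈⇒pairAt₁ a T xT)) (cong proj₁ gT)
... | ()
disjoint-setPairAt a p q X S T gT sub dj x m xT | no ne1 | no ne2 = dj x (sub (setPairAt-other⁻ a p q X x ne2 ne1 m)) xT

moveUp-id : ∀ {n} (a : Fin n) X → isTF (pairAt a X) ≡ false → moveUp a X ≡ X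
moveUp-id zero (true ∷ true ∷ X) h = refl
moveUp-id zero (false ∷ y ∷ X) h = refl
moveUp-id zero (true ∷ false ∷ X) ()
moveUp-id (suc a) (x ∷ X) h = cong (x ∷_) (moveUp-id a X h)

moveUp-TF : ∀ {n} (a : Fin n) X → pairAt a X ≡ TF → moveUp a X ≡ setPairAt a false true X
moveUp-TF zero (true ∷ false ∷ X) refl = refl
moveUp-TF (suc a) (x ∷ X) h = cong (x ∷_) (moveUp-TF a X h)

pairAt-moveUp : ∀ {n} (a : Fin n) X → pairAt a X ≡ TF → pairAt a (moveUp a X) ≡ FT
pairAt-moveUp a X h = trans (cong (pairAt a) (moveUp-TF a X h)) (pairAt-setPairAt a false true X)

moveUp-remove : ∀ {n} (a : Fin n) X i → pairAt a X ≡ TF → i ∈ X → pairAt a (remove X i) ≡ TF →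
  moveUp a (remove X i) ≡ remove (moveUp a X) i
moveUp-remove a X i gX i∈ gR = trans (moveUp-TF a (remove X i) gR)
  (trans (setPairAt-remove a false true X i i≢v i≢u) (cong (λ z → remove z i) (sym (moveUp-TF a X gX))))
  where
  i≢v : i ≢ inject₁ a
  i≢v refl with trans (sym (pairAt-remove-v a X)) (cong proj₁ gR)
  ... | ()
  i≢u : i ≢ suc a
  i≢u refl with trans (sym (∈⇒pairAt₂ a X i∈)) (cong proj₂ gX)
  ... | ()

card-moveUp : ∀ {n} (a : Fin n) X → ∣ moveUp a X ∣ ≡ ∣ X ∣
card-moveUp zero (true ∷ false ∷ X) = refl
card-moveUp zero (true ∷ true ∷ X) = refl
card-moveUp zero (false ∷ y ∷ X) = refl
card-moveUp (suc a) (true ∷ X) = cong suc (card-moveUp a X)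
card-moveUp (suc a) (false ∷ X) = card-moveUp a X

card-setPairAt-TT : ∀ {n} (a : Fin n) X → pairAt a X ≡ TF → ∣ setPairAt a true true X ∣ ≡ suc ∣ X ∣
card-setPairAt-TT zero (true ∷ false ∷ X) refl = refl
card-setPairAt-TT (suc a) (true ∷ X) h = cong suc (card-setPairAt-TT a X h)
card-setPairAt-TT (suc a) (false ∷ X) h = card-setPairAt-TT a X h

card-TF : ∀ {n} (a : Fin n) X → pairAt a X ≡ TF → Σ ℕ λ r → ∣ X ∣ ≡ suc r
card-TF zero (true ∷ false ∷ X) refl = ∣ X ∣ , refl
card-TF (suc a) (true ∷ X) h = ∣ X ∣ , refl
card-TF (suc a) (false ∷ X) h = card-TF a X h

_⊑_ : ∀ {n} → Subset n → Subset n → Set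
_⊑_ = Pointwise Bool._≤_

⊑-refl : ∀ {n} (S : Subset n) → S ⊑ S
⊑-refl [] = []
⊑-refl (x ∷ S) = Bool.b≤b ∷ ⊑-refl S

remove-⊑ : ∀ {n} (S : Subset n) i → remove S i ⊑ S
remove-⊑ (true ∷ S) zero = Bool.f≤t ∷ ⊑-refl S
remove-⊑ (false ∷ S) zero = Bool.b≤b ∷ ⊑-refl S
remove-⊑ (x ∷ S) (suc i) = Bool.b≤b ∷ remove-⊑ S i

pairAt-FF-⊑ : ∀ {n} (a : Fin n) {S T} → S ⊑ T → pairAt a T ≡ FF → pairAt a S ≡ FF
pairAt-FF-⊑ zero (Bool.b≤b ∷ Bool.b≤b ∷ _) refl = refl
pairAt-FF-⊑ (suc a) (_ ∷ p) h = pairAt-FF-⊑ a p h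

pairAt-TF-⊑ : ∀ {n} (a : Fin n) {S T} → S ⊑ T → pairAt a T ≡ TF → pairAt a S ≡ TF ⊎ pairAt a S ≡ FF
pairAt-TF-⊑ zero (Bool.b≤b ∷ Bool.b≤b ∷ _) refl = inj₁ refl
pairAt-TF-⊑ zero (Bool.f≤t ∷ Bool.b≤b ∷ _) refl = inj₂ refl
pairAt-TF-⊑ (suc a) (_ ∷ p) h = pairAt-TF-⊑ a p h

pairAt-FT-⊑ : ∀ {n} (a : Fin n) {S T} → S ⊑ T → pairAt a T ≡ FT → pairAt a S ≡ FT ⊎ pairAt a S ≡ FF
pairAt-FT-⊑ zero (Bool.b≤b ∷ Bool.b≤b ∷ _) refl = inj₁ refl
pairAt-FT-⊑ zero (Bool.b≤b ∷ Bool.f≤t ∷ _) refl = inj₂ refl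
pairAt-FT-⊑ (suc a) (_ ∷ p) h = pairAt-FT-⊑ a p h

isTF-FT-⊑ : ∀ {n} (a : Fin n) {S T} → S ⊑ T → pairAt a T ≡ FT → isTF (pairAt a S) ≡ false
isTF-FT-⊑ a p h with pairAt-FT-⊑ a p h
... | inj₁ e rewrite e = refl
... | inj₂ e rewrite e = refl

indicator : List Tag → List Tag → ℤ
indicator A v = if listEq v A then 1ℤ else 0ℤ

data Repeats (x : Tag) : List Tag → Set where
  repeats-here : ∀ {w} → Repeats x (x ∷ x ∷ w)
  repeats-there : ∀ {y w} → Repeats x w → Repeats x (y ∷ w)

Repeats-++ : ∀ {x} p {w} → Repeats x w → Repeats x (p ++ w)
Repeats-++ [] h = h
Repeats-++ (y ∷ p) h = repeats-there (Repeats-++ p h)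

flipTag : Tag → Tag
flipTag L = R
flipTag R = L

flipTag-involutive : ∀ x → flipTag (flipTag x) ≡ x
flipTag-involutive L = refl
flipTag-involutive R = refl

flipTag^ : ℕ → Tag → Tag
flipTag^ zero x = x
flipTag^ (suc k) x = flipTag^ k (flipTag x)

alternating : Tag → ℕ → List Tag
alternating x zero = []
alternating x (suc k) = x ∷ alternating (flipTag x) k

alternating-noRepeat : ∀ x k y → ¬ Repeats y (alternating x k)
alternating-noRepeat L (suc (suc k)) y (repeats-there h) = alternating-noRepeat R (suc k) y h
alternating-noRepeat R (suc (suc k)) y (repeats-there h) = alternating-noRepeat L (suc k) y h
alternating-noRepeat x (suc zero) y (repeats-there ())

alternating-+ : ∀ x k j → alternating x (k +ℕ j) ≡ alternating x k ++ alternating (flipTag^ k x) j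
alternating-+ x zero j = refl
alternating-+ x (suc k) j = cong (x ∷_) (alternating-+ (flipTag x) k j)

firstTag : ℕ → Tag
firstTag zero = L
firstTag (suc zero) = R
firstTag (suc (suc m)) = firstTag m

flipTag^-firstTag : ∀ m → flipTag^ m (firstTag m) ≡ L
flipTag^-firstTag zero = refl
flipTag^-firstTag (suc zero) = refl
flipTag^-firstTag (suc (suc m)) = trans (cong (flipTag^ m) (flipTag-involutive (firstTag m))) (flipTag^-firstTag m)

pattern′≡alternating : ∀ m → pattern′ m ≡ alternating (firstTag m) (suc (suc m))
pattern′≡alternating zero = refl
pattern′≡alternating (suc zero) = refl
pattern′≡alternating (suc (suc m)) = begin
  pattern′ m ++ L ∷ R ∷ []
      ≡⟨ cong (_++ L ∷ R ∷ []) (pattern′≡alternating m) ⟩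
  alternating x (suc (suc m)) ++ alternating L 2
      ≡⟨ cong (λ y → alternating x (suc (suc m)) ++ alternating y 2) last ⟩
  alternating x (suc (suc m)) ++ alternating (flipTag^ (suc (suc m)) x) 2 ≡⟨ sym (alternating-+ x (suc (suc m)) 2) ⟩
  alternating x (suc (suc m) +ℕ 2)
      ≡⟨ cong (alternating x) (ℕP.+-comm (suc (suc m)) 2) ⟩
  alternating x (suc (suc (suc (suc m))))                                  ∎
  where
  open ≡-Reasoning
  x = firstTag m
  last : L ≡ flipTag^ (suc (suc m)) x
  last = sym (trans (cong (flipTag^ m) (flipTag-involutive x)) (flipTag^-firstTag m))

tagEq-sound : ∀ x y → tagEq x y ≡ true → x ≡ y
tagEq-sound L L h = refl
tagEq-sound R R h = refl

listEq-sound : ∀ w p → listEq w p ≡ true → w ≡ p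
listEq-sound [] [] h = refl
listEq-sound (x ∷ w) (y ∷ p) h with tagEq x y in eq
... | true = cong₂ _∷_ (tagEq-sound x y eq) (listEq-sound w p h)
listEq-sound [] (y ∷ p) ()
listEq-sound (x ∷ w) [] ()

listEq-refl : ∀ w → listEq w w ≡ true
listEq-refl [] = refl
listEq-refl (L ∷ w) = listEq-refl w
listEq-refl (R ∷ w) = listEq-refl w

base-Repeats : ∀ {n} m (S T : Subset n) x → Repeats x (word S T) → base m S T ≡ 0ℤ
base-Repeats m S T x h with listEq (word S T) (pattern′ m) in eq
... | false = refl
... | true = ⊥-elim (alternating-noRepeat _ _ x
    (subst (Repeats x) (trans (listEq-sound _ _ eq) (pattern′≡alternating m)) h))

obs-equivariant : ∀ {n} m (S T : Subset n) → obs m S T ≡ neg1^ m * (τsign S T * obs m T S)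
obs-equivariant m S T = sym (trans (expand (neg1^ m) (τsign S T) (τsign T S) (base m T S) (base m S T))
  (trans (cong₂ (λ u w → neg1^ m * (τsign S T * base m T S) + u * w * base m S T) (neg1^-square m) (τsign-square S T))
    (swap+ (base m S T) _)))
  where
  expand : ∀ e t t' x y → e * (t * (x + e * (t' * y))) ≡ e * (t * x) + (e * e) * (t * t') * y
  expand = solve-∀
  swap+ : ∀ y z → z + 1ℤ * 1ℤ * y ≡ y + z
  swap+ = solve-∀

word-repeatsˡ : ∀ {n} (a : Fin n) S T → pairAt a S ≡ TT → pairAt a T ≡ FF → Repeats L (word S T)
word-repeatsˡ zero (true ∷ true ∷ S) (false ∷ false ∷ T) refl refl = repeats-here
word-repeatsˡ (suc a) (x ∷ S) (y ∷ T) hS hT =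
  Repeats-++ (if x then L ∷ [] else []) (Repeats-++ (if y then R ∷ [] else []) (word-repeatsˡ a S T hS hT))

word-repeatsʳ : ∀ {n} (a : Fin n) S T → pairAt a S ≡ TT → pairAt a T ≡ FF → Repeats R (word T S)
word-repeatsʳ zero (true ∷ true ∷ S) (false ∷ false ∷ T) refl refl = repeats-here
word-repeatsʳ (suc a) (x ∷ S) (y ∷ T) hS hT =
  Repeats-++ (if y then L ∷ [] else []) (Repeats-++ (if x then R ∷ [] else []) (word-repeatsʳ a S T hS hT))

obs-TT-FF : ∀ {n} (a : Fin n) m S T → pairAt a S ≡ TT → pairAt a T ≡ FF → obs m S T ≡ 0ℤ
obs-TT-FF a m S T hS hT
  rewrite base-Repeats m S T L (word-repeatsˡ a S T hS hT) | base-Repeats m T S R (word-repeatsʳ a S T hS hT) =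
  vanish (neg1^ m) (τsign S T)
  where
  vanish : ∀ e t → 0ℤ + e * (t * 0ℤ) ≡ 0ℤ
  vanish = solve-∀

word-moveUpˡ : ∀ {n} (a : Fin n) S T → pairAt a S ≡ TF → pairAt a T ≡ FF → word (moveUp a S) T ≡ word S T
word-moveUpˡ zero (true ∷ false ∷ S) (false ∷ false ∷ T) refl refl = refl
word-moveUpˡ (suc a) (x ∷ S) (y ∷ T) hS hT =
  cong (λ w → (if x then L ∷ [] else []) ++ ((if y then R ∷ [] else []) ++ w)) (word-moveUpˡ a S T hS hT)

word-moveUpʳ : ∀ {n} (a : Fin n) S T → pairAt a S ≡ TF → pairAt a T ≡ FF → word T (moveUp a S) ≡ word T S
word-moveUpʳ zero (true ∷ false ∷ S) (false ∷ false ∷ T) refl refl = refl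
word-moveUpʳ (suc a) (x ∷ S) (y ∷ T) hS hT =
  cong (λ w → (if y then L ∷ [] else []) ++ ((if x then R ∷ [] else []) ++ w)) (word-moveUpʳ a S T hS hT)

obs-moveUp : ∀ {n} (a : Fin n) m S T → pairAt a S ≡ TF → pairAt a T ≡ FF → obs m (moveUp a S) T ≡ obs m S T
obs-moveUp a m S T hS hT = cong₂ (λ b1 b2 → b1 + neg1^ m * b2)
  (cong (indicator (pattern′ m)) (word-moveUpˡ a S T hS hT))
  (cong₂ _*_ (cong (λ z → neg1^ ((z ∸ 1) *ℕ (∣ T ∣ ∸ 1))) (card-moveUp a S))
             (cong (indicator (pattern′ m)) (word-moveUpʳ a S T hS hT)))

-- Contracted complexes

∈-remove⁻ : ∀ {n} (A : Subset n) x i → i ∈ remove A x → i ∈ A × i ≢ x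
∈-remove⁻ (b ∷ A) zero zero ()
∈-remove⁻ (b ∷ A) zero (suc i) (there m) = there m , (λ ())
∈-remove⁻ (b ∷ A) (suc x) zero here = here , (λ ())
∈-remove⁻ (b ∷ A) (suc x) (suc i) (there m) with ∈-remove⁻ A x i m
... | m' , ne = there m' , (λ e → ne (FP.suc-injective e))

∈-contractSet⁻ : ∀ {n} (A : Subset n) u v {i} → i ∈ (A ∖ₛ u) ∪ ⁅ v ⁆ → (i ∈ A × i ≢ u) ⊎ i ≡ v
∈-contractSet⁻ A u v {i} m with SP.x∈p∪q⁻ (A ∖ₛ u) ⁅ v ⁆ m
... | inj₁ m' = inj₁ (∈-remove⁻ A u i (subst (i ∈_) (∖ₛ≡remove A u) m'))
... | inj₂ m' = inj₂ (SP.x∈⁅y⁆⇒x≡y v m')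

∈-contractSet⁺ : ∀ {n} (A : Subset n) u v {i} → (i ∈ A × i ≢ u) ⊎ i ≡ v → i ∈ (A ∖ₛ u) ∪ ⁅ v ⁆
∈-contractSet⁺ A u v (inj₁ (m , ne)) = SP.x∈p∪q⁺ (inj₁ (SP.x∈p∧x≢y⇒x∈p-y m ne))
∈-contractSet⁺ A u v {i} (inj₂ refl) = SP.x∈p∪q⁺ (inj₂ (SP.x∈⁅x⁆ i))

u∉contractSet : ∀ {n} (A : Subset n) {u v} → u ≢ v → u ∉ (A ∖ₛ u) ∪ ⁅ v ⁆
u∉contractSet A {u} {v} u≢v m with ∈-contractSet⁻ A u v m
... | inj₁ (_ , u≢u) = u≢u refl
... | inj₂ u≡v = u≢v u≡v

contractSet-⊆ : ∀ {n} {A T : Subset n} {u v} → T ⊆ (A ∖ₛ u) ∪ ⁅ v ⁆ → (v ∉ T ⊎ v ∈ A) → T ⊆ A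
contractSet-⊆ {A = A} {u = u} {v} T⊆ v∉T⊎v∈A m with ∈-contractSet⁻ A u v (T⊆ m) | v∉T⊎v∈A
... | inj₁ (m' , _) | _ = m'
... | inj₂ refl | inj₁ v∉T = ⊥-elim (v∉T m)
... | inj₂ refl | inj₂ v∈A = v∈A

uncontract-⊆ : ∀ {n} {A T : Subset n} {u v} → T ⊆ (A ∖ₛ u) ∪ ⁅ v ⁆ → u ∈ A → (T ∖ₛ v) ∪ ⁅ u ⁆ ⊆ A
uncontract-⊆ {A = A} {T} {u} {v} T⊆ u∈A m with ∈-contractSet⁻ T v u m
... | inj₂ refl = u∈A
... | inj₁ (mT , i≢v) with ∈-contractSet⁻ A u v (T⊆ mT)
... | inj₁ (m' , _) = m'
... | inj₂ i≡v = ⊥-elim (i≢v i≡v)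

contract-uncontract : ∀ {n} (T : Subset n) {u v} → v ∈ T → u ∉ T → T ≡ (((T ∖ₛ v) ∪ ⁅ u ⁆) ∖ₛ u) ∪ ⁅ v ⁆
contract-uncontract T {u} {v} v∈T u∉T = SP.⊆-antisym into back
  where
  into : T ⊆ (((T ∖ₛ v) ∪ ⁅ u ⁆) ∖ₛ u) ∪ ⁅ v ⁆
  into {i} m with i FP.≟ v
  ... | yes refl = ∈-contractSet⁺ _ u v (inj₂ refl)
  ... | no i≢v = ∈-contractSet⁺ _ u v (inj₁ (∈-contractSet⁺ T v u (inj₁ (m , i≢v)) , λ e → u∉T (subst (_∈ T) e m)))
  back : (((T ∖ₛ v) ∪ ⁅ u ⁆) ∖ₛ u) ∪ ⁅ v ⁆ ⊆ T
  back {i} m with ∈-contractSet⁻ _ u v m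
  ... | inj₂ refl = v∈T
  ... | inj₁ (m' , i≢u) with ∈-contractSet⁻ T v u m'
  ... | inj₁ (m'' , _) = m''
  ... | inj₂ i≡u = ⊥-elim (i≢u i≡u)

IsComplex-contract : ∀ {n} (K : SC n) u v → IsComplex K → u ≢ v → IsComplex (Contract u v K)
IsComplex-contract K u v (ne , closed) u≢v = ne′ , closed′
  where
  ne′ : ∀ S → Contract u v K S → Nonempty S
  ne′ S (inj₁ (_ , KS)) = ne S KS
  ne′ S (inj₂ (A , _ , _ , refl)) = v , ∈-contractSet⁺ A u v (inj₂ refl)
  closed′ : ∀ S T → Contract u v K S → T ⊆ S → Nonempty T → Contract u v K T
  closed′ S T (inj₁ (u∉S , KS)) T⊆S neT = inj₁ ((λ m → u∉S (T⊆S m)) , closed S T KS T⊆S neT)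
  closed′ S T (inj₂ (A , u∈A , KA , refl)) T⊆S neT with v SP.∈? T | v SP.∈? A
  ... | no v∉T | _ = inj₁ (u∉T , closed A T KA (contractSet-⊆ T⊆S (inj₁ v∉T)) neT)
    where u∉T = λ m → u∉contractSet A u≢v (T⊆S m)
  ... | yes _ | yes v∈A = inj₁ (u∉T , closed A T KA (contractSet-⊆ T⊆S (inj₂ v∈A)) neT)
    where u∉T = λ m → u∉contractSet A u≢v (T⊆S m)
  ... | yes v∈T | no _ = inj₂ ((T ∖ₛ v) ∪ ⁅ u ⁆ , u∈ ,
          closed A _ KA (uncontract-⊆ T⊆S u∈A) (u , u∈) ,
          contract-uncontract T v∈T (λ m → u∉contractSet A u≢v (T⊆S m)))
    where u∈ = ∈-contractSet⁺ T v u (inj₂ refl)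

contractedFace : ∀ {n} (a : Fin n) (K : SC (suc n)) → IsComplex K → ∀ X → Contract (suc a) (inject₁ a) K X →
  suc a ∉ X × (K X ⊎ pairAt a X ≡ TF × K (moveUp a X))
contractedFace a K cx X (inj₁ (u∉X , KX)) = u∉X , inj₁ KX
contractedFace a K (_ , closed) ._ (inj₂ (A , u∈A , KA , refl)) = u∉contractSet A (suc≢inject₁ a) , face
  where
  X = (A ∖ₛ suc a) ∪ ⁅ inject₁ a ⁆
  gX : pairAt a X ≡ TF
  gX = pairAt-contracted a A
  face : K X ⊎ pairAt a X ≡ TF × K (moveUp a X)
  face with proj₁ (pairAt a A) in eq
  ... | true = inj₁ (closed A X KA (contractSet-⊆ {u = suc a} {inject₁ a} (λ m → m) (inj₂ (pairAt₁⇒∈ a A eq)))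
      (inject₁ a , pairAt₁⇒∈ a X (cong proj₁ gX)))
  ... | false = inj₂ (gX , subst K (sym moveUp≡A) KA)
    where
    moveUp≡A : moveUp a X ≡ A
    moveUp≡A = trans (moveUp-TF a X gX)
      (trans (cong (λ z → setPairAt a false true (z ∪ ⁅ inject₁ a ⁆)) (∖ₛ≡remove A (suc a)))
             (setPairAt-contracted a A (×-η (pairAt a A) eq (∈⇒pairAt₂ a A u∈A))))

pairAt-FF-disjoint : ∀ {n} (a : Fin n) X Y → pairAt a X ≡ TF → (∀ x → x ∈ X → x ∉ Y) → suc a ∉ Y → pairAt a Y ≡ FF
pairAt-FF-disjoint a X Y gX dj u∉Y =
  ×-η (pairAt a Y) (∉⇒pairAt₁ a Y (dj (inject₁ a) (pairAt₁⇒∈ a X (cong proj₁ gX)))) (∉⇒pairAt₂ a Y u∉Y)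

ContractedCell : ∀ {n} (a : Fin n) (K : SC (suc n)) → Subset (suc n) → Subset (suc n) → Set
ContractedCell a K S T =
  K S × K T ⊎
  ¬ K S × pairAt a S ≡ TF × K (moveUp a S) × pairAt a T ≡ FF × K T ⊎
  ¬ K T × pairAt a T ≡ TF × K (moveUp a T) × pairAt a S ≡ FF × K S

contractedCell : ∀ {n} (a : Fin n) (K : SC (suc n)) → (∀ S → Dec (K S)) → IsComplex K → ∀ S T →
  Contract (suc a) (inject₁ a) K S → Contract (suc a) (inject₁ a) K T → (∀ x → x ∈ S → x ∉ T) → ContractedCell a K S T
contractedCell a K decK cx S T cS cT disj with decK S | decK T | contractedFace a K cx S cS | contractedFace a K cx T cT
... | yes KS | yes KT | _ | _ = inj₁ (KS , KT)
... | no ¬KS | _ | _ , inj₁ KS | _ = ⊥-elim (¬KS KS)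
... | yes _ | no ¬KT | _ | _ , inj₁ KT = ⊥-elim (¬KT KT)
... | no ¬KS | _ | _ , inj₂ (gS , KfS) | u∉T , inj₁ KT = inj₂
    (inj₁ (¬KS , gS , KfS , pairAt-FF-disjoint a S T gS disj u∉T , KT))
... | yes KS | no ¬KT | u∉S , _ | _ , inj₂ (gT , KfT) =
  inj₂ (inj₂ (¬KT , gT , KfT , pairAt-FF-disjoint a T S gT (λ x m m′ → disj x m′ m) u∉S , KS))
... | no ¬KS | _ | _ , inj₂ (gS , _) | u∉T , inj₂ (gT , _)
  with trans (sym (cong proj₁ gT)) (cong proj₁ (pairAt-FF-disjoint a S T gS disj u∉T))
... | ()

missingFace-⊆ : ∀ {n} (K : SC n) → (∀ S → Dec (K S)) → ∀ A → ¬ K A → Nonempty A →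
  Σ (Subset n) λ T → MissingFace K T × T ⊆ A × Nonempty T
missingFace-⊆ {n} K decK A = below ∣ A ∣ A ℕP.≤-refl
  where
  below : ∀ k A → ∣ A ∣ ≤ k → ¬ K A → Nonempty A → Σ (Subset n) λ T → MissingFace K T × T ⊆ A × Nonempty T
  below k A le ¬KA neA with SP.anySubset? (λ B → (B SP.⊂? A) ×-dec (SP.nonempty? B ×-dec ¬? (decK B)))
  below zero A le ¬KA neA | yes (B , B⊂A , _) = ⊥-elim (ℕP.<⇒≱ (SP.p⊂q⇒∣p∣<∣q∣ B⊂A) (ℕP.≤-trans le ℕ.z≤n))
  below (suc k) A le ¬KA neA | yes (B , B⊂A , neB , ¬KB)
    with below k B (ℕP.≤-pred (ℕP.≤-trans (SP.p⊂q⇒∣p∣<∣q∣ B⊂A) le)) ¬KB neB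
  ... | T , mf , T⊆B , neT = T , mf , (λ m → proj₁ B⊂A (T⊆B m)) , neT
  below k A le ¬KA neA | no none = A , (¬KA , allK) , (λ m → m) , neA
    where
    allK : ∀ S → S ⊂ A → Nonempty S → K S
    allK S S⊂A neS with decK S
    ... | yes KS = KS
    ... | no ¬KS = ⊥-elim (none (S , S⊂A , neS , ¬KS))

⊆-setPairAt-TT : ∀ {n} (a : Fin n) {X T} → pairAt a X ≡ TF → T ⊆ setPairAt a true true X → suc a ∉ T → T ⊆ X
⊆-setPairAt-TT a {X} gX T⊆ u∉T {i} m with i FP.≟ suc a | i FP.≟ inject₁ a
... | yes refl | _ = ⊥-elim (u∉T m)
... | no _ | yes refl = pairAt₁⇒∈ a X (cong proj₁ gX)
... | no i≢u | no i≢v = setPairAt-other⁻ a true true X i i≢v i≢u (T⊆ m)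

⊆-setPairAt-TT′ : ∀ {n} (a : Fin n) {X T} → pairAt a X ≡ TF → T ⊆ setPairAt a true true X → inject₁ a ∉ T →
    T ⊆ moveUp a X
⊆-setPairAt-TT′ a {X} gX T⊆ v∉T {i} m rewrite moveUp-TF a X gX with i FP.≟ suc a | i FP.≟ inject₁ a
... | _ | yes refl = ⊥-elim (v∉T m)
... | yes refl | no _ = pairAt₂⇒∈ a (setPairAt a false true X) (cong proj₂ (pairAt-setPairAt a false true X))
... | no i≢u | no i≢v = setPairAt-other⁺ a false true X i i≢v i≢u (setPairAt-other⁻ a true true X i i≢v i≢u (T⊆ m))

-- A missing face below X + u must contain u (X is a face) and v (X - v + u is a face), so its
-- size is bounded by that of X + u; admissibility excludes it.
admissible-fill : ∀ {n} (a : Fin n) (K : SC (suc n)) → (∀ S → Dec (K S)) → IsComplex K →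
  Admissible K (suc a) (inject₁ a) → ∀ X F → pairAt a X ≡ TF → K X → K (moveUp a X) → K F →
  suc ∣ X ∣ ≤ ∣ F ∣ → K (setPairAt a true true X)
admissible-fill a K decK (_ , closed) (_ , _ , _ , noMF) X F gX KX KfX KF le with decK (setPairAt a true true X)
... | yes KA = KA
... | no ¬KA with missingFace-⊆ K decK A ¬KA (inject₁ a , pairAt₁⇒∈ a A (cong proj₁ gA))
  where
  A = setPairAt a true true X
  gA : pairAt a A ≡ TT
  gA = pairAt-setPairAt a true true X
... | T , (¬KT , below) , T⊆A , neT = ⊥-elim (noMF (T , (¬KT , below) , u∈T , v∈T , F , KF , ∣T∣≤∣F∣))
  where
  u∈T : suc a ∈ T
  u∈T with suc a SP.∈? T
  ... | yes m = m
  ... | no u∉T = ⊥-elim (¬KT (closed X T KX (⊆-setPairAt-TT a gX T⊆A u∉T) neT))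
  v∈T : inject₁ a ∈ T
  v∈T with inject₁ a SP.∈? T
  ... | yes m = m
  ... | no v∉T = ⊥-elim (¬KT (closed (moveUp a X) T KfX (⊆-setPairAt-TT′ a gX T⊆A v∉T) neT))
  ∣T∣≤∣F∣ : ∣ T ∣ ≤ ∣ F ∣
  ∣T∣≤∣F∣ = ℕP.≤-trans (SP.p⊆q⇒∣p∣≤∣q∣ T⊆A) (subst (_≤ ∣ F ∣) (sym (card-setPairAt-TT a X gX)) le)

-- Contracting suc a onto inject₁ a

fill : ∀ {n} → Fin n → (Subset (suc n) → ℤ) → Subset (suc n) → ℤ
fill a f X = if isTF (pairAt a X) then signBefore a X * f (setPairAt a true true X) else 0ℤ

fill-true : ∀ {n} (a : Fin n) f X → fill (suc a) f (true ∷ X) ≡ - fill a (λ Z → f (true ∷ Z)) X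
fill-true a f X with isTF (pairAt a X)
... | true = sym (ℤP.neg-distribˡ-* (signBefore a X) (f (true ∷ setPairAt a true true X)))
... | false = refl

-- Deleting v from S + u gives S - v + u and deleting u gives S; every other face of S + u is
-- the fill of a face of S.
∂-fill : ∀ {n} (a : Fin n) (f : Subset (suc n) → ℤ) S → pairAt a S ≡ TF →
  ∂ f (setPairAt a true true S)
      ≡ signBefore a S * (f (setPairAt a false true S) - f S) - signBefore a S * ∂ (fill a f) S
∂-fill zero f (true ∷ false ∷ S) refl =
  trans (cong (λ z → f (false ∷ true ∷ S) - (f (true ∷ false ∷ S) - z))
          (sym (∂-ext _ _ S (λ X → ℤP.*-identityˡ (f (true ∷ true ∷ X))))))
        (regroup (f (false ∷ true ∷ S)) (f (true ∷ false ∷ S)) (∂ (λ X → 1ℤ * f (true ∷ true ∷ X)) S))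
  where
  regroup : ∀ p q r → p - (q - r) ≡ 1ℤ * (p - q) - 1ℤ * (0ℤ - r)
  regroup = solve-∀
∂-fill (suc a) f (true ∷ S) h = begin
  f (false ∷ A) - ∂ (λ X → f (true ∷ X)) A
    ≡⟨ cong (λ z → f (false ∷ A) - z) (∂-fill a (λ X → f (true ∷ X)) S h) ⟩
  f (false ∷ A) - (s * D - s * F)
    ≡⟨ reorder s (f (false ∷ A)) D F (signBefore-square a S) ⟩
  (- s) * D - (- s) * (s * f (false ∷ A) - (- F))
    ≡⟨ cong₂ (λ y z → (- s) * D - (- s) * (y - z)) (sym fill-head)
        (sym (trans (∂-ext _ _ S (fill-true a f)) (∂-neg _ S))) ⟩
  (- s) * D - (- s) * (fill (suc a) f (false ∷ S) - ∂ (λ X → fill (suc a) f (true ∷ X)) S) ∎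
  where
  open ≡-Reasoning
  s = signBefore a S
  A = setPairAt a true true S
  D = f (true ∷ setPairAt a false true S) - f (true ∷ S)
  F = ∂ (fill a (λ X → f (true ∷ X))) S
  fill-head : fill (suc a) f (false ∷ S) ≡ s * f (false ∷ A)
  fill-head rewrite h = refl
  reorder : ∀ s p q r → s * s ≡ 1ℤ → p - (s * q - s * r) ≡ (- s) * q - (- s) * (s * p - (- r))
  reorder s p q r ss = trans (expand s p q r) (trans (cong (λ z → z * p - s * q + s * r) (sym ss)) (factor s p q r))
    where
    expand : ∀ s p q r → p - (s * q - s * r) ≡ 1ℤ * p - s * q + s * r
    expand = solve-∀
    factor : ∀ s p q r → (s * s) * p - s * q + s * r ≡ (- s) * q - (- s) * (s * p - (- r))
    factor = solve-∀
∂-fill (suc a) f (false ∷ S) h = ∂-fill a (λ X → f (false ∷ X)) S h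

∂-moveUp : ∀ {n} (a : Fin n) (f : Subset (suc n) → ℤ) S → pairAt a S ≡ TF →
  ∂ (λ X → f (moveUp a X)) S ≡ ∂ f (moveUp a S)
∂-moveUp zero f (true ∷ false ∷ S) refl = refl
∂-moveUp (suc a) f (true ∷ S) h = cong (λ z → f (false ∷ moveUp a S) - z) (∂-moveUp a (λ X → f (true ∷ X)) S h)
∂-moveUp (suc a) f (false ∷ S) h = ∂-moveUp a (λ X → f (false ∷ X)) S h

δ′-moveUp : ∀ {n} (a : Fin n) (g : Cochain (suc n)) S T → pairAt a S ≡ TF → pairAt a T ≡ FF →
  δ′ (λ X Y → g (moveUp a X) (moveUp a Y)) S T ≡ δ′ g (moveUp a S) T
δ′-moveUp a g S T hS hT = cong₂ (λ x y → x + y)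
  (trans (∂-ext _ _ S (λ X → cong (g (moveUp a X)) (moveUp-id a T (isTF-FF hT)))) (∂-moveUp a (λ Z → g Z T) S hS))
  (cong₂ _*_ (cong (λ z → neg1^ (z ∸ 1)) (sym (card-moveUp a S)))
     (∂-cong _ _ T (λ i i∈ →
         cong (g (moveUp a S)) (moveUp-id a (remove T i) (isTF-FF (pairAt-FF-⊑ a (remove-⊑ T i) hT))))))

zero-scaled : ∀ e t → 0ℤ ≡ e * (t * 0ℤ)
zero-scaled = solve-∀

twice-equivariant : ∀ ε τ τ' z → ε * ε ≡ 1ℤ → τ * τ' ≡ 1ℤ → z ≡ ε * (τ * (ε * (τ' * z)))
twice-equivariant ε τ τ' z εε ττ = sym (begin
  ε * (τ * (ε * (τ' * z)))   ≡⟨ regroup ε τ τ' z ⟩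
  (ε * ε) * (τ * τ') * z     ≡⟨ cong₂ (λ u w → u * w * z) εε ττ ⟩
  1ℤ * 1ℤ * z                ≡⟨ ℤP.*-identityˡ z ⟩
  z                          ∎)
  where
  open ≡-Reasoning
  regroup : ∀ e t t' z → e * (t * (e * (t' * z))) ≡ (e * e) * (t * t') * z
  regroup = solve-∀

pickTF-FF : Bool × Bool → Bool × Bool → ℤ → ℤ → ℤ
pickTF-FF TF FF x y = x
pickTF-FF FF TF x y = y
pickTF-FF _ _ x y = 0ℤ

correction : ∀ {n} → Fin n → ℤ → Cochain (suc n) → Cochain (suc n)
correction a ε e₀ X Y = pickTF-FF (pairAt a X) (pairAt a Y)
  (signBefore a X * e₀ (setPairAt a true true X) Y)
  (ε * (τsign X Y * (signBefore a Y * e₀ (setPairAt a true true Y) X)))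

pickTF-FF-equivariant : ∀ p q (A B ε τ τ' : ℤ) → ε * ε ≡ 1ℤ → τ * τ' ≡ 1ℤ →
  pickTF-FF p q A (ε * (τ * B)) ≡ ε * (τ * pickTF-FF q p B (ε * (τ' * A)))
pickTF-FF-equivariant TF FF A B ε τ τ' εε ττ = twice-equivariant ε τ τ' A εε ττ
pickTF-FF-equivariant FF TF A B ε τ τ' εε ττ = refl
pickTF-FF-equivariant TT TT A B ε τ τ' εε ττ = zero-scaled ε τ
pickTF-FF-equivariant TT TF A B ε τ τ' εε ττ = zero-scaled ε τ
pickTF-FF-equivariant TT FT A B ε τ τ' εε ττ = zero-scaled ε τ
pickTF-FF-equivariant TT FF A B ε τ τ' εε ττ = zero-scaled ε τ
pickTF-FF-equivariant TF TT A B ε τ τ' εε ττ = zero-scaled ε τ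
pickTF-FF-equivariant TF TF A B ε τ τ' εε ττ = zero-scaled ε τ
pickTF-FF-equivariant TF FT A B ε τ τ' εε ττ = zero-scaled ε τ
pickTF-FF-equivariant FT TT A B ε τ τ' εε ττ = zero-scaled ε τ
pickTF-FF-equivariant FT TF A B ε τ τ' εε ττ = zero-scaled ε τ
pickTF-FF-equivariant FT FT A B ε τ τ' εε ττ = zero-scaled ε τ
pickTF-FF-equivariant FT FF A B ε τ τ' εε ττ = zero-scaled ε τ
pickTF-FF-equivariant FF TT A B ε τ τ' εε ττ = zero-scaled ε τ
pickTF-FF-equivariant FF FT A B ε τ τ' εε ττ = zero-scaled ε τ
pickTF-FF-equivariant FF FF A B ε τ τ' εε ττ = zero-scaled ε τ

correction-equivariant : ∀ {n} (a : Fin n) ε e₀ → ε * ε ≡ 1ℤ → ∀ X Y → correction a ε e₀ X Y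
    ≡ ε * (τsign X Y * correction a ε e₀ Y X)
correction-equivariant a ε e₀ εε X Y = pickTF-FF-equivariant (pairAt a X) (pairAt a Y) _ _ ε (τsign X Y)
    (τsign Y X) εε (τsign-square X Y)

correction-vanishes : ∀ {n} (a : Fin n) ε e₀ → VanishesOnEmpty e₀ → VanishesOnEmpty (correction a ε e₀)
correction-vanishes a ε e₀ (m1 , m2) = vanishesˡ , vanishesʳ
  where
  vanishesˡ : ∀ X Y → nonemptyᵇ X ≡ false → correction a ε e₀ X Y ≡ 0ℤ
  vanishesˡ X Y h rewrite pairAt-empty a X h with pairAt a Y
  ... | TF = trans (cong (λ z → ε * (τsign X Y * (signBefore a Y * z))) (m2 _ X h))
      (sym (zero-scaled₃ ε (τsign X Y) (signBefore a Y)))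
    where
    zero-scaled₃ : ∀ e t s → 0ℤ ≡ e * (t * (s * 0ℤ))
    zero-scaled₃ = solve-∀
  ... | TT = refl
  ... | FT = refl
  ... | FF = refl
  vanishesʳ : ∀ X Y → nonemptyᵇ Y ≡ false → correction a ε e₀ X Y ≡ 0ℤ
  vanishesʳ X Y h rewrite pairAt-empty a Y h with pairAt a X
  ... | TF = trans (cong (signBefore a X *_) (m2 _ Y h)) (ℤP.*-zeroʳ (signBefore a X))
  ... | TT = refl
  ... | FT = refl
  ... | FF = refl

pickTF-FF-FF : ∀ p (x y : ℤ) → isTF p ≡ false → pickTF-FF p FF x y ≡ 0ℤ
pickTF-FF-FF TT x y h = refl
pickTF-FF-FF FT x y h = refl
pickTF-FF-FF FF x y h = refl
pickTF-FF-FF TF x y ()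

correction-FF : ∀ {n} (a : Fin n) ε e₀ X T → pairAt a T ≡ FF → correction a ε e₀ X T ≡ fill a (λ Z → e₀ Z T) X
correction-FF a ε e₀ X T hT rewrite hT with pairAt a X
... | true , false = refl
... | true , true = refl
... | false , true = refl
... | false , false = refl

δ′-correction-moveUp : ∀ {n} (a : Fin n) ε e₀ S T → pairAt a S ≡ TF → pairAt a T ≡ FF →
  δ′ (correction a ε e₀) (moveUp a S) T ≡ 0ℤ
δ′-correction-moveUp a ε e₀ S T hS hT = δ′-zero k (moveUp a S) T
  (∂-vanishingOnFaces (moveUp a S) (λ i _ → vanishesˡ (remove (moveUp a S) i)
     (isTF-FT-⊑ a (remove-⊑ (moveUp a S) i) (pairAt-moveUp a S hS))))
  (∂-vanishingOnFaces T (λ i _ → vanishesʳ (remove T i) (pairAt-FF-⊑ a (remove-⊑ T i) hT)))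
  where
  k = correction a ε e₀
  vanishesˡ : ∀ X → isTF (pairAt a X) ≡ false → k X T ≡ 0ℤ
  vanishesˡ X h rewrite hT = pickTF-FF-FF (pairAt a X) _ _ h
  vanishesʳ : ∀ Y → pairAt a Y ≡ FF → k (moveUp a S) Y ≡ 0ℤ
  vanishesʳ Y h rewrite h | pairAt-moveUp a S hS = refl

δ′-correction-TF-FF : ∀ {n} (a : Fin n) ε e₀ S T → pairAt a S ≡ TF → pairAt a T ≡ FF →
  δ′ (correction a ε e₀) S T
    ≡ ∂ (fill a (λ Z → e₀ Z T)) S + dimSign S * (signBefore a S * ∂ (e₀ (setPairAt a true true S)) T)
δ′-correction-TF-FF a ε e₀ S T hS hT = cong₂ (λ x y → x + dimSign S * y)
  (∂-ext _ _ S (λ X → correction-FF a ε e₀ X T hT))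
  (trans (∂-cong _ (λ Y → signBefore a S * e₀ (setPairAt a true true S) Y) T
            (λ i _ → onFaces (remove T i) (pairAt-FF-⊑ a (remove-⊑ T i) hT)))
         (∂-* (signBefore a S) _ T))
  where
  onFaces : ∀ Y → pairAt a Y ≡ FF → correction a ε e₀ S Y ≡ signBefore a S * e₀ (setPairAt a true true S) Y
  onFaces Y h rewrite h | hS = refl

corrected-moveUp : ∀ {n} (a : Fin n) ε e₀ S T → pairAt a S ≡ TF → pairAt a T ≡ FF →
  δ′ e₀ (setPairAt a true true S) T ≡ 0ℤ →
  e₀ S T + δ′ (correction a ε e₀) S T ≡ e₀ (moveUp a S) T + δ′ (correction a ε e₀) (moveUp a S) T
corrected-moveUp a ε e₀ S T hS hT filled0 = begin
  Q + δ′ (correction a ε e₀) S T    ≡⟨ cong (Q +_) (δ′-correction-TF-FF a ε e₀ S T hS hT) ⟩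
  Q + (F + dimSign S * (s * B))     ≡⟨ cong (λ z → Q + (F + z * (s * B))) dimS ⟩
  Q + (F + neg1^ r * (s * B))       ≡⟨ solveFor s (neg1^ r) P Q F B (signBefore-square a S) filled ⟩
  P + 0ℤ                            ≡⟨ cong (P +_) (sym (δ′-correction-moveUp a ε e₀ S T hS hT)) ⟩
  P + δ′ (correction a ε e₀) (moveUp a S) T ∎
  where
  open ≡-Reasoning
  s = signBefore a S
  A = setPairAt a true true S
  P = e₀ (moveUp a S) T
  Q = e₀ S T
  F = ∂ (fill a (λ Z → e₀ Z T)) S
  B = ∂ (e₀ A) T
  r = proj₁ (card-TF a S hS)
  dimS : dimSign S ≡ neg1^ r
  dimS = cong (λ z → neg1^ (z ∸ 1)) (proj₂ (card-TF a S hS))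
  dimA : dimSign A ≡ - neg1^ r
  dimA = cong (λ z → neg1^ (z ∸ 1)) (trans (card-setPairAt-TT a S hS) (cong suc (proj₂ (card-TF a S hS))))
  filled : s * (P - Q) - s * F + (- neg1^ r) * B ≡ 0ℤ
  filled = trans (cong₂ (λ x y → s * (e₀ x T - Q) - s * F + y * B) (moveUp-TF a S hS) (sym dimA))
             (trans (cong (_+ dimSign A * B) (sym (∂-fill a (λ Z → e₀ Z T) S hS))) filled0)
  solveFor : ∀ s d P Q F B → s * s ≡ 1ℤ → s * (P - Q) - s * F + (- d) * B ≡ 0ℤ → Q + (F + d * (s * B)) ≡ P + 0ℤ
  solveFor s d P Q F B ss h = sym (ℤP.i-j≡0⇒i≡j _ _ (begin
    (P + 0ℤ) - (Q + (F + d * (s * B)))               ≡⟨ expand s d P Q F B ⟩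
    1ℤ * (P - Q) - 1ℤ * F - s * d * B                ≡⟨ cong (λ z → z * (P - Q) - z * F - s * d * B) (sym ss) ⟩
    (s * s) * (P - Q) - (s * s) * F - s * d * B      ≡⟨ factor s d P Q F B ⟩
    s * (s * (P - Q) - s * F + (- d) * B)            ≡⟨ cong (s *_) h ⟩
    s * 0ℤ                                           ≡⟨ ℤP.*-zeroʳ s ⟩
    0ℤ                                               ∎))
    where
    expand : ∀ s d P Q F B → (P + 0ℤ) - (Q + (F + d * (s * B))) ≡ 1ℤ * (P - Q) - 1ℤ * F - s * d * B
    expand = solve-∀
    factor : ∀ s d P Q F B → (s * s) * (P - Q) - (s * s) * F - s * d * B ≡ s * (s * (P - Q) - s * F + (- d) * B)
    factor = solve-∀

Primitive-+-δ′ : ∀ {n m} {K : SC n} {e k} → Primitive m K e → VanishesOnEmpty k →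
  (∀ X Y → k X Y ≡ neg1^ m * (τsign X Y * k Y X)) → Primitive m K (λ X Y → e X Y + δ′ k X Y)
Primitive-+-δ′ {m = m} {e = e} {k} (me , eqe , cobe) mk eqk = vanishes-+ e (δ′ k) me (δ′-vanishes k mk) , eq′ , cob′
  where
  ε = neg1^ m
  eq′ : ∀ S T → _ → e S T + δ′ k S T ≡ ε * (τsign S T * (e T S + δ′ k T S))
  eq′ S T c = trans (cong₂ _+_ (eqe S T c)
      (δ′-equivariant ε k S T (neg1^-square m) mk (λ i _ → eqk T (remove S i)) (λ i _ → eqk (remove T i) S)))
    (distrib ε (τsign S T) (e T S) (δ′ k T S))
    where
    distrib : ∀ ε t x y → ε * (t * x) + ε * (t * y) ≡ ε * (t * (x + y))
    distrib = solve-∀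
  cob′ : ∀ S T → _ → δ′ (λ X Y → e X Y + δ′ k X Y) S T ≡ obs m S T
  cob′ S T c = trans (δ′-+ e (δ′ k) S T) (trans (cong₂ _+_ (cobe S T c) (δ′δ′≡0 k mk S T)) (ℤP.+-identityʳ _))

Cell-retype : ∀ {n} {K L : SC n} {d S T} → Cell L d S T → K S → K T → Cell K d S T
Cell-retype (_ , _ , dj , c) KS KT = KS , KT , dj , c

Cell-moveUp : ∀ {n} (a : Fin n) {K L : SC (suc n)} {d S T} → Cell L d S T → pairAt a S ≡ TF → pairAt a T ≡ FF →
  K (moveUp a S) → K T → Cell K d (moveUp a S) T
Cell-moveUp a {S = S} {T} (_ , _ , dj , c) gS gT KfS KT = KfS , KT ,
  (λ x m → disjoint-setPairAt a false true S S T gT (λ z → z) dj x (subst (x ∈_) (moveUp-TF a S gS) m)) ,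
  trans (cong (_+ℕ ∣ T ∣) (card-moveUp a S)) c

select : ∀ {P Q : Set} → Dec P → Dec Q → ℤ → ℤ → ℤ
select (yes _) (yes _) x y = x
select (yes _) (no _) x y = y
select (no _) _ x y = y

module AdjacentContraction {n} (a : Fin n) {m} (K : SC (suc n)) (1≤m : 1 ≤ m) (decK : ∀ S → Dec (K S))
  (cx : IsComplex K) (adm : Admissible K (suc a) (inject₁ a)) (e : Cochain (suc n)) (prim : Primitive m K e) where

  ε = neg1^ m
  K′ = Contract (suc a) (inject₁ a) K

  corrected : Cochain (suc n)
  corrected X Y = e X Y + δ′ (correction a ε e) X Y

  corrected-primitive : Primitive m K corrected
  corrected-primitive = Primitive-+-δ′ prim (correction-vanishes a ε e (proj₁ prim))
    (correction-equivariant a ε e (neg1^-square m))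

  descended : Cochain (suc n)
  descended X Y = select (decK X) (decK Y) (corrected X Y) (corrected (moveUp a X) (moveUp a Y))

  descended-faces : ∀ X Y → K X → K Y → descended X Y ≡ corrected X Y
  descended-faces X Y KX KY with decK X | decK Y
  ... | yes _ | yes _ = refl
  ... | yes _ | no ¬KY = ⊥-elim (¬KY KY)
  ... | no ¬KX | _ = ⊥-elim (¬KX KX)

  descended-nonfaceˡ : ∀ X Y → ¬ K X → descended X Y ≡ corrected (moveUp a X) (moveUp a Y)
  descended-nonfaceˡ X Y ¬KX with decK X | decK Y
  ... | yes KX | _ = ⊥-elim (¬KX KX)
  ... | no _ | _ = refl

  descended-nonfaceʳ : ∀ X Y → ¬ K Y → descended X Y ≡ corrected (moveUp a X) (moveUp a Y)
  descended-nonfaceʳ X Y ¬KY with decK X | decK Y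
  ... | _ | yes KY = ⊥-elim (¬KY KY)
  ... | yes _ | no _ = refl
  ... | no _ | no _ = refl

  descended-vanishes : VanishesOnEmpty descended
  descended-vanishes = vanishesˡ , vanishesʳ
    where
    mc = proj₁ corrected-primitive
    moveUp-empty : ∀ X → nonemptyᵇ X ≡ false → nonemptyᵇ (moveUp a X) ≡ false
    moveUp-empty X h = trans (cong nonemptyᵇ (moveUp-id a X (isTF-FF (pairAt-empty a X h)))) h
    vanishesˡ : ∀ X Y → nonemptyᵇ X ≡ false → descended X Y ≡ 0ℤ
    vanishesˡ X Y h with decK X | decK Y
    ... | yes _ | yes _ = proj₁ mc X Y h
    ... | yes _ | no _ = proj₁ mc _ _ (moveUp-empty X h)
    ... | no _ | _ = proj₁ mc _ _ (moveUp-empty X h)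
    vanishesʳ : ∀ X Y → nonemptyᵇ Y ≡ false → descended X Y ≡ 0ℤ
    vanishesʳ X Y h with decK X | decK Y
    ... | yes _ | yes _ = proj₂ mc X Y h
    ... | yes _ | no _ = proj₂ mc _ _ (moveUp-empty Y h)
    ... | no _ | _ = proj₂ mc _ _ (moveUp-empty Y h)

  private
    eqc = proj₁ (proj₂ corrected-primitive)
    cobc = proj₂ (proj₂ corrected-primitive)
    cellOf : ∀ {d S T} → Cell K′ d S T → ContractedCell a K S T
    cellOf (cS , cT , dj , _) = contractedCell a K decK cx _ _ cS cT dj

  descended-equivariant : Equivariant m K′ (m ∸ 1) descended
  descended-equivariant S T c with cellOf c
  ... | inj₁ (KS , KT) = begin
    descended S T                       ≡⟨ descended-faces S T KS KT ⟩
    corrected S T                       ≡⟨ eqc S T (Cell-retype c KS KT) ⟩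
    ε * (τsign S T * corrected T S)     ≡⟨ cong (λ z → ε * (τsign S T * z)) (sym (descended-faces T S KT KS)) ⟩
    ε * (τsign S T * descended T S)     ∎
    where open ≡-Reasoning
  ... | inj₂ (inj₁ (¬KS , gS , KfS , gT , KT)) = begin
    descended S T                                      ≡⟨ descended-nonfaceˡ S T ¬KS ⟩
    corrected (moveUp a S) (moveUp a T)                ≡⟨ cong (corrected (moveUp a S)) fT ⟩
    corrected (moveUp a S) T                           ≡⟨ eqc (moveUp a S) T (Cell-moveUp a c gS gT KfS KT) ⟩
    ε * (τsign (moveUp a S) T * corrected T (moveUp a S))
      ≡⟨ cong₂ (λ u w → ε * (u * w)) (cong (λ z → neg1^ ((z ∸ 1) *ℕ (∣ T ∣ ∸ 1))) (card-moveUp a S))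
                                     (cong (λ z → corrected z (moveUp a S)) (sym fT)) ⟩
    ε * (τsign S T * corrected (moveUp a T) (moveUp a S))
        ≡⟨ cong (λ z → ε * (τsign S T * z)) (sym (descended-nonfaceʳ T S ¬KS)) ⟩
    ε * (τsign S T * descended T S)                    ∎
    where
    open ≡-Reasoning
    fT : moveUp a T ≡ T
    fT = moveUp-id a T (isTF-FF gT)
  ... | inj₂ (inj₂ (¬KT , gT , KfT , gS , KS)) = begin
    descended S T                                      ≡⟨ descended-nonfaceʳ S T ¬KT ⟩
    corrected (moveUp a S) (moveUp a T)                ≡⟨ cong (λ z → corrected z (moveUp a T)) fS ⟩
    corrected S (moveUp a T)
        ≡⟨ eqc S (moveUp a T) (Cell-swap (Cell-moveUp a (Cell-swap c) gT gS KfT KS)) ⟩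
    ε * (τsign S (moveUp a T) * corrected (moveUp a T) S)
      ≡⟨ cong₂ (λ u w → ε * (u * w)) (cong (λ z → neg1^ ((∣ S ∣ ∸ 1) *ℕ (z ∸ 1))) (card-moveUp a T))
                                     (cong (corrected (moveUp a T)) (sym fS)) ⟩
    ε * (τsign S T * corrected (moveUp a T) (moveUp a S))
        ≡⟨ cong (λ z → ε * (τsign S T * z)) (sym (descended-nonfaceˡ T S ¬KT)) ⟩
    ε * (τsign S T * descended T S)                    ∎
    where
    open ≡-Reasoning
    fS : moveUp a S ≡ S
    fS = moveUp-id a S (isTF-FF gS)

  -- X + u is a face by admissibility, and o^m vanishes on (X + u) × T.
  corrected-face : ∀ S T i → Cell K′ m S T → pairAt a S ≡ TF → K (moveUp a S) → pairAt a T ≡ FF → K T →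
    i ∈ S → pairAt a (remove S i) ≡ TF → K (remove S i) → corrected (remove S i) T ≡ corrected (moveUp a (remove S i)) T
  corrected-face S T i c gS KfS gT KT i∈ gX KX = corrected-moveUp a ε e X T gX gT filled0
    where
    X = remove S i
    A = setPairAt a true true X
    moveUpX : moveUp a X ≡ remove (moveUp a S) i
    moveUpX = moveUp-remove a S i gS i∈ gX
    KfX : K (moveUp a X)
    KfX = subst K (sym moveUpX) (proj₂ cx (moveUp a S) _ KfS (remove-⊆ (moveUp a S) i)
            (subst Nonempty moveUpX (suc a , pairAt₂⇒∈ a (moveUp a X) (cong proj₂ (pairAt-moveUp a X gX)))))
    ∣X∣ : suc ∣ X ∣ ≡ ∣ S ∣
    ∣X∣ = card-remove S i i∈
    KA : K A
    KA = admissible-fill a K decK cx adm X (moveUp a S) gX KX KfX KfS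
        (ℕP.≤-reflexive (trans ∣X∣ (sym (card-moveUp a S))))
    cellA : Cell K m A T
    cellA = KA , KT , disjoint-setPairAt a true true X S T gT (remove-⊆ S i) (proj₁ (proj₂ (proj₂ c))) ,
            trans (cong (_+ℕ ∣ T ∣) (trans (card-setPairAt-TT a X gX) ∣X∣)) (proj₂ (proj₂ (proj₂ c)))
    filled0 : δ′ e A T ≡ 0ℤ
    filled0 = trans (proj₂ (proj₂ prim) A T cellA) (obs-TT-FF a m A T (pairAt-setPairAt a true true X) gT)

  descended-cobounds-moved : ∀ S T → Cell K′ m S T → ¬ K S → pairAt a S ≡ TF → K (moveUp a S) → pairAt a T ≡ FF → K T →
    δ′ descended S T ≡ obs m S T
  descended-cobounds-moved S T c ¬KS gS KfS gT KT = begin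
    δ′ descended S T
        ≡⟨ δ′-cong _ _ S T onFacesˡ (λ j _ → descended-nonfaceˡ S (remove T j) ¬KS) ⟩
    δ′ (λ X Y → corrected (moveUp a X) (moveUp a Y)) S T     ≡⟨ δ′-moveUp a corrected S T gS gT ⟩
    δ′ corrected (moveUp a S) T                              ≡⟨ cobc (moveUp a S) T (Cell-moveUp a c gS gT KfS KT) ⟩
    obs m (moveUp a S) T                                     ≡⟨ obs-moveUp a m S T gS gT ⟩
    obs m S T                                                ∎
    where
    open ≡-Reasoning
    fT : moveUp a T ≡ T
    fT = moveUp-id a T (isTF-FF gT)
    onFacesˡ : ∀ i → i ∈ S → descended (remove S i) T ≡ corrected (moveUp a (remove S i)) (moveUp a T)
    onFacesˡ i i∈ = byFace (decK (remove S i))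
      where
      moved : pairAt a (remove S i) ≡ TF ⊎ pairAt a (remove S i) ≡ FF → K (remove S i) →
        corrected (remove S i) T ≡ corrected (moveUp a (remove S i)) T
      moved (inj₁ gX) KX = corrected-face S T i c gS KfS gT KT i∈ gX KX
      moved (inj₂ gX) _ = cong (λ z → corrected z T) (sym (moveUp-id a (remove S i) (isTF-FF gX)))
      byFace : Dec (K (remove S i)) → descended (remove S i) T ≡ corrected (moveUp a (remove S i)) (moveUp a T)
      byFace (no ¬KX) = descended-nonfaceˡ (remove S i) T ¬KX
      byFace (yes KX) = trans (descended-faces _ T KX KT) (trans (moved (pairAt-TF-⊑ a (remove-⊑ S i) gS) KX)
        (cong (corrected (moveUp a (remove S i))) (sym fT)))

  descended-cobounds : Cobounds m K′ descended
  descended-cobounds S T c with cellOf c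
  ... | inj₁ (KS , KT) = trans (δ′-cong descended corrected S T onFacesˡ onFacesʳ) (cobc S T (Cell-retype c KS KT))
    where
    mc = proj₁ corrected-primitive
    onFacesˡ : ∀ i → i ∈ S → descended (remove S i) T ≡ corrected (remove S i) T
    onFacesˡ i i∈ with nonemptyᵇ (remove S i) in h
    ... | true = descended-faces _ T (proj₂ cx S _ KS (remove-⊆ S i) (Nonempty-nonemptyᵇ _ h)) KT
    ... | false = trans (proj₁ descended-vanishes _ T h) (sym (proj₁ mc _ T h))
    onFacesʳ : ∀ i → i ∈ T → descended S (remove T i) ≡ corrected S (remove T i)
    onFacesʳ i i∈ with nonemptyᵇ (remove T i) in h
    ... | true = descended-faces S _ KS (proj₂ cx T _ KT (remove-⊆ T i) (Nonempty-nonemptyᵇ _ h))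
    ... | false = trans (proj₂ descended-vanishes S _ h) (sym (proj₂ mc S _ h))
  ... | inj₂ (inj₁ (¬KS , gS , KfS , gT , KT)) = descended-cobounds-moved S T c ¬KS gS KfS gT KT
  ... | inj₂ (inj₂ (¬KT , gT , KfT , gS , KS)) = begin
    δ′ descended S T
        ≡⟨ δ′-equivariant-cell (IsComplex-contract K (suc a) (inject₁ a) cx (suc≢inject₁ a))
                                                1≤m descended-equivariant descended-vanishes c ⟩
    ε * (τsign S T * δ′ descended T S)
        ≡⟨ cong (λ z → ε * (τsign S T * z)) (descended-cobounds-moved T S (Cell-swap c) ¬KT gT KfT gS KS) ⟩
    ε * (τsign S T * obs m T S)           ≡⟨ sym (obs-equivariant m S T) ⟩
    obs m S T                             ∎
    where open ≡-Reasoning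

  descended-primitive : Primitive m K′ descended
  descended-primitive = descended-vanishes , descended-equivariant , descended-cobounds

primitive-adjacentContraction : ∀ {n} (a : Fin n) {m} (K : SC (suc n)) → 1 ≤ m → (∀ S → Dec (K S)) → IsComplex K →
  Admissible K (suc a) (inject₁ a) → HasPrimitive m K → HasPrimitive m (Contract (suc a) (inject₁ a) K)
primitive-adjacentContraction a K 1≤m decK cx adm (e , prim) =
  descended , descended-primitive
  where open AdjacentContraction a K 1≤m decK cx adm e prim

-- Independence of the vertex order

-- Relabelling by the transposition of inject₁ a and suc a reverses the orientation of exactly
-- the simplices containing both vertices; twistSign records this.

swapAt : ∀ {n} {A : Set} → Fin n → Vec A (suc n) → Vec A (suc n)
swapAt zero (x ∷ y ∷ X) = y ∷ x ∷ X
swapAt (suc a) (x ∷ X) = x ∷ swapAt a X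

swapFin : ∀ {n} → Fin n → Fin (suc n) → Fin (suc n)
swapFin zero zero = suc zero
swapFin zero (suc zero) = zero
swapFin zero (suc (suc i)) = suc (suc i)
swapFin (suc a) zero = zero
swapFin (suc a) (suc i) = suc (swapFin a i)

twistSign : ∀ {n} → Fin n → Subset (suc n) → ℤ
twistSign zero (true ∷ true ∷ X) = - 1ℤ
twistSign zero (true ∷ false ∷ X) = 1ℤ
twistSign zero (false ∷ y ∷ X) = 1ℤ
twistSign (suc a) (x ∷ X) = twistSign a X

swapAt-involutive : ∀ {n} {A : Set} (a : Fin n) (X : Vec A (suc n)) → swapAt a (swapAt a X) ≡ X
swapAt-involutive zero (x ∷ y ∷ X) = refl
swapAt-involutive (suc a) (x ∷ X) = cong (x ∷_) (swapAt-involutive a X)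

swapFin-involutive : ∀ {n} (a : Fin n) i → swapFin a (swapFin a i) ≡ i
swapFin-involutive zero zero = refl
swapFin-involutive zero (suc zero) = refl
swapFin-involutive zero (suc (suc i)) = refl
swapFin-involutive (suc a) zero = refl
swapFin-involutive (suc a) (suc i) = cong suc (swapFin-involutive a i)

∈-swapAt⁻ : ∀ {n} (a : Fin n) X i → i ∈ swapAt a X → swapFin a i ∈ X
∈-swapAt⁻ zero (x ∷ y ∷ X) zero here = there here
∈-swapAt⁻ zero (x ∷ y ∷ X) (suc zero) (there here) = here
∈-swapAt⁻ zero (x ∷ y ∷ X) (suc (suc i)) (there (there m)) = there (there m)
∈-swapAt⁻ (suc a) (x ∷ X) zero here = here
∈-swapAt⁻ (suc a) (x ∷ X) (suc i) (there m) = there (∈-swapAt⁻ a X i m)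

∈-swapAt⁺ : ∀ {n} (a : Fin n) X i → swapFin a i ∈ X → i ∈ swapAt a X
∈-swapAt⁺ a X i m = subst (_∈ swapAt a X) (swapFin-involutive a i)
    (∈-swapAt⁻ a (swapAt a X) (swapFin a i) (subst (swapFin a i ∈_) (sym (swapAt-involutive a X)) m))

card-swapAt : ∀ {n} (a : Fin n) X → ∣ swapAt a X ∣ ≡ ∣ X ∣
card-swapAt zero (true ∷ true ∷ X) = refl
card-swapAt zero (true ∷ false ∷ X) = ℕP.+-suc 0 _
card-swapAt zero (false ∷ true ∷ X) = refl
card-swapAt zero (false ∷ false ∷ X) = refl
card-swapAt (suc a) (true ∷ X) = cong suc (card-swapAt a X)
card-swapAt (suc a) (false ∷ X) = card-swapAt a X

nonemptyᵇ-swapAt : ∀ {n} (a : Fin n) X → nonemptyᵇ (swapAt a X) ≡ nonemptyᵇ X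
nonemptyᵇ-swapAt zero (true ∷ true ∷ X) = refl
nonemptyᵇ-swapAt zero (true ∷ false ∷ X) = refl
nonemptyᵇ-swapAt zero (false ∷ true ∷ X) = refl
nonemptyᵇ-swapAt zero (false ∷ false ∷ X) = refl
nonemptyᵇ-swapAt (suc a) (true ∷ X) = refl
nonemptyᵇ-swapAt (suc a) (false ∷ X) = nonemptyᵇ-swapAt a X

twistSign-TF : ∀ {n} (a : Fin n) X → pairAt a X ≡ TF → twistSign a X ≡ 1ℤ
twistSign-TF zero (true ∷ false ∷ X) refl = refl
twistSign-TF (suc a) (x ∷ X) h = twistSign-TF a X h

twistSign-FT : ∀ {n} (a : Fin n) X → pairAt a X ≡ FT → twistSign a X ≡ 1ℤ
twistSign-FT zero (false ∷ true ∷ X) refl = refl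
twistSign-FT (suc a) (x ∷ X) h = twistSign-FT a X h

twistSign-FF : ∀ {n} (a : Fin n) X → pairAt a X ≡ FF → twistSign a X ≡ 1ℤ
twistSign-FF zero (false ∷ false ∷ X) refl = refl
twistSign-FF (suc a) (x ∷ X) h = twistSign-FF a X h

twistSign-¬TT : ∀ {n} (a : Fin n) X → pairAt a X ≢ TT → twistSign a X ≡ 1ℤ
twistSign-¬TT zero (true ∷ true ∷ X) ne = ⊥-elim (ne refl)
twistSign-¬TT zero (true ∷ false ∷ X) ne = refl
twistSign-¬TT zero (false ∷ y ∷ X) ne = refl
twistSign-¬TT (suc a) (x ∷ X) ne = twistSign-¬TT a X ne

pairAt-swapAt : ∀ {n} (a : Fin n) (X : Subset (suc n)) → pairAt a (swapAt a X)
    ≡ (proj₂ (pairAt a X) , proj₁ (pairAt a X))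
pairAt-swapAt zero (x ∷ y ∷ X) = refl
pairAt-swapAt (suc a) (x ∷ X) = pairAt-swapAt a X

disjoint-swapAt : ∀ {n} (a : Fin n) S T → (∀ x → x ∈ S → x ∉ T) → ∀ x → x ∈ swapAt a S → x ∉ swapAt a T
disjoint-swapAt a S T dj x m m' = dj (swapFin a x) (∈-swapAt⁻ a S x m) (∈-swapAt⁻ a T x m')

Cell-swapAt : ∀ {n} (a : Fin n) (K : SC (suc n)) d S T → Cell (λ X → K (swapAt a X)) d S T →
    Cell K d (swapAt a S) (swapAt a T)
Cell-swapAt a K d S T (KS , KT , dj , c) = KS , KT , disjoint-swapAt a S T dj , trans
    (cong₂ _+ℕ_ (card-swapAt a S) (card-swapAt a T)) c

τsign-swapAt : ∀ {n} (a : Fin n) S T → τsign (swapAt a S) (swapAt a T) ≡ τsign S T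
τsign-swapAt a S T = cong₂ (λ x y → neg1^ ((x ∸ 1) *ℕ (y ∸ 1))) (card-swapAt a S) (card-swapAt a T)

∂-twist : ∀ {n} (a : Fin n) (f : Subset (suc n) → ℤ) S →
  ∂ (λ X → twistSign a X * f (swapAt a X)) S ≡ twistSign a S * ∂ f (swapAt a S)
∂-twist zero f (true ∷ true ∷ S) = trans (cong (λ y → 1ℤ * f (true ∷ false ∷ S) - (1ℤ * f (false ∷ true ∷ S) - y))
      (trans (∂-ext _ _ S (λ X → ℤP.-1*i≡-i _)) (∂-neg _ S)))
  (regroup (f (true ∷ false ∷ S)) (f (false ∷ true ∷ S)) (∂ (λ X → f (true ∷ true ∷ X)) S))
  where
  regroup : ∀ p q r → 1ℤ * p - (1ℤ * q - (- r)) ≡ (- 1ℤ) * (q - (p - r))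
  regroup = solve-∀
∂-twist zero f (true ∷ false ∷ S) =
  trans (cong₂ _-_ (ℤP.*-identityˡ (f (false ∷ false ∷ S))) (∂-ext _ _ S (λ X → ℤP.*-identityˡ (f (false ∷ true ∷ X)))))
    (sym (ℤP.*-identityˡ _))
∂-twist zero f (false ∷ true ∷ S) =
  trans (cong₂ _-_ (ℤP.*-identityˡ (f (false ∷ false ∷ S))) (∂-ext _ _ S (λ X → ℤP.*-identityˡ (f (true ∷ false ∷ X)))))
    (sym (ℤP.*-identityˡ _))
∂-twist zero f (false ∷ false ∷ S) =
  trans (∂-ext _ _ S (λ X → ℤP.*-identityˡ (f (false ∷ false ∷ X)))) (sym (ℤP.*-identityˡ _))
∂-twist (suc a) f (true ∷ S) = trans
    (cong (λ y → twistSign a S * f (false ∷ swapAt a S) - y) (∂-twist a (λ X → f (true ∷ X)) S))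
  (distrib (twistSign a S) (f (false ∷ swapAt a S)) (∂ (λ X → f (true ∷ X)) (swapAt a S)))
  where
  distrib : ∀ t p q → t * p - t * q ≡ t * (p - q)
  distrib = solve-∀
∂-twist (suc a) f (false ∷ S) = ∂-twist a (λ X → f (false ∷ X)) S

δ′-twist : ∀ {n} (a : Fin n) (e : Cochain (suc n)) S T →
  δ′ (λ X Y → twistSign a X * twistSign a Y * e (swapAt a X) (swapAt a Y)) S T
      ≡ twistSign a S * twistSign a T * δ′ e (swapAt a S) (swapAt a T)
δ′-twist a e S T =
  trans (cong₂ (λ x y → x + dimSign S * y)
     (trans (∂-ext _ _ S (λ X → commute (twistSign a X) (twistSign a T) (e (swapAt a X) (swapAt a T))))
       (trans (∂-* (twistSign a T) _ S) (cong (twistSign a T *_) (∂-twist a (λ Z → e Z (swapAt a T)) S))))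
     (trans (∂-ext _ _ T (λ Y → ℤP.*-assoc (twistSign a S) (twistSign a Y) (e (swapAt a S) (swapAt a Y))))
       (trans (∂-* (twistSign a S) _ T) (cong (twistSign a S *_) (∂-twist a (λ Z → e (swapAt a S) Z) T)))))
  (trans (cong (λ z → twistSign a T * (twistSign a S * ∂ (λ Z → e Z (swapAt a T)) (swapAt a S)) + z *
      (twistSign a S * (twistSign a T * ∂ (e (swapAt a S)) (swapAt a T))))
            (cong (λ z → neg1^ (z ∸ 1)) (sym (card-swapAt a S))))
     (factor (twistSign a S) (twistSign a T) (∂ (λ Z → e Z (swapAt a T)) (swapAt a S)) (dimSign (swapAt a S))
         (∂ (e (swapAt a S)) (swapAt a T))))
  where
  commute : ∀ x y z → x * y * z ≡ y * (x * z)
  commute = solve-∀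
  factor : ∀ s t p d q → t * (s * p) + d * (s * (t * q)) ≡ s * t * (p + d * q)
  factor = solve-∀

-- Words in L and R stand for pairs (S , T) through their merged vertex sequence; ∂ᴸ and ∂ᴿ are
-- the boundary sums deleting a letter L (a vertex of S), resp. R (a vertex of T).

∂ᴸ : (List Tag → ℤ) → List Tag → ℤ
∂ᴸ F [] = 0ℤ
∂ᴸ F (L ∷ w) = F w - ∂ᴸ (λ v → F (L ∷ v)) w
∂ᴸ F (R ∷ w) = ∂ᴸ (λ v → F (R ∷ v)) w

∂ᴿ : (List Tag → ℤ) → List Tag → ℤ
∂ᴿ F [] = 0ℤ
∂ᴿ F (L ∷ w) = ∂ᴿ (λ v → F (L ∷ v)) w
∂ᴿ F (R ∷ w) = F w - ∂ᴿ (λ v → F (R ∷ v)) w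

∂ᴸ-ext : ∀ F G w → (∀ v → F v ≡ G v) → ∂ᴸ F w ≡ ∂ᴸ G w
∂ᴸ-ext F G [] h = refl
∂ᴸ-ext F G (L ∷ w) h = cong₂ _-_ (h w) (∂ᴸ-ext _ _ w (λ v → h (L ∷ v)))
∂ᴸ-ext F G (R ∷ w) h = ∂ᴸ-ext _ _ w (λ v → h (R ∷ v))

∂ᴿ-ext : ∀ F G w → (∀ v → F v ≡ G v) → ∂ᴿ F w ≡ ∂ᴿ G w
∂ᴿ-ext F G [] h = refl
∂ᴿ-ext F G (L ∷ w) h = ∂ᴿ-ext _ _ w (λ v → h (L ∷ v))
∂ᴿ-ext F G (R ∷ w) h = cong₂ _-_ (h w) (∂ᴿ-ext _ _ w (λ v → h (R ∷ v)))

∂ᴸ-0 : ∀ w → ∂ᴸ (λ _ → 0ℤ) w ≡ 0ℤ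
∂ᴸ-0 [] = refl
∂ᴸ-0 (L ∷ w) = cong (λ z → 0ℤ - z) (∂ᴸ-0 w)
∂ᴸ-0 (R ∷ w) = ∂ᴸ-0 w

∂ᴿ-0 : ∀ w → ∂ᴿ (λ _ → 0ℤ) w ≡ 0ℤ
∂ᴿ-0 [] = refl
∂ᴿ-0 (L ∷ w) = ∂ᴿ-0 w
∂ᴿ-0 (R ∷ w) = cong (λ z → 0ℤ - z) (∂ᴿ-0 w)

pairTags : Bool → Bool → List Tag
pairTags x y = (if x then L ∷ [] else []) ++ (if y then R ∷ [] else [])

∂-word≡∂ᴸ : ∀ {n} (F : List Tag → ℤ) (S T : Subset n) → ∂ (λ X → F (word X T)) S ≡ ∂ᴸ F (word S T)
∂-word≡∂ᴸ F [] [] = refl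
∂-word≡∂ᴸ F (true ∷ S) (true ∷ T) = cong (λ z → F (R ∷ word S T) - z) (∂-word≡∂ᴸ (λ v → F (L ∷ R ∷ v)) S T)
∂-word≡∂ᴸ F (true ∷ S) (false ∷ T) = cong (λ z → F (word S T) - z) (∂-word≡∂ᴸ (λ v → F (L ∷ v)) S T)
∂-word≡∂ᴸ F (false ∷ S) (true ∷ T) = ∂-word≡∂ᴸ (λ v → F (R ∷ v)) S T
∂-word≡∂ᴸ F (false ∷ S) (false ∷ T) = ∂-word≡∂ᴸ F S T

∂-word≡∂ᴿ : ∀ {n} (F : List Tag → ℤ) (S T : Subset n) → ∂ (λ Y → F (word S Y)) T ≡ ∂ᴿ F (word S T)
∂-word≡∂ᴿ F [] [] = refl
∂-word≡∂ᴿ F (true ∷ S) (true ∷ T) = cong (λ z → F (L ∷ word S T) - z) (∂-word≡∂ᴿ (λ v → F (L ∷ R ∷ v)) S T)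
∂-word≡∂ᴿ F (true ∷ S) (false ∷ T) = ∂-word≡∂ᴿ (λ v → F (L ∷ v)) S T
∂-word≡∂ᴿ F (false ∷ S) (true ∷ T) = cong (λ z → F (word S T) - z) (∂-word≡∂ᴿ (λ v → F (R ∷ v)) S T)
∂-word≡∂ᴿ F (false ∷ S) (false ∷ T) = ∂-word≡∂ᴿ F S T

-- The letter M3 stands for an occurrence of L R at the positions inject₁ a, suc a: deleting its
-- L leaves R, deleting its R leaves L.

data Tag3 : Set where
  L3 R3 M3 : Tag3

neg-distrib-sub : ∀ a b → - a - - b ≡ - (a - b)
neg-distrib-sub = solve-∀

neg-zero-sub : ∀ b → - 0ℤ - b ≡ - (1ℤ * b)
neg-zero-sub = solve-∀

mark-step : ∀ s a b → s * a - - - (s * b) ≡ - ((- s) * (a - b))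
mark-step = solve-∀

mark-skip : ∀ s b → - - (s * b) ≡ - ((- s) * b)
mark-skip = solve-∀

embed : List Tag → List Tag3
embed [] = []
embed (L ∷ w) = L3 ∷ embed w
embed (R ∷ w) = R3 ∷ embed w

∂ᴸ₃ : (List Tag3 → ℤ) → List Tag3 → ℤ
∂ᴸ₃ F [] = 0ℤ
∂ᴸ₃ F (L3 ∷ w) = F w - ∂ᴸ₃ (λ v → F (L3 ∷ v)) w
∂ᴸ₃ F (R3 ∷ w) = ∂ᴸ₃ (λ v → F (R3 ∷ v)) w
∂ᴸ₃ F (M3 ∷ w) = F (R3 ∷ w) - ∂ᴸ₃ (λ v → F (M3 ∷ v)) w

∂ᴿ₃ : (List Tag3 → ℤ) → List Tag3 → ℤ
∂ᴿ₃ F [] = 0ℤ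
∂ᴿ₃ F (L3 ∷ w) = ∂ᴿ₃ (λ v → F (L3 ∷ v)) w
∂ᴿ₃ F (R3 ∷ w) = F w - ∂ᴿ₃ (λ v → F (R3 ∷ v)) w
∂ᴿ₃ F (M3 ∷ w) = F (L3 ∷ w) - ∂ᴿ₃ (λ v → F (M3 ∷ v)) w

∂ᴸ₃-neg : ∀ F w → ∂ᴸ₃ (λ v → - F v) w ≡ - ∂ᴸ₃ F w
∂ᴸ₃-neg F [] = refl
∂ᴸ₃-neg F (L3 ∷ w) = trans (cong (λ z → - F w - z) (∂ᴸ₃-neg _ w)) (neg-distrib-sub (F w) _)
∂ᴸ₃-neg F (R3 ∷ w) = ∂ᴸ₃-neg _ w
∂ᴸ₃-neg F (M3 ∷ w) = trans (cong (λ z → - F (R3 ∷ w) - z) (∂ᴸ₃-neg _ w)) (neg-distrib-sub (F (R3 ∷ w)) _)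

∂ᴿ₃-neg : ∀ F w → ∂ᴿ₃ (λ v → - F v) w ≡ - ∂ᴿ₃ F w
∂ᴿ₃-neg F [] = refl
∂ᴿ₃-neg F (L3 ∷ w) = ∂ᴿ₃-neg _ w
∂ᴿ₃-neg F (R3 ∷ w) = trans (cong (λ z → - F w - z) (∂ᴿ₃-neg _ w)) (neg-distrib-sub (F w) _)
∂ᴿ₃-neg F (M3 ∷ w) = trans (cong (λ z → - F (L3 ∷ w) - z) (∂ᴿ₃-neg _ w)) (neg-distrib-sub (F (L3 ∷ w)) _)

∂ᴸ₃-embed : ∀ F w → ∂ᴸ₃ F (embed w) ≡ ∂ᴸ (λ v → F (embed v)) w
∂ᴸ₃-embed F [] = refl
∂ᴸ₃-embed F (L ∷ w) = cong (λ z → F (embed w) - z) (∂ᴸ₃-embed _ w)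
∂ᴸ₃-embed F (R ∷ w) = ∂ᴸ₃-embed _ w

∂ᴿ₃-embed : ∀ F w → ∂ᴿ₃ F (embed w) ≡ ∂ᴿ (λ v → F (embed v)) w
∂ᴿ₃-embed F [] = refl
∂ᴿ₃-embed F (L ∷ w) = ∂ᴿ₃-embed _ w
∂ᴿ₃-embed F (R ∷ w) = cong (λ z → F (embed w) - z) (∂ᴿ₃-embed _ w)

ifUnmarked : (List Tag → ℤ) → List Tag3 → ℤ
ifUnmarked G [] = G []
ifUnmarked G (L3 ∷ u) = ifUnmarked (λ v → G (L ∷ v)) u
ifUnmarked G (R3 ∷ u) = ifUnmarked (λ v → G (R ∷ v)) u
ifUnmarked G (M3 ∷ u) = 0ℤ

atMark : (List Tag → ℤ) → List Tag3 → ℤ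
atMark G [] = 0ℤ
atMark G (L3 ∷ u) = - atMark (λ v → G (L ∷ v)) u
atMark G (R3 ∷ u) = - atMark (λ v → G (R ∷ v)) u
atMark G (M3 ∷ u) = ifUnmarked G u

ifUnmarked-embed : ∀ G w → ifUnmarked G (embed w) ≡ G w
ifUnmarked-embed G [] = refl
ifUnmarked-embed G (L ∷ w) = ifUnmarked-embed _ w
ifUnmarked-embed G (R ∷ w) = ifUnmarked-embed _ w

atMark-embed : ∀ G w → atMark G (embed w) ≡ 0ℤ
atMark-embed G [] = refl
atMark-embed G (L ∷ w) = cong -_ (atMark-embed _ w)
atMark-embed G (R ∷ w) = cong -_ (atMark-embed _ w)

atMark-value : ∀ G w1 w2 → atMark G (embed w1 ++ M3 ∷ embed w2) ≡ neg1^ (length w1) * G (w1 ++ w2)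
atMark-value G [] w2 = trans (ifUnmarked-embed G w2) (sym (ℤP.*-identityˡ _))
atMark-value G (L ∷ w1) w2 = trans (cong -_ (atMark-value _ w1 w2))
    (ℤP.neg-distribˡ-* (neg1^ (length w1)) (G (L ∷ (w1 ++ w2))))
atMark-value G (R ∷ w1) w2 = trans (cong -_ (atMark-value _ w1 w2))
    (ℤP.neg-distribˡ-* (neg1^ (length w1)) (G (R ∷ (w1 ++ w2))))

∂ᴸ₃-atMark : ∀ G w1 w2 → ∂ᴸ₃ (atMark G) (embed w1 ++ M3 ∷ embed w2) ≡ - (neg1^ (length w1) * ∂ᴸ G (w1 ++ w2))
∂ᴸ₃-atMark G [] w2 = trans (cong (λ z → - atMark (λ v → G (R ∷ v)) (embed w2) - z)
      (trans (∂ᴸ₃-embed (ifUnmarked G) w2) (∂ᴸ-ext _ _ w2 (ifUnmarked-embed G))))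
    (trans (cong (λ z → - z - ∂ᴸ G w2) (atMark-embed _ w2)) (neg-zero-sub (∂ᴸ G w2)))
∂ᴸ₃-atMark G (L ∷ w1) w2 =
  trans (cong₂ _-_ (atMark-value G w1 w2)
      (trans (∂ᴸ₃-neg (atMark (λ v → G (L ∷ v))) (embed w1 ++ M3 ∷ embed w2))
          (cong -_ (∂ᴸ₃-atMark (λ v → G (L ∷ v)) w1 w2))))
    (mark-step (neg1^ (length w1)) (G (w1 ++ w2)) (∂ᴸ (λ v → G (L ∷ v)) (w1 ++ w2)))
∂ᴸ₃-atMark G (R ∷ w1) w2 =
  trans (trans (∂ᴸ₃-neg (atMark (λ v → G (R ∷ v))) (embed w1 ++ M3 ∷ embed w2))
      (cong -_ (∂ᴸ₃-atMark (λ v → G (R ∷ v)) w1 w2)))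
    (mark-skip (neg1^ (length w1)) (∂ᴸ (λ v → G (R ∷ v)) (w1 ++ w2)))

∂ᴿ₃-atMark : ∀ G w1 w2 → ∂ᴿ₃ (atMark G) (embed w1 ++ M3 ∷ embed w2) ≡ - (neg1^ (length w1) * ∂ᴿ G (w1 ++ w2))
∂ᴿ₃-atMark G [] w2 = trans (cong (λ z → - atMark (λ v → G (L ∷ v)) (embed w2) - z)
      (trans (∂ᴿ₃-embed (ifUnmarked G) w2) (∂ᴿ-ext _ _ w2 (ifUnmarked-embed G))))
    (trans (cong (λ z → - z - ∂ᴿ G w2) (atMark-embed _ w2)) (neg-zero-sub (∂ᴿ G w2)))
∂ᴿ₃-atMark G (R ∷ w1) w2 =
  trans (cong₂ _-_ (atMark-value G w1 w2)
      (trans (∂ᴿ₃-neg (atMark (λ v → G (R ∷ v))) (embed w1 ++ M3 ∷ embed w2))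
          (cong -_ (∂ᴿ₃-atMark (λ v → G (R ∷ v)) w1 w2))))
    (mark-step (neg1^ (length w1)) (G (w1 ++ w2)) (∂ᴿ (λ v → G (R ∷ v)) (w1 ++ w2)))
∂ᴿ₃-atMark G (L ∷ w1) w2 =
  trans (trans (∂ᴿ₃-neg (atMark (λ v → G (L ∷ v))) (embed w1 ++ M3 ∷ embed w2))
      (cong -_ (∂ᴿ₃-atMark (λ v → G (L ∷ v)) w1 w2)))
    (mark-skip (neg1^ (length w1)) (∂ᴿ (λ v → G (L ∷ v)) (w1 ++ w2)))

markedPair : Bool → Bool → Bool → Bool → List Tag3
markedPair true false false true = M3 ∷ []
markedPair x x' y y' = embed (pairTags x y ++ pairTags x' y')

markedWord : ∀ {n} → Fin n → Subset (suc n) → Subset (suc n) → List Tag3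
markedWord zero (x ∷ x' ∷ S) (y ∷ y' ∷ T) = markedPair x x' y y' ++ embed (word S T)
markedWord (suc a) (x ∷ S) (y ∷ T) = embed (pairTags x y) ++ markedWord a S T

wordBefore : ∀ {n} → Fin n → Subset (suc n) → Subset (suc n) → List Tag
wordBefore zero S T = []
wordBefore (suc a) (x ∷ S) (y ∷ T) = pairTags x y ++ wordBefore a S T

wordAfter : ∀ {n} → Fin n → Subset (suc n) → Subset (suc n) → List Tag
wordAfter zero (x ∷ x' ∷ S) (y ∷ y' ∷ T) = word S T
wordAfter (suc a) (x ∷ S) (y ∷ T) = wordAfter a S T

∂-markedWord≡∂ᴸ₃ : ∀ {n} (a : Fin n) F S T → pairAt a S ≡ TF → pairAt a T ≡ FT →
  ∂ (λ X → F (markedWord a X T)) S ≡ ∂ᴸ₃ F (markedWord a S T)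
∂-markedWord≡∂ᴸ₃ zero F (true ∷ false ∷ S) (false ∷ true ∷ T) refl refl =
  cong (λ z → F (R3 ∷ embed (word S T)) - z)
    (trans (∂-word≡∂ᴸ (λ v → F (M3 ∷ embed v)) S T) (sym (∂ᴸ₃-embed (λ v → F (M3 ∷ v)) (word S T))))
∂-markedWord≡∂ᴸ₃ (suc a) F (true ∷ S) (true ∷ T) hS hT = cong (λ z → F (R3 ∷ markedWord a S T) - z)
    (∂-markedWord≡∂ᴸ₃ a (λ v → F (L3 ∷ R3 ∷ v)) S T hS hT)
∂-markedWord≡∂ᴸ₃ (suc a) F (true ∷ S) (false ∷ T) hS hT = cong (λ z → F (markedWord a S T) - z)
    (∂-markedWord≡∂ᴸ₃ a (λ v → F (L3 ∷ v)) S T hS hT)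
∂-markedWord≡∂ᴸ₃ (suc a) F (false ∷ S) (true ∷ T) hS hT = ∂-markedWord≡∂ᴸ₃ a (λ v → F (R3 ∷ v)) S T hS hT
∂-markedWord≡∂ᴸ₃ (suc a) F (false ∷ S) (false ∷ T) hS hT = ∂-markedWord≡∂ᴸ₃ a F S T hS hT

∂-markedWord≡∂ᴿ₃ : ∀ {n} (a : Fin n) F S T → pairAt a S ≡ TF → pairAt a T ≡ FT →
  ∂ (λ Y → F (markedWord a S Y)) T ≡ ∂ᴿ₃ F (markedWord a S T)
∂-markedWord≡∂ᴿ₃ zero F (true ∷ false ∷ S) (false ∷ true ∷ T) refl refl =
  cong (λ z → F (L3 ∷ embed (word S T)) - z)
    (trans (∂-word≡∂ᴿ (λ v → F (M3 ∷ embed v)) S T) (sym (∂ᴿ₃-embed (λ v → F (M3 ∷ v)) (word S T))))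
∂-markedWord≡∂ᴿ₃ (suc a) F (true ∷ S) (true ∷ T) hS hT = cong (λ z → F (L3 ∷ markedWord a S T) - z)
    (∂-markedWord≡∂ᴿ₃ a (λ v → F (L3 ∷ R3 ∷ v)) S T hS hT)
∂-markedWord≡∂ᴿ₃ (suc a) F (true ∷ S) (false ∷ T) hS hT = ∂-markedWord≡∂ᴿ₃ a (λ v → F (L3 ∷ v)) S T hS hT
∂-markedWord≡∂ᴿ₃ (suc a) F (false ∷ S) (true ∷ T) hS hT = cong (λ z → F (markedWord a S T) - z)
    (∂-markedWord≡∂ᴿ₃ a (λ v → F (R3 ∷ v)) S T hS hT)
∂-markedWord≡∂ᴿ₃ (suc a) F (false ∷ S) (false ∷ T) hS hT = ∂-markedWord≡∂ᴿ₃ a F S T hS hT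

word-split : ∀ {n} (a : Fin n) S T → pairAt a S ≡ TF → pairAt a T ≡ FT →
  word S T ≡ wordBefore a S T ++ L ∷ R ∷ wordAfter a S T
word-split zero (true ∷ false ∷ S) (false ∷ true ∷ T) refl refl = refl
word-split (suc a) (true ∷ S) (true ∷ T) hS hT = cong (λ z → L ∷ R ∷ z) (word-split a S T hS hT)
word-split (suc a) (true ∷ S) (false ∷ T) hS hT = cong (L ∷_) (word-split a S T hS hT)
word-split (suc a) (false ∷ S) (true ∷ T) hS hT = cong (R ∷_) (word-split a S T hS hT)
word-split (suc a) (false ∷ S) (false ∷ T) hS hT = word-split a S T hS hT

word-split-swapAt : ∀ {n} (a : Fin n) S T → pairAt a S ≡ TF → pairAt a T ≡ FT →
  word (swapAt a S) (swapAt a T) ≡ wordBefore a S T ++ R ∷ L ∷ wordAfter a S T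
word-split-swapAt zero (true ∷ false ∷ S) (false ∷ true ∷ T) refl refl = refl
word-split-swapAt (suc a) (true ∷ S) (true ∷ T) hS hT = cong (λ z → L ∷ R ∷ z) (word-split-swapAt a S T hS hT)
word-split-swapAt (suc a) (true ∷ S) (false ∷ T) hS hT = cong (L ∷_) (word-split-swapAt a S T hS hT)
word-split-swapAt (suc a) (false ∷ S) (true ∷ T) hS hT = cong (R ∷_) (word-split-swapAt a S T hS hT)
word-split-swapAt (suc a) (false ∷ S) (false ∷ T) hS hT = word-split-swapAt a S T hS hT

markedWord-split : ∀ {n} (a : Fin n) S T → pairAt a S ≡ TF → pairAt a T ≡ FT →
  markedWord a S T ≡ embed (wordBefore a S T) ++ M3 ∷ embed (wordAfter a S T)
markedWord-split zero (true ∷ false ∷ S) (false ∷ true ∷ T) refl refl = refl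
markedWord-split (suc a) (true ∷ S) (true ∷ T) hS hT = cong (λ z → L3 ∷ R3 ∷ z) (markedWord-split a S T hS hT)
markedWord-split (suc a) (true ∷ S) (false ∷ T) hS hT = cong (L3 ∷_) (markedWord-split a S T hS hT)
markedWord-split (suc a) (false ∷ S) (true ∷ T) hS hT = cong (R3 ∷_) (markedWord-split a S T hS hT)
markedWord-split (suc a) (false ∷ S) (false ∷ T) hS hT = markedWord-split a S T hS hT

markedWord-FF-FT : ∀ {n} (a : Fin n) S T → pairAt a S ≡ FF → pairAt a T ≡ FT → markedWord a S T ≡ embed (word S T)
markedWord-FF-FT zero (false ∷ false ∷ S) (false ∷ true ∷ T) refl refl = refl
markedWord-FF-FT (suc a) (true ∷ S) (true ∷ T) hS hT = cong (λ z → L3 ∷ R3 ∷ z) (markedWord-FF-FT a S T hS hT)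
markedWord-FF-FT (suc a) (true ∷ S) (false ∷ T) hS hT = cong (L3 ∷_) (markedWord-FF-FT a S T hS hT)
markedWord-FF-FT (suc a) (false ∷ S) (true ∷ T) hS hT = cong (R3 ∷_) (markedWord-FF-FT a S T hS hT)
markedWord-FF-FT (suc a) (false ∷ S) (false ∷ T) hS hT = markedWord-FF-FT a S T hS hT

markedWord-TF-FF : ∀ {n} (a : Fin n) S T → pairAt a S ≡ TF → pairAt a T ≡ FF → markedWord a S T ≡ embed (word S T)
markedWord-TF-FF zero (true ∷ false ∷ S) (false ∷ false ∷ T) refl refl = refl
markedWord-TF-FF (suc a) (true ∷ S) (true ∷ T) hS hT = cong (λ z → L3 ∷ R3 ∷ z) (markedWord-TF-FF a S T hS hT)
markedWord-TF-FF (suc a) (true ∷ S) (false ∷ T) hS hT = cong (L3 ∷_) (markedWord-TF-FF a S T hS hT)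
markedWord-TF-FF (suc a) (false ∷ S) (true ∷ T) hS hT = cong (R3 ∷_) (markedWord-TF-FF a S T hS hT)
markedWord-TF-FF (suc a) (false ∷ S) (false ∷ T) hS hT = markedWord-TF-FF a S T hS hT

pickTF-FT : Bool × Bool → Bool × Bool → ℤ → ℤ → ℤ
pickTF-FT TF FT x y = x
pickTF-FT FT TF x y = y
pickTF-FT _ _ x y = 0ℤ

pickTF-FT-equivariant : ∀ p q (A B ε τ τ' : ℤ) → ε * ε ≡ 1ℤ → τ * τ' ≡ 1ℤ →
  pickTF-FT p q A (ε * (τ * B)) ≡ ε * (τ * pickTF-FT q p B (ε * (τ' * A)))
pickTF-FT-equivariant TF FT A B ε τ τ' εε ττ = twice-equivariant ε τ τ' A εε ττ
pickTF-FT-equivariant FT TF A B ε τ τ' εε ττ = refl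
pickTF-FT-equivariant TT TT A B ε τ τ' εε ττ = zero-scaled ε τ
pickTF-FT-equivariant TT TF A B ε τ τ' εε ττ = zero-scaled ε τ
pickTF-FT-equivariant TT FT A B ε τ τ' εε ττ = zero-scaled ε τ
pickTF-FT-equivariant TT FF A B ε τ τ' εε ττ = zero-scaled ε τ
pickTF-FT-equivariant TF TT A B ε τ τ' εε ττ = zero-scaled ε τ
pickTF-FT-equivariant TF TF A B ε τ τ' εε ττ = zero-scaled ε τ
pickTF-FT-equivariant TF FF A B ε τ τ' εε ττ = zero-scaled ε τ
pickTF-FT-equivariant FT TT A B ε τ τ' εε ττ = zero-scaled ε τ
pickTF-FT-equivariant FT FT A B ε τ τ' εε ττ = zero-scaled ε τ
pickTF-FT-equivariant FT FF A B ε τ τ' εε ττ = zero-scaled ε τ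
pickTF-FT-equivariant FF TT A B ε τ τ' εε ττ = zero-scaled ε τ
pickTF-FT-equivariant FF TF A B ε τ τ' εε ττ = zero-scaled ε τ
pickTF-FT-equivariant FF FT A B ε τ τ' εε ττ = zero-scaled ε τ
pickTF-FT-equivariant FF FF A B ε τ τ' εε ττ = zero-scaled ε τ

pickTF-FT-FFˡ : ∀ q (x y : ℤ) → pickTF-FT FF q x y ≡ 0ℤ
pickTF-FT-FFˡ TT x y = refl
pickTF-FT-FFˡ TF x y = refl
pickTF-FT-FFˡ FT x y = refl
pickTF-FT-FFˡ FF x y = refl

pickTF-FT-FFʳ : ∀ p (x y : ℤ) → pickTF-FT p FF x y ≡ 0ℤ
pickTF-FT-FFʳ TT x y = refl
pickTF-FT-FFʳ TF x y = refl
pickTF-FT-FFʳ FT x y = refl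
pickTF-FT-FFʳ FF x y = refl

isOdd : ℕ → Bool
isOdd zero = false
isOdd (suc m) = not (isOdd m)

homotopySign : ℕ → ℤ
homotopySign zero = 1ℤ
homotopySign (suc zero) = 1ℤ
homotopySign (suc (suc m)) = if isOdd m then - homotopySign m else homotopySign m

alternatingIndicator : ℕ → List Tag → ℤ
alternatingIndicator m = indicator (alternating L (m ∸ 1))

unmarkedWord : ∀ {n} → Fin n → Subset (suc n) → Subset (suc n) → List Tag
unmarkedWord a S T = wordBefore a S T ++ wordAfter a S T

-- On an (m-1)-cell S × T with v ∈ S ∌ u and u ∈ T ∌ v, the homotopy is ±1 exactly when the merged
-- word of S and T without the letters of v and u is L R L R ... of length m - 1.
homotopy : ∀ {n} → Fin n → ℕ → Cochain (suc n)
homotopy a m X Y = homotopySign m * atMark (alternatingIndicator m) (markedWord a X Y)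

swapHomotopy : ∀ {n} → Fin n → ℕ → Cochain (suc n)
swapHomotopy a m X Y =
  pickTF-FT (pairAt a X) (pairAt a Y) (homotopy a m X Y) (neg1^ m * (τsign X Y * homotopy a m Y X))

swapHomotopy-equivariant : ∀ {n} (a : Fin n) m X Y → swapHomotopy a m X Y ≡ neg1^ m * (τsign X Y * swapHomotopy a m Y X)
swapHomotopy-equivariant a m X Y =
  pickTF-FT-equivariant (pairAt a X) (pairAt a Y) _ _ (neg1^ m) (τsign X Y) (τsign Y X) (neg1^-square m)
      (τsign-square X Y)

swapHomotopy-FFˡ : ∀ {n} (a : Fin n) m X Y → pairAt a X ≡ FF → swapHomotopy a m X Y ≡ 0ℤ
swapHomotopy-FFˡ a m X Y h rewrite h = pickTF-FT-FFˡ (pairAt a Y) (homotopy a m X Y)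
    (neg1^ m * (τsign X Y * homotopy a m Y X))

swapHomotopy-FFʳ : ∀ {n} (a : Fin n) m X Y → pairAt a Y ≡ FF → swapHomotopy a m X Y ≡ 0ℤ
swapHomotopy-FFʳ a m X Y h rewrite h = pickTF-FT-FFʳ (pairAt a X) (homotopy a m X Y)
    (neg1^ m * (τsign X Y * homotopy a m Y X))

swapHomotopy-vanishes : ∀ {n} (a : Fin n) m → VanishesOnEmpty (swapHomotopy a m)
swapHomotopy-vanishes a m =
  (λ X Y h → swapHomotopy-FFˡ a m X Y (pairAt-empty a X h)) , (λ X Y h → swapHomotopy-FFʳ a m X Y (pairAt-empty a Y h))

δ′-swapHomotopy-TF-FT : ∀ {n} (a : Fin n) m S T → pairAt a S ≡ TF → pairAt a T ≡ FT →
  δ′ (swapHomotopy a m) S T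
    ≡ homotopySign m * (- (neg1^ (length (wordBefore a S T)) * ∂ᴸ (alternatingIndicator m) (unmarkedWord a S T)))
      + dimSign S * (homotopySign m *
          (- (neg1^ (length (wordBefore a S T)) * ∂ᴿ (alternatingIndicator m) (unmarkedWord a S T))))
δ′-swapHomotopy-TF-FT a m S T hS hT = cong₂ (λ x y → x + dimSign S * y) alongS alongT
  where
  c = homotopySign m
  G = atMark (alternatingIndicator m)
  onFacesˡ : ∀ X → pairAt a X ≡ TF ⊎ pairAt a X ≡ FF → swapHomotopy a m X T ≡ c * G (markedWord a X T)
  onFacesˡ X (inj₁ g) rewrite g | hT = refl
  onFacesˡ X (inj₂ g) = trans (swapHomotopy-FFˡ a m X T g)
    (sym (trans (cong (λ z → c * G z) (markedWord-FF-FT a X T g hT))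
        (trans (cong (c *_) (atMark-embed _ (word X T))) (ℤP.*-zeroʳ c))))
  onFacesʳ : ∀ Y → pairAt a Y ≡ FT ⊎ pairAt a Y ≡ FF → swapHomotopy a m S Y ≡ c * G (markedWord a S Y)
  onFacesʳ Y (inj₁ g) rewrite g | hS = refl
  onFacesʳ Y (inj₂ g) = trans (swapHomotopy-FFʳ a m S Y g)
    (sym (trans (cong (λ z → c * G z) (markedWord-TF-FF a S Y hS g))
        (trans (cong (c *_) (atMark-embed _ (word S Y))) (ℤP.*-zeroʳ c))))
  alongS : ∂ (λ X → swapHomotopy a m X T) S
      ≡ c * (- (neg1^ (length (wordBefore a S T)) * ∂ᴸ (alternatingIndicator m) (unmarkedWord a S T)))
  alongS = trans (∂-cong _ (λ X → c * G (markedWord a X T)) S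
      (λ i i∈ → onFacesˡ (remove S i) (pairAt-TF-⊑ a (remove-⊑ S i) hS)))
    (trans (∂-* c _ S) (cong (c *_) (trans (∂-markedWord≡∂ᴸ₃ a G S T hS hT)
      (trans (cong (∂ᴸ₃ G) (markedWord-split a S T hS hT))
          (∂ᴸ₃-atMark (alternatingIndicator m) (wordBefore a S T) (wordAfter a S T))))))
  alongT : ∂ (λ Y → swapHomotopy a m S Y) T
      ≡ c * (- (neg1^ (length (wordBefore a S T)) * ∂ᴿ (alternatingIndicator m) (unmarkedWord a S T)))
  alongT = trans (∂-cong _ (λ Y → c * G (markedWord a S Y)) T
      (λ i i∈ → onFacesʳ (remove T i) (pairAt-FT-⊑ a (remove-⊑ T i) hT)))
    (trans (∂-* c _ T) (cong (c *_) (trans (∂-markedWord≡∂ᴿ₃ a G S T hS hT)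
      (trans (cong (∂ᴿ₃ G) (markedWord-split a S T hS hT))
          (∂ᴿ₃-atMark (alternatingIndicator m) (wordBefore a S T) (wordAfter a S T))))))

toℤ : Bool → ℤ
toℤ true = 1ℤ
toℤ false = 0ℤ

if-toℤ : ∀ b → (if b then 1ℤ else 0ℤ) ≡ toℤ b
if-toℤ true = refl
if-toℤ false = refl

tagSign : Tag → ℤ
tagSign L = 1ℤ
tagSign R = - 1ℤ

tagSign-∧ : ∀ y b → toℤ (tagEq y L ∧ b) - toℤ (tagEq y R ∧ b) ≡ tagSign y * toℤ b
tagSign-∧ L true = refl
tagSign-∧ L false = refl
tagSign-∧ R true = refl
tagSign-∧ R false = refl

tagSign-flipTag^ : ∀ j y → tagSign (flipTag^ j y) ≡ neg1^ j * tagSign y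
tagSign-flipTag^ zero y = sym (ℤP.*-identityˡ _)
tagSign-flipTag^ (suc j) L = trans (tagSign-flipTag^ j R) (simplify (neg1^ j))
  where
  simplify : ∀ s → s * (- 1ℤ) ≡ (- s) * 1ℤ
  simplify = solve-∀
tagSign-flipTag^ (suc j) R = trans (tagSign-flipTag^ j L) (simplify (neg1^ j))
  where
  simplify : ∀ s → s * 1ℤ ≡ (- s) * (- 1ℤ)
  simplify = solve-∀

listEq-split : ∀ w1 w2 z x r → listEq (w1 ++ x ∷ flipTag x ∷ w2) (alternating z (length w1 +ℕ suc (suc r))) ≡
  tagEq (flipTag^ (length w1) z) x ∧ listEq (w1 ++ w2) (alternating z (length w1 +ℕ r))
listEq-split [] w2 L L r = refl
listEq-split [] w2 L R r = refl
listEq-split [] w2 R L r = refl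
listEq-split [] w2 R R r = refl
listEq-split (y ∷ w1) w2 z x r with tagEq y z
... | true = listEq-split w1 w2 (flipTag z) x r
... | false = sym (BP.∧-zeroʳ _)

#L : List Tag → ℕ
#L [] = 0
#L (L ∷ w) = suc (#L w)
#L (R ∷ w) = #L w

#R : List Tag → ℕ
#R [] = 0
#R (L ∷ w) = #R w
#R (R ∷ w) = suc (#R w)

#L-++ : ∀ u v → #L (u ++ v) ≡ #L u +ℕ #L v
#L-++ [] v = refl
#L-++ (L ∷ u) v = cong suc (#L-++ u v)
#L-++ (R ∷ u) v = #L-++ u v

#R-++ : ∀ u v → #R (u ++ v) ≡ #R u +ℕ #R v
#R-++ [] v = refl
#R-++ (L ∷ u) v = #R-++ u v
#R-++ (R ∷ u) v = cong suc (#R-++ u v)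

card-#L : ∀ {n} (S T : Subset n) → ∣ S ∣ ≡ #L (word S T)
card-#L [] [] = refl
card-#L (true ∷ S) (true ∷ T) = cong suc (card-#L S T)
card-#L (true ∷ S) (false ∷ T) = cong suc (card-#L S T)
card-#L (false ∷ S) (true ∷ T) = card-#L S T
card-#L (false ∷ S) (false ∷ T) = card-#L S T

card-#R : ∀ {n} (S T : Subset n) → ∣ T ∣ ≡ #R (word S T)
card-#R [] [] = refl
card-#R (true ∷ S) (true ∷ T) = cong suc (card-#R S T)
card-#R (true ∷ S) (false ∷ T) = card-#R S T
card-#R (false ∷ S) (true ∷ T) = cong suc (card-#R S T)
card-#R (false ∷ S) (false ∷ T) = card-#R S T

len-word : ∀ {n} (S T : Subset n) → length (word S T) ≡ ∣ S ∣ +ℕ ∣ T ∣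
len-word [] [] = refl
len-word (true ∷ S) (true ∷ T) = cong suc (trans (cong suc (len-word S T)) (sym (ℕP.+-suc ∣ S ∣ ∣ T ∣)))
len-word (true ∷ S) (false ∷ T) = cong suc (len-word S T)
len-word (false ∷ S) (true ∷ T) = trans (cong suc (len-word S T)) (sym (ℕP.+-suc ∣ S ∣ ∣ T ∣))
len-word (false ∷ S) (false ∷ T) = len-word S T

flipTags : List Tag → List Tag
flipTags [] = []
flipTags (x ∷ w) = flipTag x ∷ flipTags w

flipTags-++ : ∀ u v → flipTags (u ++ v) ≡ flipTags u ++ flipTags v
flipTags-++ [] v = refl
flipTags-++ (x ∷ u) v = cong (flipTag x ∷_) (flipTags-++ u v)

length-flipTags : ∀ u → length (flipTags u) ≡ length u
length-flipTags [] = refl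
length-flipTags (x ∷ u) = cong suc (length-flipTags u)

word-flip : ∀ {n} (S T : Subset n) → (∀ x → x ∈ S → x ∉ T) → word T S ≡ flipTags (word S T)
word-flip [] [] dj = refl
word-flip (true ∷ S) (true ∷ T) dj = ⊥-elim (dj zero here here)
word-flip (true ∷ S) (false ∷ T) dj = cong (R ∷_) (word-flip S T (λ x m m' → dj (suc x) (there m) (there m')))
word-flip (false ∷ S) (true ∷ T) dj = cong (L ∷_) (word-flip S T (λ x m m' → dj (suc x) (there m) (there m')))
word-flip (false ∷ S) (false ∷ T) dj = word-flip S T (λ x m m' → dj (suc x) (there m) (there m'))

listEq-flipTags : ∀ v z k → listEq (flipTags v) (alternating z k) ≡ listEq v (alternating (flipTag z) k)
listEq-flipTags [] z zero = refl
listEq-flipTags [] z (suc k) = refl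
listEq-flipTags (x ∷ v) z zero = refl
listEq-flipTags (L ∷ v) L (suc k) = refl
listEq-flipTags (L ∷ v) R (suc k) = listEq-flipTags v L k
listEq-flipTags (R ∷ v) L (suc k) = listEq-flipTags v R k
listEq-flipTags (R ∷ v) R (suc k) = refl

-- Of the words w from which deleting one L gives alternating x k, only L ∷ alternating x k and
-- alternating x (suc k) contribute to ∂ᴸ: any other insertion of an L creates a repeated L, whose
-- two deletions cancel.  ∂ᴸ-front and ∂ᴸ-sign record the two contributions.
∂ᴸ-front : Tag → ℕ → List Tag → ℤ
∂ᴸ-front R k w = indicator (L ∷ alternating R k) w
∂ᴸ-front L zero w = indicator (L ∷ []) w
∂ᴸ-front L (suc k) w = 0ℤ

∂ᴸ-sign : Tag → ℕ → ℤ
∂ᴸ-sign x zero = 0ℤ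
∂ᴸ-sign L (suc k) = - ∂ᴸ-sign R k
∂ᴸ-sign R (suc zero) = 1ℤ
∂ᴸ-sign R (suc (suc k)) = ∂ᴸ-sign L (suc k)

∂ᴿ-front : Tag → ℕ → List Tag → ℤ
∂ᴿ-front L k w = indicator (R ∷ alternating L k) w
∂ᴿ-front R zero w = indicator (R ∷ []) w
∂ᴿ-front R (suc k) w = 0ℤ

∂ᴿ-sign : Tag → ℕ → ℤ
∂ᴿ-sign x zero = 0ℤ
∂ᴿ-sign R (suc k) = - ∂ᴿ-sign L k
∂ᴿ-sign L (suc zero) = 1ℤ
∂ᴿ-sign L (suc (suc k)) = ∂ᴿ-sign R (suc k)

∂ᴸ-alternating : ∀ x k w → ∂ᴸ (indicator (alternating x k)) w
    ≡ ∂ᴸ-front x k w + ∂ᴸ-sign x k * indicator (alternating x (suc k)) w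
∂ᴸ-alternating L zero [] = refl
∂ᴸ-alternating L (suc k) [] = sym (trans (cong (0ℤ +_) (ℤP.*-zeroʳ (- ∂ᴸ-sign R k))) refl)
∂ᴸ-alternating R zero [] = refl
∂ᴸ-alternating R (suc k) [] = sym (cong (0ℤ +_) (ℤP.*-zeroʳ (∂ᴸ-sign R (suc k))))
∂ᴸ-alternating L zero (L ∷ w) = trans (cong (λ z → indicator [] w - z) (∂ᴸ-0 w)) (simplify (indicator [] w))
  where
  simplify : ∀ a → a - 0ℤ ≡ a + 0ℤ * 0ℤ
  simplify = solve-∀
∂ᴸ-alternating L (suc k) (L ∷ w) = trans
    (cong (λ z → indicator (L ∷ alternating R k) w - z) (∂ᴸ-alternating R k w))
        (simplify (indicator (L ∷ alternating R k) w) (∂ᴸ-sign R k) (indicator (alternating R (suc k)) w))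
  where
  simplify : ∀ a e b → a - (a + e * b) ≡ 0ℤ + (- e) * b
  simplify = solve-∀
∂ᴸ-alternating R zero (L ∷ w) = trans (cong (λ z → indicator [] w - z) (∂ᴸ-0 w)) (simplify (indicator [] w))
  where
  simplify : ∀ a → a - 0ℤ ≡ a + 0ℤ * 0ℤ
  simplify = solve-∀
∂ᴸ-alternating R (suc k) (L ∷ w) = trans (cong (λ z → indicator (R ∷ alternating L k) w - z) (∂ᴸ-0 w))
    (simplify (indicator (R ∷ alternating L k) w) (∂ᴸ-sign R (suc k)))
  where
  simplify : ∀ a e → a - 0ℤ ≡ a + e * 0ℤ
  simplify = solve-∀
∂ᴸ-alternating L zero (R ∷ w) = ∂ᴸ-0 w
∂ᴸ-alternating L (suc k) (R ∷ w) = trans (∂ᴸ-0 w) (simplify (∂ᴸ-sign R k))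
  where
  simplify : ∀ e → 0ℤ ≡ 0ℤ + (- e) * 0ℤ
  simplify = solve-∀
∂ᴸ-alternating R zero (R ∷ w) = ∂ᴸ-0 w
∂ᴸ-alternating R (suc zero) (R ∷ w) = trans (∂ᴸ-alternating L zero w) (simplify (indicator (L ∷ []) w))
  where
  simplify : ∀ a → a + 0ℤ * a ≡ 0ℤ + 1ℤ * a
  simplify = solve-∀
∂ᴸ-alternating R (suc (suc k)) (R ∷ w) = ∂ᴸ-alternating L (suc k) w

∂ᴿ-alternating : ∀ x k w → ∂ᴿ (indicator (alternating x k)) w
    ≡ ∂ᴿ-front x k w + ∂ᴿ-sign x k * indicator (alternating x (suc k)) w
∂ᴿ-alternating R zero [] = refl
∂ᴿ-alternating R (suc k) [] = sym (trans (cong (0ℤ +_) (ℤP.*-zeroʳ (- ∂ᴿ-sign L k))) refl)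
∂ᴿ-alternating L zero [] = refl
∂ᴿ-alternating L (suc k) [] = sym (cong (0ℤ +_) (ℤP.*-zeroʳ (∂ᴿ-sign L (suc k))))
∂ᴿ-alternating R zero (R ∷ w) = trans (cong (λ z → indicator [] w - z) (∂ᴿ-0 w)) (simplify (indicator [] w))
  where
  simplify : ∀ a → a - 0ℤ ≡ a + 0ℤ * 0ℤ
  simplify = solve-∀
∂ᴿ-alternating R (suc k) (R ∷ w) = trans
    (cong (λ z → indicator (R ∷ alternating L k) w - z) (∂ᴿ-alternating L k w))
        (simplify (indicator (R ∷ alternating L k) w) (∂ᴿ-sign L k) (indicator (alternating L (suc k)) w))
  where
  simplify : ∀ a e b → a - (a + e * b) ≡ 0ℤ + (- e) * b
  simplify = solve-∀
∂ᴿ-alternating L zero (R ∷ w) = trans (cong (λ z → indicator [] w - z) (∂ᴿ-0 w)) (simplify (indicator [] w))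
  where
  simplify : ∀ a → a - 0ℤ ≡ a + 0ℤ * 0ℤ
  simplify = solve-∀
∂ᴿ-alternating L (suc k) (R ∷ w) = trans (cong (λ z → indicator (L ∷ alternating R k) w - z) (∂ᴿ-0 w))
    (simplify (indicator (L ∷ alternating R k) w) (∂ᴿ-sign L (suc k)))
  where
  simplify : ∀ a e → a - 0ℤ ≡ a + e * 0ℤ
  simplify = solve-∀
∂ᴿ-alternating R zero (L ∷ w) = ∂ᴿ-0 w
∂ᴿ-alternating R (suc k) (L ∷ w) = trans (∂ᴿ-0 w) (simplify (∂ᴿ-sign L k))
  where
  simplify : ∀ e → 0ℤ ≡ 0ℤ + (- e) * 0ℤ
  simplify = solve-∀
∂ᴿ-alternating L zero (L ∷ w) = ∂ᴿ-0 w
∂ᴿ-alternating L (suc zero) (L ∷ w) = trans (∂ᴿ-alternating R zero w) (simplify (indicator (R ∷ []) w))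
  where
  simplify : ∀ a → a + 0ℤ * a ≡ 0ℤ + 1ℤ * a
  simplify = solve-∀
∂ᴿ-alternating L (suc (suc k)) (L ∷ w) = ∂ᴿ-alternating R (suc k) w

double : ℕ → ℕ
double zero = zero
double (suc j) = suc (suc (double j))

parity : ∀ m → 1 ≤ m → Σ ℕ λ j → (m ≡ suc (double j)) ⊎ (m ≡ suc (suc (double j)))
parity (suc zero) _ = 0 , inj₁ refl
parity (suc (suc zero)) _ = 0 , inj₂ refl
parity (suc (suc (suc m))) _ with parity (suc m) (ℕ.s≤s ℕ.z≤n)
... | j , inj₁ e = suc j , inj₁ (cong (λ z → suc (suc z)) e)
... | j , inj₂ e = suc j , inj₂ (cong (λ z → suc (suc z)) e)

isOdd-double : ∀ j → isOdd (double j) ≡ false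
isOdd-double zero = refl
isOdd-double (suc j) rewrite isOdd-double j = refl

homotopySign-odd : ∀ j → homotopySign (suc (double j)) ≡ neg1^ j
homotopySign-odd zero = refl
homotopySign-odd (suc j) = trans
    (cong (λ b → if b then - homotopySign (suc (double j)) else homotopySign (suc (double j)))
        (cong not (isOdd-double j)))
  (cong -_ (homotopySign-odd j))

homotopySign-even : ∀ j → homotopySign (suc (suc (double j))) ≡ 1ℤ
homotopySign-even zero = refl
homotopySign-even (suc j) = trans
    (cong (λ b → if b then - homotopySign (suc (suc (double j))) else homotopySign (suc (suc (double j))))
  (cong (λ z → not (not z)) (isOdd-double j))) (homotopySign-even j)

∂ᴸ-sign-R-odd : ∀ j → ∂ᴸ-sign R (suc (double j)) ≡ neg1^ j
∂ᴸ-sign-R-odd zero = refl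
∂ᴸ-sign-R-odd (suc j) = cong -_ (∂ᴸ-sign-R-odd j)

∂ᴸ-sign-L-odd : ∀ j → ∂ᴸ-sign L (suc (double j)) ≡ 0ℤ
∂ᴸ-sign-R-even : ∀ j → ∂ᴸ-sign R (double j) ≡ 0ℤ
∂ᴸ-sign-L-odd j = cong -_ (∂ᴸ-sign-R-even j)
∂ᴸ-sign-R-even zero = refl
∂ᴸ-sign-R-even (suc j) = ∂ᴸ-sign-L-odd j

∂ᴿ-sign-L-odd : ∀ j → ∂ᴿ-sign L (suc (double j)) ≡ neg1^ j
∂ᴿ-sign-L-odd zero = refl
∂ᴿ-sign-L-odd (suc j) = cong -_ (∂ᴿ-sign-L-odd j)

∂ᴿ-sign-L-even : ∀ j → ∂ᴿ-sign L (double j) ≡ 0ℤ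
∂ᴿ-sign-L-even zero = refl
∂ᴿ-sign-L-even (suc j) = cong -_ (∂ᴿ-sign-L-even j)

#L-alternatingL : ∀ j → #L (alternating L (double j)) ≡ j
#L-alternatingL zero = refl
#L-alternatingL (suc j) = cong suc (#L-alternatingL j)

#L-alternatingR : ∀ j → #L (alternating R (double j)) ≡ j
#L-alternatingR zero = refl
#L-alternatingR (suc j) = cong suc (#L-alternatingR j)

#R-alternatingR : ∀ j → #R (alternating R (double j)) ≡ j
#R-alternatingR zero = refl
#R-alternatingR (suc j) = cong suc (#R-alternatingR j)

firstTag-odd : ∀ j → firstTag (suc (double j)) ≡ R
firstTag-odd zero = refl
firstTag-odd (suc j) = firstTag-odd j

firstTag-even : ∀ j → firstTag (suc (suc (double j))) ≡ L
firstTag-even zero = refl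
firstTag-even (suc j) = firstTag-even j

neg1^-double′ : ∀ j → neg1^ (double j) ≡ 1ℤ
neg1^-double′ zero = refl
neg1^-double′ (suc j) = trans (ℤP.neg-involutive _) (neg1^-double′ j)

neg1^-square-exponent : ∀ j → neg1^ (j *ℕ j) ≡ neg1^ j
neg1^-square-exponent zero = refl
neg1^-square-exponent (suc j) = trans (cong neg1^ (exponent j)) (trans (cong -_ (trans (neg1^-+ (j +ℕ j) (j *ℕ j))
    (trans (cong₂ _*_ (neg1^-double j) (neg1^-square-exponent j)) (ℤP.*-identityˡ _)))) refl)
  where
  exponent : ∀ j → suc j *ℕ suc j ≡ suc ((j +ℕ j) +ℕ j *ℕ j)
  exponent = ℕSolver.solve-∀

neg1^-suc*self : ∀ j → neg1^ (suc j *ℕ j) ≡ 1ℤ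
neg1^-suc*self j = trans (neg1^-+ j (j *ℕ j)) (trans (cong (neg1^ j *_) (neg1^-square-exponent j)) (neg1^-square j))

∂ᴸ-alternatingL-even : ∀ j w → ∂ᴸ (indicator (alternating L (double j))) w
    ≡ neg1^ j * indicator (alternating L (suc (double j))) w
∂ᴸ-alternatingL-even zero w = trans (∂ᴸ-alternating L zero w) (simplify (indicator (L ∷ []) w))
  where
  simplify : ∀ a → a + 0ℤ * a ≡ 1ℤ * a
  simplify = solve-∀
∂ᴸ-alternatingL-even (suc j) w = trans (∂ᴸ-alternating L (double (suc j)) w)
    (trans (cong (λ z → 0ℤ + z * indicator (alternating L (suc (double (suc j)))) w)
   (cong -_ (∂ᴸ-sign-R-odd j))) (ℤP.+-identityˡ _))

∂ᴿ-alternatingL-even : ∀ j w → ∂ᴿ (indicator (alternating L (double j))) w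
    ≡ indicator (alternating R (suc (double j))) w
∂ᴿ-alternatingL-even j w = trans (∂ᴿ-alternating L (double j) w)
    (trans (cong (λ z → indicator (R ∷ alternating L (double j)) w + z * indicator
        (alternating L (suc (double j))) w) (∂ᴿ-sign-L-even j))
  (simplify (indicator (R ∷ alternating L (double j)) w) (indicator (alternating L (suc (double j))) w)))
  where
  simplify : ∀ a b → a + 0ℤ * b ≡ a
  simplify = solve-∀

∂ᴸ-alternatingL-odd : ∀ j w → ∂ᴸ (indicator (alternating L (suc (double j)))) w ≡ 0ℤ
∂ᴸ-alternatingL-odd j w = trans (∂ᴸ-alternating L (suc (double j)) w)
    (trans (cong (λ z → 0ℤ + z * indicator (alternating L (suc (suc (double j)))) w) (∂ᴸ-sign-L-odd j))
  (simplify (indicator (alternating L (suc (suc (double j)))) w)))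
  where
  simplify : ∀ b → 0ℤ + 0ℤ * b ≡ 0ℤ
  simplify = solve-∀

∂ᴿ-alternatingL-odd : ∀ j w → ∂ᴿ (indicator (alternating L (suc (double j)))) w
    ≡ indicator (alternating R (suc (suc (double j)))) w + neg1^ j * indicator (alternating L (suc (suc (double j)))) w
∂ᴿ-alternatingL-odd j w = trans (∂ᴿ-alternating L (suc (double j)) w)
    (cong (λ z → indicator (R ∷ alternating L (suc (double j))) w + z * indicator
        (alternating L (suc (suc (double j)))) w) (∂ᴿ-sign-L-odd j))

alternatingDifference : ℕ → List Tag → ℤ
alternatingDifference m w =
  tagSign (firstTag m) * (indicator (alternating (firstTag m) m) w
                          - neg1^ m * neg1^ (#L w *ℕ #R w) * indicator (alternating (flipTag (firstTag m)) m) w)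

SwapCore : ℕ → List Tag → Set
SwapCore m w =
  (- homotopySign m) * (∂ᴸ (alternatingIndicator m) w + neg1^ (#L w) * ∂ᴿ (alternatingIndicator m) w)
      ≡ alternatingDifference m w

swapCore-odd : ∀ j w → SwapCore (suc (double j)) w
swapCore-odd j w =
  trans (cong₂ (λ c z → (- c) * z) (homotopySign-odd j)
      (cong₂ (λ x y → x + neg1^ (#L w) * y) (∂ᴸ-alternatingL-even j w) (∂ᴿ-alternatingL-even j w)))
  (trans (byCase (listEq w (alternating L m)) refl)
  (sym (trans (cong (λ t →
      tagSign t * (indicator (alternating t m) w - neg1^ m * neg1^ (#L w *ℕ #R w) * indicator
          (alternating (flipTag t) m) w)) (firstTag-odd j))
     (cong (λ z → tagSign R *
         (indicator (alternating R m) w - z * neg1^ (#L w *ℕ #R w) * indicator (alternating L m) w))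
             (cong -_ (neg1^-double′ j))))))
  where
  m = suc (double j)
  s = neg1^ j
  byCase : ∀ b → listEq w (alternating L m) ≡ b →
    (- s) * (s * indicator (alternating L m) w + neg1^ (#L w) * indicator (alternating R m) w) ≡
    tagSign R * (indicator (alternating R m) w - (- 1ℤ) * neg1^ (#L w *ℕ #R w) * indicator (alternating L m) w)
  byCase true e with listEq-sound w _ e
  ... | refl rewrite listEq-refl (alternating L m) | #L-alternatingR j | #R-alternatingR j | neg1^-suc*self j =
    trans (simplify s (neg1^ (suc j))) (cong -_ (neg1^-square j))
    where
    simplify : ∀ s x → (- s) * (s * 1ℤ + x * 0ℤ) ≡ - (s * s)
    simplify = solve-∀
  byCase false e with listEq w (alternating R m) in e2
  ... | true with listEq-sound w _ e2
  ... | refl rewrite listEq-refl (alternating R m) | #L-alternatingL j =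
    trans (simplify s) (trans (cong -_ (neg1^-square j)) (simplify′ (neg1^ (j *ℕ suc (#R (alternating L (double j)))))))
    where
    simplify : ∀ s → (- s) * (s * 0ℤ + s * 1ℤ) ≡ - (s * s)
    simplify = solve-∀
    simplify′ : ∀ t → - 1ℤ ≡ - 1ℤ * (1ℤ - (- 1ℤ) * t * 0ℤ)
    simplify′ = solve-∀
  byCase false e | false rewrite e = simplify s (neg1^ (#L w)) (neg1^ (#L w *ℕ #R w))
    where
    simplify : ∀ s d t → (- s) * (s * 0ℤ + d * 0ℤ) ≡ - 1ℤ * (0ℤ - (- 1ℤ) * t * 0ℤ)
    simplify = solve-∀

swapCore-even : ∀ j w → SwapCore (suc (suc (double j))) w
swapCore-even j w =
  trans (cong₂ (λ c z → (- c) * z) (homotopySign-even j)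
      (cong₂ (λ x y → x + neg1^ (#L w) * y) (∂ᴸ-alternatingL-odd j w) (∂ᴿ-alternatingL-odd j w)))
  (trans (byCase (listEq w (alternating L m)) refl)
  (sym (trans (cong (λ t →
      tagSign t * (indicator (alternating t m) w - neg1^ m * neg1^ (#L w *ℕ #R w) * indicator
          (alternating (flipTag t) m) w)) (firstTag-even j))
     (cong (λ z → tagSign L *
         (indicator (alternating L m) w - z * neg1^ (#L w *ℕ #R w) * indicator (alternating R m) w))
        (trans (ℤP.neg-involutive _) (neg1^-double′ j))))))
  where
  m = suc (suc (double j))
  s = neg1^ j
  byCase : ∀ b → listEq w (alternating L m) ≡ b →
    (- 1ℤ) * (0ℤ + neg1^ (#L w) * (indicator (alternating R m) w + s * indicator (alternating L m) w)) ≡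
    tagSign L * (indicator (alternating L m) w - 1ℤ * neg1^ (#L w *ℕ #R w) * indicator (alternating R m) w)
  byCase true e with listEq-sound w _ e
  ... | refl rewrite listEq-refl (alternating L m) | #L-alternatingL j =
    trans (simplify s) (trans (neg1^-square j) (simplify′ (neg1^ (suc j *ℕ suc (#R (alternating L (double j)))))))
    where
    simplify : ∀ s → (- 1ℤ) * (0ℤ + (- s) * (0ℤ + s * 1ℤ)) ≡ s * s
    simplify = solve-∀
    simplify′ : ∀ t → 1ℤ ≡ 1ℤ * (1ℤ - 1ℤ * t * 0ℤ)
    simplify′ = solve-∀
  byCase false e with listEq w (alternating R m) in e2
  ... | true with listEq-sound w _ e2
  ... | refl rewrite listEq-refl
      (alternating R m) | #L-alternatingR j | #R-alternatingR j | neg1^-square-exponent (suc j) = simplify s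
    where
    simplify : ∀ s → (- 1ℤ) * (0ℤ + (- s) * (1ℤ + s * 0ℤ)) ≡ 1ℤ * (0ℤ - 1ℤ * (- s) * 1ℤ)
    simplify = solve-∀
  byCase false e | false rewrite e = simplify s (neg1^ (#L w)) (neg1^ (#L w *ℕ #R w))
    where
    simplify : ∀ s d t → (- 1ℤ) * (0ℤ + d * (0ℤ + s * 0ℤ)) ≡ 1ℤ * (0ℤ - 1ℤ * t * 0ℤ)
    simplify = solve-∀

swapCore : ∀ m w → 1 ≤ m → SwapCore m w
swapCore m w le with parity m le
... | j , inj₁ refl = swapCore-odd j w
... | j , inj₂ refl = swapCore-even j w

-- The swap homotopy bounds the change of the obstruction cocycle

obsDifference : ∀ {n} → Fin n → ℕ → Cochain (suc n)
obsDifference a m S T = obs m S T - twistSign a S * twistSign a T * obs m (swapAt a S) (swapAt a T)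

obsDifference-equivariant : ∀ {n} (a : Fin n) m S T → obsDifference a m S T
    ≡ neg1^ m * (τsign S T * obsDifference a m T S)
obsDifference-equivariant a m S T =
  trans (cong₂ (λ x y → x - twistSign a S * twistSign a T * y) (obs-equivariant m S T)
          (trans (obs-equivariant m (swapAt a S) (swapAt a T))
                 (cong (λ z → neg1^ m * (z * obs m (swapAt a T) (swapAt a S))) (τsign-swapAt a S T))))
        (factor (neg1^ m) (τsign S T) (obs m T S) (twistSign a S) (twistSign a T) (obs m (swapAt a T) (swapAt a S)))
  where
  factor : ∀ e t x p q y → e * (t * x) - p * q * (e * (t * y)) ≡ e * (t * (x - q * p * y))
  factor = solve-∀

base-adjacent : ∀ {n} m (X Y : Subset n) x pr po → word X Y ≡ pr ++ x ∷ flipTag x ∷ po → length pr +ℕ length po ≡ m →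
  base m X Y ≡ toℤ (tagEq (flipTag^ (length pr) (firstTag m)) x ∧ listEq (pr ++ po) (alternating (firstTag m) m))
base-adjacent m X Y x pr po w≡ len = begin
  base m X Y                                                  ≡⟨ cong (indicator (pattern′ m)) w≡ ⟩
  indicator (pattern′ m) (pr ++ x ∷ flipTag x ∷ po)           ≡⟨ if-toℤ _ ⟩
  toℤ (listEq (pr ++ x ∷ flipTag x ∷ po) (pattern′ m))
      ≡⟨ cong (λ p → toℤ (listEq (pr ++ x ∷ flipTag x ∷ po) p)) pattern≡ ⟩
  toℤ (listEq (pr ++ x ∷ flipTag x ∷ po) (alternating s (length pr +ℕ suc (suc (length po)))))
                                                              ≡⟨ cong toℤ (listEq-split pr po s x (length po)) ⟩
  toℤ (tagEq (flipTag^ (length pr) s) x ∧ listEq (pr ++ po) (alternating s (length pr +ℕ length po)))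
                                                              ≡⟨ cong (λ k → toℤ (tagEq
                                                                  (flipTag^ (length pr) s) x ∧ listEq
                                                                      (pr ++ po) (alternating s k))) len ⟩
  toℤ (tagEq (flipTag^ (length pr) s) x ∧ listEq (pr ++ po) (alternating s m)) ∎
  where
  open ≡-Reasoning
  s = firstTag m
  pattern≡ : pattern′ m ≡ alternating s (length pr +ℕ suc (suc (length po)))
  pattern≡ = trans (pattern′≡alternating m) (cong (alternating s) (trans (cong (λ z → suc (suc z)) (sym len))
    (sym (trans (ℕP.+-suc (length pr) (suc (length po))) (cong suc (ℕP.+-suc (length pr) (length po)))))))

base-adjacent-flipped : ∀ {n} m (X Y : Subset n) x pr po → word X Y ≡ flipTags (pr ++ x ∷ flipTag x ∷ po) →
  length pr +ℕ length po ≡ m →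
  base m X Y ≡ toℤ (tagEq (flipTag^ (length pr) (firstTag m)) (flipTag x) ∧ listEq (pr ++ po)
      (alternating (flipTag (firstTag m)) m))
base-adjacent-flipped m X Y x pr po w≡ len =
  trans (base-adjacent m X Y (flipTag x) (flipTags pr) (flipTags po) w≡′ len′)
    (cong₂ (λ u v → toℤ (tagEq u (flipTag x) ∧ v)) (cong (λ k → flipTag^ k (firstTag m)) (length-flipTags pr))
      (trans (cong (λ v → listEq v (alternating (firstTag m) m)) (sym (flipTags-++ pr po)))
          (listEq-flipTags (pr ++ po) (firstTag m) m)))
  where
  w≡′ : word X Y ≡ flipTags pr ++ flipTag x ∷ flipTag (flipTag x) ∷ flipTags po
  w≡′ = trans w≡ (flipTags-++ pr (x ∷ flipTag x ∷ po))
  len′ : length (flipTags pr) +ℕ length (flipTags po) ≡ m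
  len′ = trans (cong₂ _+ℕ_ (length-flipTags pr) (length-flipTags po)) len

length-unmarkedWord : ∀ {n} (a : Fin n) m S T → pairAt a S ≡ TF → pairAt a T ≡ FT → ∣ S ∣ +ℕ ∣ T ∣ ≡ suc (suc m) →
  length (wordBefore a S T) +ℕ length (wordAfter a S T) ≡ m
length-unmarkedWord a m S T hS hT c = ℕP.suc-injective (ℕP.suc-injective (begin
  suc (suc (length pr +ℕ length po))  ≡⟨ cong suc (sym (ℕP.+-suc (length pr) (length po))) ⟩
  suc (length pr +ℕ suc (length po))  ≡⟨ sym (ℕP.+-suc (length pr) (suc (length po))) ⟩
  length pr +ℕ length (L ∷ R ∷ po)    ≡⟨ sym (LP.length-++ pr) ⟩
  length (pr ++ L ∷ R ∷ po)           ≡⟨ cong length (sym (word-split a S T hS hT)) ⟩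
  length (word S T)                   ≡⟨ len-word S T ⟩
  ∣ S ∣ +ℕ ∣ T ∣                      ≡⟨ c ⟩
  suc (suc m)                         ∎))
  where
  open ≡-Reasoning
  pr = wordBefore a S T
  po = wordAfter a S T

card-TF-FTˡ : ∀ {n} (a : Fin n) S T → pairAt a S ≡ TF → pairAt a T ≡ FT → ∣ S ∣ ≡ suc (#L (unmarkedWord a S T))
card-TF-FTˡ a S T hS hT = trans (card-#L S T) (trans (cong #L (word-split a S T hS hT))
  (trans (#L-++ pr (L ∷ R ∷ po)) (trans (ℕP.+-suc (#L pr) (#L po)) (cong suc (sym (#L-++ pr po))))))
  where
  pr = wordBefore a S T
  po = wordAfter a S T

card-TF-FTʳ : ∀ {n} (a : Fin n) S T → pairAt a S ≡ TF → pairAt a T ≡ FT → ∣ T ∣ ≡ suc (#R (unmarkedWord a S T))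
card-TF-FTʳ a S T hS hT = trans (card-#R S T) (trans (cong #R (word-split a S T hS hT))
  (trans (#R-++ pr (L ∷ R ∷ po)) (trans (ℕP.+-suc (#R pr) (#R po)) (cong suc (sym (#R-++ pr po))))))
  where
  pr = wordBefore a S T
  po = wordAfter a S T

obsDifference-TF-FT : ∀ {n} (a : Fin n) m S T → pairAt a S ≡ TF → pairAt a T ≡ FT → (∀ x → x ∈ S → x ∉ T) →
  ∣ S ∣ +ℕ ∣ T ∣ ≡ suc (suc m) →
  obsDifference a m S T ≡ neg1^ (length (wordBefore a S T)) * alternatingDifference m (unmarkedWord a S T)
obsDifference-TF-FT a m S T hS hT dj c = begin
  (base m S T + ε * (τsign S T * base m T S))
    - twistSign a S * twistSign a T *
        (base m (swapAt a S) (swapAt a T) + ε * (τsign (swapAt a S) (swapAt a T) * base m (swapAt a T) (swapAt a S)))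
      ≡⟨ cong₂ _-_ (cong₂ (λ u v → u + ε * v) b₁ (cong₂ _*_ τ≡ b₂))
                   (cong₂ _*_ (cong₂ _*_ (twistSign-TF a S hS) (twistSign-FT a T hT))
                       (cong₂ (λ u v → u + ε * v) b₃ (cong₂ _*_ τ≡′ b₄))) ⟩
  (toℤ (tagEq y L ∧ A) + ε * (τ * toℤ (tagEq y R ∧ B))) - 1ℤ * 1ℤ *
      (toℤ (tagEq y R ∧ A) + ε * (τ * toℤ (tagEq y L ∧ B)))
      ≡⟨ regroup (toℤ (tagEq y L ∧ A)) (toℤ (tagEq y R ∧ A)) (toℤ (tagEq y L ∧ B)) (toℤ (tagEq y R ∧ B)) ε τ ⟩
  (toℤ (tagEq y L ∧ A) - toℤ (tagEq y R ∧ A)) - ε * τ * (toℤ (tagEq y L ∧ B) - toℤ (tagEq y R ∧ B))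
      ≡⟨ cong₂ (λ p q → p - ε * τ * q) (tagSign-∧ y A) (tagSign-∧ y B) ⟩
  tagSign y * toℤ A - ε * τ * (tagSign y * toℤ B)
      ≡⟨ cong (λ z → z * toℤ A - ε * τ * (z * toℤ B)) (tagSign-flipTag^ (length pr) s) ⟩
  neg1^ (length pr) * tagSign s * toℤ A - ε * τ * (neg1^ (length pr) * tagSign s * toℤ B)
      ≡⟨ factor (neg1^ (length pr)) (tagSign s) (toℤ A) (toℤ B) ε τ ⟩
  neg1^ (length pr) * (tagSign s * (toℤ A - ε * τ * toℤ B))
      ≡⟨ cong₂ (λ p q → neg1^ (length pr) * (tagSign s * (p - ε * τ * q))) (sym (if-toℤ A)) (sym (if-toℤ B)) ⟩
  neg1^ (length pr) * alternatingDifference m w ∎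
  where
  open ≡-Reasoning
  pr = wordBefore a S T
  po = wordAfter a S T
  w = pr ++ po
  s = firstTag m
  y = flipTag^ (length pr) s
  A = listEq w (alternating s m)
  B = listEq w (alternating (flipTag s) m)
  ε = neg1^ m
  τ = neg1^ (#L w *ℕ #R w)
  len = length-unmarkedWord a m S T hS hT c
  b₁ : base m S T ≡ toℤ (tagEq y L ∧ A)
  b₁ = base-adjacent m S T L pr po (word-split a S T hS hT) len
  b₂ : base m T S ≡ toℤ (tagEq y R ∧ B)
  b₂ = base-adjacent-flipped m T S L pr po (trans (word-flip S T dj) (cong flipTags (word-split a S T hS hT))) len
  b₃ : base m (swapAt a S) (swapAt a T) ≡ toℤ (tagEq y R ∧ A)
  b₃ = base-adjacent m (swapAt a S) (swapAt a T) R pr po (word-split-swapAt a S T hS hT) len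
  b₄ : base m (swapAt a T) (swapAt a S) ≡ toℤ (tagEq y L ∧ B)
  b₄ = base-adjacent-flipped m (swapAt a T) (swapAt a S) R pr po
         (trans (word-flip (swapAt a S) (swapAt a T) (disjoint-swapAt a S T dj))
             (cong flipTags (word-split-swapAt a S T hS hT))) len
  τ≡ : τsign S T ≡ τ
  τ≡ = cong₂ (λ x z → neg1^ ((x ∸ 1) *ℕ (z ∸ 1))) (card-TF-FTˡ a S T hS hT) (card-TF-FTʳ a S T hS hT)
  τ≡′ : τsign (swapAt a S) (swapAt a T) ≡ τ
  τ≡′ = trans (τsign-swapAt a S T) τ≡
  regroup : ∀ p q r t e τ → (p + e * (τ * t)) - 1ℤ * 1ℤ * (q + e * (τ * r)) ≡ (p - q) - e * τ * (r - t)
  regroup = solve-∀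
  factor : ∀ n c x z e τ → n * c * x - e * τ * (n * c * z) ≡ n * (c * (x - e * τ * z))
  factor = solve-∀

δ′-swapHomotopy≡obsDifference-TF-FT : ∀ {n} (a : Fin n) m S T → 1 ≤ m → pairAt a S ≡ TF → pairAt a T ≡ FT →
  (∀ x → x ∈ S → x ∉ T) → ∣ S ∣ +ℕ ∣ T ∣ ≡ suc (suc m) → δ′ (swapHomotopy a m) S T ≡ obsDifference a m S T
δ′-swapHomotopy≡obsDifference-TF-FT a m S T 1≤m hS hT dj c = begin
  δ′ (swapHomotopy a m) S T
    ≡⟨ δ′-swapHomotopy-TF-FT a m S T hS hT ⟩
  h * (- (s * ∂ᴸ I w)) + dimSign S * (h * (- (s * ∂ᴿ I w)))
    ≡⟨ cong (λ z → h * (- (s * ∂ᴸ I w)) + neg1^ (z ∸ 1) * (h * (- (s * ∂ᴿ I w)))) (card-TF-FTˡ a S T hS hT) ⟩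
  h * (- (s * ∂ᴸ I w)) + neg1^ (#L w) * (h * (- (s * ∂ᴿ I w)))
    ≡⟨ factor h s (∂ᴸ I w) (∂ᴿ I w) (neg1^ (#L w)) ⟩
  s * ((- h) * (∂ᴸ I w + neg1^ (#L w) * ∂ᴿ I w))
    ≡⟨ cong (s *_) (swapCore m w 1≤m) ⟩
  s * alternatingDifference m w
    ≡⟨ sym (obsDifference-TF-FT a m S T hS hT dj c) ⟩
  obsDifference a m S T ∎
  where
  open ≡-Reasoning
  w = unmarkedWord a S T
  s = neg1^ (length (wordBefore a S T))
  h = homotopySign m
  I = alternatingIndicator m
  factor : ∀ c n x y d → c * (- (n * x)) + d * (c * (- (n * y))) ≡ n * ((- c) * (x + d * y))
  factor = solve-∀

word-swapAt-¬TT : ∀ {n} (a : Fin n) S T → pairAt a T ≡ FF → pairAt a S ≢ TT →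
  word (swapAt a S) (swapAt a T) ≡ word S T × word (swapAt a T) (swapAt a S) ≡ word T S
word-swapAt-¬TT zero (true ∷ true ∷ S) (false ∷ false ∷ T) refl ne = ⊥-elim (ne refl)
word-swapAt-¬TT zero (true ∷ false ∷ S) (false ∷ false ∷ T) refl ne = refl , refl
word-swapAt-¬TT zero (false ∷ true ∷ S) (false ∷ false ∷ T) refl ne = refl , refl
word-swapAt-¬TT zero (false ∷ false ∷ S) (false ∷ false ∷ T) refl ne = refl , refl
word-swapAt-¬TT (suc a) (x ∷ S) (y ∷ T) hT ne with word-swapAt-¬TT a S T hT ne
... | e1 , e2 = cong (λ z → (if x then L ∷ [] else []) ++ ((if y then R ∷ [] else []) ++ z)) e1 ,
                cong (λ z → (if y then L ∷ [] else []) ++ ((if x then R ∷ [] else []) ++ z)) e2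

obs-swapAt-¬TT : ∀ {n} (a : Fin n) m S T → pairAt a T ≡ FF → pairAt a S ≢ TT →
  obs m (swapAt a S) (swapAt a T) ≡ obs m S T
obs-swapAt-¬TT a m S T hT ne = cong₂ (λ p q → p + neg1^ m * q)
  (cong (indicator (pattern′ m)) (proj₁ (word-swapAt-¬TT a S T hT ne)))
  (cong₂ _*_ (τsign-swapAt a S T) (cong (indicator (pattern′ m)) (proj₂ (word-swapAt-¬TT a S T hT ne))))

obsDifference-¬TT-FF : ∀ {n} (a : Fin n) m S T → pairAt a T ≡ FF → pairAt a S ≢ TT → obsDifference a m S T ≡ 0ℤ
obsDifference-¬TT-FF a m S T hT ne = trans (cong (λ z → obs m S T - z) (begin
  twistSign a S * twistSign a T * obs m (swapAt a S) (swapAt a T)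
    ≡⟨ cong₂ (λ u v → u * v * obs m (swapAt a S) (swapAt a T)) (twistSign-¬TT a S ne) (twistSign-FF a T hT) ⟩
  1ℤ * 1ℤ * obs m (swapAt a S) (swapAt a T)   ≡⟨ ℤP.*-identityˡ _ ⟩
  obs m (swapAt a S) (swapAt a T)             ≡⟨ obs-swapAt-¬TT a m S T hT ne ⟩
  obs m S T                                   ∎))
  (ℤP.+-inverseʳ (obs m S T))
  where open ≡-Reasoning

obsDifference-TT-FF : ∀ {n} (a : Fin n) m S T → pairAt a S ≡ TT → pairAt a T ≡ FF → obsDifference a m S T ≡ 0ℤ
obsDifference-TT-FF a m S T hS hT =
  trans (cong₂ (λ p q → p - twistSign a S * twistSign a T * q) (obs-TT-FF a m S T hS hT)
          (obs-TT-FF a m (swapAt a S) (swapAt a T) (trans (pairAt-swapAt a S) (cong (λ p → proj₂ p , proj₁ p) hS))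
                                                    (trans (pairAt-swapAt a T) (cong (λ p → proj₂ p , proj₁ p) hT))))
        (vanish (twistSign a S * twistSign a T))
  where
  vanish : ∀ x → 0ℤ - x * 0ℤ ≡ 0ℤ
  vanish = solve-∀

obsDifference-FFʳ : ∀ {n} (a : Fin n) m S T → pairAt a T ≡ FF → obsDifference a m S T ≡ 0ℤ
obsDifference-FFʳ a m S T hT with pairAt a S in eS
... | TT = obsDifference-TT-FF a m S T eS hT
... | TF = obsDifference-¬TT-FF a m S T hT (λ e → case (trans (sym eS) e) of λ ())
... | false , q = obsDifference-¬TT-FF a m S T hT (λ e → case (trans (sym eS) e) of λ ())

obsDifference-FFˡ : ∀ {n} (a : Fin n) m S T → pairAt a S ≡ FF → obsDifference a m S T ≡ 0ℤ
obsDifference-FFˡ a m S T hS =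
  trans (obsDifference-equivariant a m S T)
    (sym (zero-equivariant (neg1^ m) (τsign S T) refl (obsDifference-FFʳ a m T S hS)))

δ′-swapHomotopy-FFˡ : ∀ {n} (a : Fin n) m S T → pairAt a S ≡ FF → δ′ (swapHomotopy a m) S T ≡ 0ℤ
δ′-swapHomotopy-FFˡ a m S T hS = δ′-zero (swapHomotopy a m) S T
  (∂-vanishingOnFaces S (λ i _ → swapHomotopy-FFˡ a m (remove S i) T (pairAt-FF-⊑ a (remove-⊑ S i) hS)))
  (∂-vanishing _ T (λ Y → swapHomotopy-FFˡ a m S Y hS))

δ′-swapHomotopy-FFʳ : ∀ {n} (a : Fin n) m S T → pairAt a T ≡ FF → δ′ (swapHomotopy a m) S T ≡ 0ℤ
δ′-swapHomotopy-FFʳ a m S T hT = δ′-zero (swapHomotopy a m) S T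
  (∂-vanishing _ S (λ X → swapHomotopy-FFʳ a m X T hT))
  (∂-vanishingOnFaces T (λ i _ → swapHomotopy-FFʳ a m S (remove T i) (pairAt-FF-⊑ a (remove-⊑ T i) hT)))

δ′-swapHomotopy≡obsDifference : ∀ {n} (a : Fin n) m S T → 1 ≤ m → (∀ x → x ∈ S → x ∉ T) →
  ∣ S ∣ +ℕ ∣ T ∣ ≡ suc (suc m) → δ′ (swapHomotopy a m) S T ≡ obsDifference a m S T
δ′-swapHomotopy≡obsDifference a m S T 1≤m dj c = byPairs (pairAt a S) (pairAt a T) refl refl
  where
  byPairs : ∀ p q → pairAt a S ≡ p → pairAt a T ≡ q → δ′ (swapHomotopy a m) S T ≡ obsDifference a m S T
  byPairs FF _ eS eT = trans (δ′-swapHomotopy-FFˡ a m S T eS) (sym (obsDifference-FFˡ a m S T eS))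
  byPairs TT FF eS eT = trans (δ′-swapHomotopy-FFʳ a m S T eT) (sym (obsDifference-FFʳ a m S T eT))
  byPairs TF FF eS eT = trans (δ′-swapHomotopy-FFʳ a m S T eT) (sym (obsDifference-FFʳ a m S T eT))
  byPairs FT FF eS eT = trans (δ′-swapHomotopy-FFʳ a m S T eT) (sym (obsDifference-FFʳ a m S T eT))
  byPairs TF FT eS eT = δ′-swapHomotopy≡obsDifference-TF-FT a m S T 1≤m eS eT dj c
  byPairs FT TF eS eT = begin
    δ′ (swapHomotopy a m) S T
      ≡⟨ δ′-equivariant (neg1^ m) (swapHomotopy a m) S T (neg1^-square m) (swapHomotopy-vanishes a m)
           (λ i _ → swapHomotopy-equivariant a m T (remove S i)) (λ i _ → swapHomotopy-equivariant a m (remove T i) S) ⟩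
    neg1^ m * (τsign S T * δ′ (swapHomotopy a m) T S)
      ≡⟨ cong (λ z → neg1^ m * (τsign S T * z))
           (δ′-swapHomotopy≡obsDifference-TF-FT a m T S 1≤m eT eS (λ x m₁ m₂ → dj x m₂ m₁)
               (trans (ℕP.+-comm ∣ T ∣ ∣ S ∣) c)) ⟩
    neg1^ m * (τsign S T * obsDifference a m T S)
      ≡⟨ sym (obsDifference-equivariant a m S T) ⟩
    obsDifference a m S T ∎
    where open ≡-Reasoning
  byPairs (true , _) (true , _) eS eT = ⊥-elim
      (dj (inject₁ a) (pairAt₁⇒∈ a S (cong proj₁ eS)) (pairAt₁⇒∈ a T (cong proj₁ eT)))
  byPairs (_ , true) (_ , true) eS eT = ⊥-elim
      (dj (suc a) (pairAt₂⇒∈ a S (cong proj₂ eS)) (pairAt₂⇒∈ a T (cong proj₂ eT)))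

twisted : ∀ {n} → Fin n → Cochain (suc n) → Cochain (suc n)
twisted a e X Y = twistSign a X * twistSign a Y * e (swapAt a X) (swapAt a Y)

twisted-vanishes : ∀ {n} (a : Fin n) e → VanishesOnEmpty e → VanishesOnEmpty (twisted a e)
twisted-vanishes a e (m1 , m2) =
  (λ X Y h → trans (cong (twistSign a X * twistSign a Y *_) (m1 _ _ (trans (nonemptyᵇ-swapAt a X) h)))
      (ℤP.*-zeroʳ (twistSign a X * twistSign a Y))) ,
  (λ X Y h → trans (cong (twistSign a X * twistSign a Y *_) (m2 _ _ (trans (nonemptyᵇ-swapAt a Y) h)))
      (ℤP.*-zeroʳ (twistSign a X * twistSign a Y)))

twisted-equivariant : ∀ {n} (a : Fin n) {m} (K : SC (suc n)) e → Equivariant m K (m ∸ 1) e →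
  Equivariant m (λ X → K (swapAt a X)) (m ∸ 1) (twisted a e)
twisted-equivariant a {m} K e eq S T c = begin
  twistSign a S * twistSign a T * e (swapAt a S) (swapAt a T)
    ≡⟨ cong (twistSign a S * twistSign a T *_) (eq (swapAt a S) (swapAt a T) (Cell-swapAt a K (m ∸ 1) S T c)) ⟩
  twistSign a S * twistSign a T * (neg1^ m * (τsign (swapAt a S) (swapAt a T) * e (swapAt a T) (swapAt a S)))
    ≡⟨ cong (λ z → twistSign a S * twistSign a T * (neg1^ m * (z * e (swapAt a T) (swapAt a S)))) (τsign-swapAt a S T) ⟩
  twistSign a S * twistSign a T * (neg1^ m * (τsign S T * e (swapAt a T) (swapAt a S)))
    ≡⟨ commute (twistSign a S) (twistSign a T) (neg1^ m) (τsign S T) (e (swapAt a T) (swapAt a S)) ⟩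
  neg1^ m * (τsign S T * twisted a e T S) ∎
  where
  open ≡-Reasoning
  commute : ∀ p q e t x → p * q * (e * (t * x)) ≡ e * (t * (q * p * x))
  commute = solve-∀

primitive-swapAt : ∀ {n} (a : Fin n) {m} (K : SC (suc n)) → 1 ≤ m → HasPrimitive m K →
    HasPrimitive m (λ X → K (swapAt a X))
primitive-swapAt {n} a {m} K 1≤m (e , me , eqe , cobe) = e′ , vanishes-+ _ _ (twisted-vanishes a e me)
    (swapHomotopy-vanishes a m) , eq′ , cob′
  where
  e′ : Cochain (suc n)
  e′ X Y = twisted a e X Y + swapHomotopy a m X Y
  eq′ : Equivariant m (λ X → K (swapAt a X)) (m ∸ 1) e′
  eq′ S T c = trans (cong₂ _+_ (twisted-equivariant a {m} K e eqe S T c) (swapHomotopy-equivariant a m S T))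
                    (distrib (neg1^ m) (τsign S T) (twisted a e T S) (swapHomotopy a m T S))
    where
    distrib : ∀ e t x y → e * (t * x) + e * (t * y) ≡ e * (t * (x + y))
    distrib = solve-∀
  cob′ : Cobounds m (λ X → K (swapAt a X)) e′
  cob′ S T c@(_ , _ , dj , size) = begin
    δ′ e′ S T                                                       ≡⟨ δ′-+ (twisted a e) (swapHomotopy a m) S T ⟩
    δ′ (twisted a e) S T + δ′ (swapHomotopy a m) S T
        ≡⟨ cong₂ _+_ (δ′-twist a e S T) (δ′-swapHomotopy≡obsDifference a m S T 1≤m dj size) ⟩
    t * δ′ e (swapAt a S) (swapAt a T) + obsDifference a m S T
        ≡⟨ cong (λ z → t * z + obsDifference a m S T) (cobe _ _ (Cell-swapAt a K m S T c)) ⟩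
    t * obs m (swapAt a S) (swapAt a T) + obsDifference a m S T
        ≡⟨ cancel (obs m S T) t (obs m (swapAt a S) (swapAt a T)) ⟩
    obs m S T                                                       ∎
    where
    open ≡-Reasoning
    t = twistSign a S * twistSign a T
    cancel : ∀ o p q → p * q + (o - p * q) ≡ o
    cancel = solve-∀

swapFin-injective : ∀ {n} (a : Fin n) {i j} → swapFin a i ≡ swapFin a j → i ≡ j
swapFin-injective a {i} {j} e = trans (sym (swapFin-involutive a i))
    (trans (cong (swapFin a) e) (swapFin-involutive a j))

∈-swapAt⁺′ : ∀ {n} (a : Fin n) X i → i ∈ X → swapFin a i ∈ swapAt a X
∈-swapAt⁺′ a X i m = ∈-swapAt⁺ a X (swapFin a i) (subst (_∈ X) (sym (swapFin-involutive a i)) m)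

⊆-swapAt : ∀ {n} (a : Fin n) {X Y} → X ⊆ Y → swapAt a X ⊆ swapAt a Y
⊆-swapAt a {X} {Y} X⊆Y {i} m = ∈-swapAt⁺ a Y i (X⊆Y (∈-swapAt⁻ a X i m))

⊂-swapAt : ∀ {n} (a : Fin n) {S T} → S ⊂ swapAt a T → swapAt a S ⊂ T
⊂-swapAt a {S} {T} (S⊆ , x , xT , x∉S) =
  (λ {i} m → subst (_∈ T) (swapFin-involutive a i) (∈-swapAt⁻ a T (swapFin a i) (S⊆ (∈-swapAt⁻ a S i m)))) ,
  swapFin a x , ∈-swapAt⁻ a T x xT , (λ m → x∉S (subst (_∈ S) (swapFin-involutive a x) (∈-swapAt⁻ a S (swapFin a x) m)))

Nonempty-swapAt : ∀ {n} (a : Fin n) X → Nonempty X → Nonempty (swapAt a X)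
Nonempty-swapAt a X (i , m) = swapFin a i , ∈-swapAt⁺′ a X i m

swapAt-contractSet : ∀ {n} (a : Fin n) A x y → swapAt a ((A ∖ₛ x) ∪ ⁅ y ⁆)
    ≡ (swapAt a A ∖ₛ swapFin a x) ∪ ⁅ swapFin a y ⁆
swapAt-contractSet a A x y = SP.⊆-antisym into back
  where
  f = swapFin a
  into : swapAt a ((A ∖ₛ x) ∪ ⁅ y ⁆) ⊆ (swapAt a A ∖ₛ f x) ∪ ⁅ f y ⁆
  into {i} m with ∈-contractSet⁻ A x y (∈-swapAt⁻ a _ i m)
  ... | inj₁ (m′ , ne) = ∈-contractSet⁺ (swapAt a A) (f x) (f y)
          (inj₁ (∈-swapAt⁺ a A i m′ , λ e → ne (trans (cong f e) (swapFin-involutive a x))))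
  ... | inj₂ e = ∈-contractSet⁺ (swapAt a A) (f x) (f y) (inj₂ (trans (sym (swapFin-involutive a i)) (cong f e)))
  back : (swapAt a A ∖ₛ f x) ∪ ⁅ f y ⁆ ⊆ swapAt a ((A ∖ₛ x) ∪ ⁅ y ⁆)
  back {i} m with ∈-contractSet⁻ (swapAt a A) (f x) (f y) m
  ... | inj₁ (m′ , ne) = ∈-swapAt⁺ a _ i (∈-contractSet⁺ A x y
          (inj₁ (∈-swapAt⁻ a A i m′ , λ e → ne (trans (sym (swapFin-involutive a i)) (cong f e)))))
  ... | inj₂ refl = ∈-swapAt⁺ a _ i (∈-contractSet⁺ A x y (inj₂ (swapFin-involutive a y)))

swapAt-⁅⁆ : ∀ {n} (a : Fin n) x → swapAt a ⁅ swapFin a x ⁆ ≡ ⁅ x ⁆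
swapAt-⁅⁆ a x = SP.⊆-antisym into back
  where
  into : swapAt a ⁅ swapFin a x ⁆ ⊆ ⁅ x ⁆
  into {i} m = subst (_∈ ⁅ x ⁆) (sym (swapFin-injective a (SP.x∈⁅y⁆⇒x≡y (swapFin a x) (∈-swapAt⁻ a _ i m))))
      (SP.x∈⁅x⁆ x)
  back : ⁅ x ⁆ ⊆ swapAt a ⁅ swapFin a x ⁆
  back {i} m = subst (_∈ swapAt a ⁅ swapFin a x ⁆) (sym (SP.x∈⁅y⁆⇒x≡y x m)) (∈-swapAt⁺ a _ x (SP.x∈⁅x⁆ (swapFin a x)))

IsComplex-swapAt : ∀ {n} (a : Fin n) {K : SC (suc n)} → IsComplex K → IsComplex (λ X → K (swapAt a X))
IsComplex-swapAt a {K} (ne , closed) =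
  (λ S KS → nonempty S (ne (swapAt a S) KS)) ,
  (λ S T KS T⊆S neT → closed (swapAt a S) (swapAt a T) KS (⊆-swapAt a T⊆S) (Nonempty-swapAt a T neT))
  where
  nonempty : ∀ S → Nonempty (swapAt a S) → Nonempty S
  nonempty S (i , m) = swapFin a i , ∈-swapAt⁻ a S i m

Admissible-swapAt : ∀ {n} (a : Fin n) {K : SC (suc n)} {u v} → Admissible K u v →
  Admissible (λ X → K (swapAt a X)) (swapFin a u) (swapFin a v)
Admissible-swapAt a {K} {u} {v} (u≢v , Ku , Kv , noMissing) =
  (λ e → u≢v (swapFin-injective a e)) , subst K (sym (swapAt-⁅⁆ a u)) Ku , subst K (sym (swapAt-⁅⁆ a v)) Kv , noMissing′
  where
  noMissing′ : ¬ (Σ (Subset _) λ T → MissingFace (λ X → K (swapAt a X)) T × swapFin a u ∈ T × swapFin a v ∈ T ×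
                   Σ (Subset _) λ F → K (swapAt a F) × ∣ T ∣ ≤ ∣ F ∣)
  noMissing′ (T , (¬KT , below) , uT , vT , F , KF , le) =
    noMissing (swapAt a T , (¬KT , below′) , ∈-swapAt⁺ a T u uT , ∈-swapAt⁺ a T v vT , swapAt a F , KF ,
               subst₂ _≤_ (sym (card-swapAt a T)) (sym (card-swapAt a F)) le)
    where
    below′ : ∀ S → S ⊂ swapAt a T → Nonempty S → K S
    below′ S S⊂ neS = subst K (swapAt-involutive a S) (below (swapAt a S) (⊂-swapAt a S⊂) (Nonempty-swapAt a S neS))

Contract-swapAt : ∀ {n} (a : Fin n) {K : SC (suc n)} {u v} X →
  Contract u v K (swapAt a X) → Contract (swapFin a u) (swapFin a v) (λ Y → K (swapAt a Y)) X
Contract-swapAt a {u = u} X (inj₁ (u∉X , KX)) = inj₁ ((λ m → u∉X (∈-swapAt⁺ a X u m)) , KX)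
Contract-swapAt a {K} {u} {v} X (inj₂ (A , u∈A , KA , eq)) =
  inj₂ (swapAt a A , ∈-swapAt⁺′ a A u u∈A , subst K (sym (swapAt-involutive a A)) KA ,
        trans (sym (swapAt-involutive a X)) (trans (cong (swapAt a) eq) (swapAt-contractSet a A u v)))

swapFin-inject₁ : ∀ {n} (a : Fin n) → swapFin a (inject₁ a) ≡ suc a
swapFin-inject₁ zero = refl
swapFin-inject₁ (suc a) = cong suc (swapFin-inject₁ a)

swapFin-suc : ∀ {n} (a : Fin n) → swapFin a (suc a) ≡ inject₁ a
swapFin-suc zero = refl
swapFin-suc (suc a) = cong suc (swapFin-suc a)

swapFin-other : ∀ {n} (a : Fin n) i → i ≢ inject₁ a → i ≢ suc a → swapFin a i ≡ i
swapFin-other zero zero h1 h2 = ⊥-elim (h1 refl)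
swapFin-other zero (suc zero) h1 h2 = ⊥-elim (h2 refl)
swapFin-other zero (suc (suc i)) h1 h2 = refl
swapFin-other (suc a) zero h1 h2 = refl
swapFin-other (suc a) (suc i) h1 h2 = cong suc (swapFin-other a i (λ e → h1 (cong suc e)) (λ e → h2 (cong suc e)))

swapFin-far : ∀ {n} (a : Fin n) i d → toℕ i ≡ suc (suc (toℕ a +ℕ d)) ⊎ suc (toℕ i +ℕ d) ≡ toℕ a → swapFin a i ≡ i
swapFin-far a i d far = swapFin-other a i i≢v i≢u
  where
  i≢v : i ≢ inject₁ a
  i≢v refl = case far of λ
    { (inj₁ e) → ℕP.m≢1+m+n (toℕ a) (trans (sym (FP.toℕ-inject₁ a)) (trans e (cong suc (sym (ℕP.+-suc (toℕ a) d)))))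
    ; (inj₂ e) → ℕP.m≢1+m+n (toℕ a) (trans (sym e) (cong (λ z → suc (z +ℕ d)) (FP.toℕ-inject₁ a))) }
  i≢u : i ≢ suc a
  i≢u refl = case far of λ
    { (inj₁ e) → ℕP.m≢1+m+n (toℕ a) (ℕP.suc-injective e)
    ; (inj₂ e) → ℕP.m≢1+m+n (toℕ a) (trans (sym e) (cong suc (sym (ℕP.+-suc (toℕ a) d)))) }

AdmissiblePair : ∀ {n} → SC n → Fin n → Fin n → Set
AdmissiblePair K u v = (∀ S → Dec (K S)) × IsComplex K × Admissible K u v

AdmissiblePair-swapAt : ∀ {n} (a : Fin n) {K : SC (suc n)} {u v} → AdmissiblePair K u v →
  AdmissiblePair (λ X → K (swapAt a X)) (swapFin a u) (swapFin a v)
AdmissiblePair-swapAt a (decK , cx , adm) = (λ S → decK (swapAt a S)) , IsComplex-swapAt a cx , Admissible-swapAt a adm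

ContractionPreserves : ∀ {n} → ℕ → SC n → Fin n → Fin n → Set
ContractionPreserves m K u v = HasPrimitive m K → HasPrimitive m (Contract u v K)

contraction-swapAt : ∀ {n} (a : Fin n) {m} {K : SC (suc n)} {u v} → 1 ≤ m →
  ContractionPreserves m (λ X → K (swapAt a X)) (swapFin a u) (swapFin a v) → ContractionPreserves m K u v
contraction-swapAt a {m} {K} {u} {v} 1≤m preserves prim =
  proj₁ swapped , Primitive-mono inclusion (proj₂ swapped)
  where
  K′ = Contract (swapFin a u) (swapFin a v) (λ X → K (swapAt a X))
  swapped = primitive-swapAt a K′ 1≤m (preserves (primitive-swapAt a K 1≤m prim))
  inclusion : ∀ X → Contract u v K X → K′ (swapAt a X)
  inclusion X c = Contract-swapAt a (swapAt a X) (subst (Contract u v K) (sym (swapAt-involutive a X)) c)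

contraction-down : ∀ d {n} {m} {K : SC (suc n)} {u v} → toℕ u ≡ suc (toℕ v +ℕ d) → 1 ≤ m →
  AdmissiblePair K u v → ContractionPreserves m K u v
contraction-down d {u = zero} ()
contraction-down zero {m = m} {K} {suc a} {v} e 1≤m (decK , cx , adm) =
  subst (ContractionPreserves m K (suc a)) v≡
      (primitive-adjacentContraction a K 1≤m decK cx (subst (Admissible K (suc a)) (sym v≡) adm))
  where
  v≡ : inject₁ a ≡ v
  v≡ = FP.toℕ-injective (trans (FP.toℕ-inject₁ a) (trans (ℕP.suc-injective e) (ℕP.+-identityʳ (toℕ v))))
contraction-down (suc d) {u = suc a} {v} e 1≤m ap =
  contraction-swapAt a 1≤m (contraction-down d distance 1≤m (AdmissiblePair-swapAt a ap))
  where
  a≡ : toℕ a ≡ suc (toℕ v +ℕ d)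
  a≡ = trans (ℕP.suc-injective e) (ℕP.+-suc (toℕ v) d)
  distance : toℕ (swapFin a (suc a)) ≡ suc (toℕ (swapFin a v) +ℕ d)
  distance = begin
    toℕ (swapFin a (suc a))       ≡⟨ cong toℕ (swapFin-suc a) ⟩
    toℕ (inject₁ a)               ≡⟨ FP.toℕ-inject₁ a ⟩
    toℕ a                         ≡⟨ a≡ ⟩
    suc (toℕ v +ℕ d)              ≡⟨ cong (λ z → suc (toℕ z +ℕ d)) (sym (swapFin-far a v d (inj₂ (sym a≡)))) ⟩
    suc (toℕ (swapFin a v) +ℕ d)  ∎
    where open ≡-Reasoning

toℕ-not-last : ∀ {n} (u v : Fin (suc n)) d → toℕ v ≡ suc (toℕ u +ℕ suc d) → n ≢ toℕ u
toℕ-not-last {n} u v d e n≡u = ℕP.<⇒≱ (FP.toℕ<n v) (begin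
  suc n                    ≡⟨ cong suc n≡u ⟩
  suc (toℕ u)              ≤⟨ ℕP.m≤m+n (suc (toℕ u)) (suc d) ⟩
  suc (toℕ u) +ℕ suc d     ≡⟨ sym e ⟩
  toℕ v                    ∎)
  where open ℕP.≤-Reasoning

contraction-up : ∀ d {n} {m} {K : SC (suc n)} {u v} → toℕ v ≡ suc (toℕ u +ℕ d) → 1 ≤ m →
  AdmissiblePair K u v → ContractionPreserves m K u v
contraction-up d {v = zero} ()
contraction-up zero {u = u} {suc a} e 1≤m ap =
  contraction-swapAt a 1≤m (contraction-down 0 distance 1≤m (AdmissiblePair-swapAt a ap))
  where
  u≡ : inject₁ a ≡ u
  u≡ = FP.toℕ-injective (trans (FP.toℕ-inject₁ a) (trans (ℕP.suc-injective e) (ℕP.+-identityʳ (toℕ u))))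
  distance : toℕ (swapFin a u) ≡ suc (toℕ (swapFin a (suc a)) +ℕ 0)
  distance = begin
    toℕ (swapFin a u)                    ≡⟨ cong (λ z → toℕ (swapFin a z)) (sym u≡) ⟩
    toℕ (swapFin a (inject₁ a))          ≡⟨ cong toℕ (swapFin-inject₁ a) ⟩
    suc (toℕ a)                          ≡⟨ cong suc (sym (FP.toℕ-inject₁ a)) ⟩
    suc (toℕ (inject₁ a))                ≡⟨ cong (λ z → suc (toℕ z)) (sym (swapFin-suc a)) ⟩
    suc (toℕ (swapFin a (suc a)))        ≡⟨ cong suc (sym (ℕP.+-identityʳ _)) ⟩
    suc (toℕ (swapFin a (suc a)) +ℕ 0)   ∎
    where open ≡-Reasoning
contraction-up (suc d) {n} {u = u} {v} e 1≤m ap =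
  subst (λ u′ → ContractionPreserves _ _ u′ v) (FP.inject₁-lower₁ u n≢u)
    (contraction-swapAt a 1≤m
        (contraction-up d distance 1≤m
            (AdmissiblePair-swapAt a (subst (λ u′ → AdmissiblePair _ u′ v) (sym (FP.inject₁-lower₁ u n≢u)) ap))))
  where
  n≢u = toℕ-not-last u v d e
  a = lower₁ u n≢u
  a≡ : toℕ a ≡ toℕ u
  a≡ = FP.toℕ-lower₁ u n≢u
  distance : toℕ (swapFin a v) ≡ suc (toℕ (swapFin a (inject₁ a)) +ℕ d)
  distance = begin
    toℕ (swapFin a v)
        ≡⟨ cong toℕ (swapFin-far a v d
            (inj₁ (trans e (cong suc (trans (ℕP.+-suc (toℕ u) d) (cong (λ z → suc (z +ℕ d)) (sym a≡))))))) ⟩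
    toℕ v                                  ≡⟨ e ⟩
    suc (toℕ u +ℕ suc d)                   ≡⟨ cong suc (ℕP.+-suc (toℕ u) d) ⟩
    suc (suc (toℕ u) +ℕ d)                 ≡⟨ cong (λ z → suc (suc z +ℕ d)) (sym a≡) ⟩
    suc (suc (toℕ a) +ℕ d)                 ≡⟨ cong (λ z → suc (toℕ z +ℕ d)) (sym (swapFin-inject₁ a)) ⟩
    suc (toℕ (swapFin a (inject₁ a)) +ℕ d) ∎
    where open ≡-Reasoning

primitive-contraction : ∀ {n} {m} {K : SC n} {u v} → 1 ≤ m → AdmissiblePair K u v → ContractionPreserves m K u v
primitive-contraction {zero} {u = ()}
primitive-contraction {suc n} {u = u} {v} 1≤m ap@(_ , _ , u≢v , _) with ℕP.<-cmp (toℕ u) (toℕ v)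
... | tri< u<v _ _ = contraction-up (toℕ v ∸ suc (toℕ u)) (sym (ℕP.m+[n∸m]≡n u<v)) 1≤m ap
... | tri≈ _ u≡v _ = ⊥-elim (u≢v (FP.toℕ-injective u≡v))
... | tri> _ _ v<u = contraction-down (toℕ u ∸ suc (toℕ v)) (sym (ℕP.m+[n∸m]≡n v<u)) 1≤m ap

¬¬-decidable : ∀ {n} (P : Subset n → Set) → ¬ ¬ (∀ S → Dec (P S))
¬¬-decidable {zero} P k = k (λ { [] → no (λ p → k (λ { [] → yes p })) })
¬¬-decidable {suc n} P k = ¬¬-decidable (λ S → P (true ∷ S)) (λ d1 → ¬¬-decidable (λ S → P (false ∷ S)) (λ d2 →
  k (λ { (true ∷ S) → d1 S ; (false ∷ S) → d2 S })))

vanishes-minor : ∀ {n} {m} {H K : SC n} → 1 ≤ m → H ≼ K → IsComplex K → Vanishes m K → ¬ ¬ Vanishes m H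
vanishes-minor 1≤m done cx vanishes = λ ¬vanishes → ¬vanishes vanishes
vanishes-minor {K = K} 1≤m (contract u v adm rest) cx vanishes ¬vanishes = ¬¬-decidable K λ decK →
  vanishes-minor 1≤m rest cx′
      (fromPrimitive cx′ (primitive-contraction 1≤m (decK , cx , adm) (toPrimitive cx vanishes))) ¬vanishes
  where
  cx′ = IsComplex-contract K u v cx (proj₁ adm)
vanishes-minor 1≤m (delete K′ cx′ K′⊆K rest) cx vanishes = vanishes-minor 1≤m rest cx′ (Vanishes-mono K′⊆K vanishes)

theorem4p2 : ∀ {n} (m : ℕ) (H K : SC n) →
    IsComplex H → IsComplex K → 1 ≤ m →
    H ≼ K → VKNonzero m H → VKNonzero m K
theorem4p2 m H K _ cxK 1≤m H≼K nonzeroH vanishesK = vanishes-minor 1≤m H≼K cxK vanishesK nonzeroH
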